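{- Let $D$ be the derivation of the polynomial ring $\mathbb{Q}[x,y,z]$ determined by $D(x)=xyz$, $D(y)=yz^2$, $D(z)=y^2z$ (i.e. $D$ is $\mathbb{Q}$-linear, satisfies the Leibniz rule $D(uv)=D(u)v+uD(v)$, and acts on the generators as indicated). Then for every $n\geq 1$, $$D^n(x)=x\sum_{\sigma\in\mathcal{Q}_n}y^{\mathrm{fap}(\sigma)}z^{2n-\mathrm{fap}(\sigma)}.$$ Consequently, for $n\ge 1$, $$\sum_{\pi\in B_n}x^{\mathrm{fdes}(\pi)}=\sum_{k=0}^n\binom{n}{k}\left(\sum_{\sigma\in\mathcal{Q}_{k}}x^{\mathrm{fap}(\sigma)}\right)\left(\sum_{\sigma\in\mathcal{Q}_{n-k}}x^{2\,\mathrm{ap}(\sigma)}\right).$$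
   Context: A Stirling permutation of order $n$ is a permutation $\sigma=\sigma_1\sigma_2\cdots\sigma_{2n}$ of the multiset $\{1,1,2,2,\ldots,n,n\}$ such that for each $i$, all entries between the two occurrences of $i$ are larger than $i$. $\mathcal{Q}_n$ denotes the set of Stirling permutations of order $n$; $\mathcal{Q}_0$ consists of the empty word only (with all statistics equal to $0$). An ascent-plateau of $\sigma\in\mathcal{Q}_n$ is an index $i\in\{2,3,\ldots,2n-1\}$ with $\sigma_{i-1}<\sigma_i=\sigma_{i+1}$; $\mathrm{ap}(\sigma)$ is the number of ascent-plateaus. The flag ascent-plateau number is $\mathrm{fap}(\sigma)=2\,\mathrm{ap}(\sigma)+1$ if $\sigma_1=\sigma_2$, and $\mathrm{fap}(\sigma)=2\,\mathrm{ap}(\sigma)$ otherwise. $B_n$ is the hyperoctahedral group of signed permutations $\pi=\pi(1)\cdots\pi(n)$ of $\pm[n]$ (with $\pi(-i)=-\pi(i)$). For $\pi\in B_n$, $\mathrm{des}_A(\pi)=\#\{i\in[n-1]:\pi(i)>\pi(i+1)\}$, and the flag descent number is $\mathrm{fdes}(\pi)=2\,\mathrm{des}_A(\pi)+1$ if $\pi(1)<0$, and $\mathrm{fdes}(\pi)=2\,\mathrm{des}_A(\pi)$ otherwise. -}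

module Defs where

open import Data.Bool using (Bool; true; false; _∧_; _∨_; if_then_else_; not)
open import Data.Nat as ℕ using (ℕ; zero; suc; _∸_; _<ᵇ_; _≡ᵇ_)
open import Data.Nat.Combinatorics using (_C_)
open import Data.Integer as ℤ using (ℤ; +_; -[1+_]; ∣_∣)
open import Data.Rational as ℚ using (ℚ; 0ℚ; 1ℚ)
open import Data.List using (List; []; _∷_; _++_; map; concatMap; filterᵇ; any; upTo; length; foldr; replicate)
open import Data.Product using (_×_; _,_)
open import Relation.Nullary using (does)
open import Relation.Binary.PropositionalEquality using (_≡_)

allᵇ : {A : Set} → (A → Bool) → List A → Bool
allᵇ p []      = true
allᵇ p (x ∷ xs) = p x ∧ allᵇ p xs

-- entry at (0-based) position i, with default 0 outside the word
at : List ℕ → ℕ → ℕ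
at []       _       = 0
at (a ∷ _)  zero    = a
at (_ ∷ w)  (suc i) = at w i

count : ℕ → List ℕ → ℕ
count a []      = 0
count a (b ∷ w) = if a ≡ᵇ b then suc (count a w) else count a w

words : ℕ → ℕ → List (List ℕ)
words n zero    = [] ∷ []
words n (suc L) = concatMap (λ a → map (a ∷_) (words n L)) (map suc (upTo n))

isMultisetPerm : ℕ → List ℕ → Bool
isMultisetPerm n w = allᵇ (λ i → count (suc i) w ≡ᵇ 2) (upTo n)
                     ∧ (length w ≡ᵇ 2 ℕ.* n)

-- for positions p < q < r with w_p = w_r we have w_q > w_p
-- (i.e. all entries between the two occurrences of any i exceed i)
stirlingCond : List ℕ → Bool
stirlingCond w =
  allᵇ (λ p → allᵇ (λ q → allᵇ (λ r →
        not ((p <ᵇ q) ∧ (q <ᵇ r) ∧ (at w p ≡ᵇ at w r)) ∨ (at w p <ᵇ at w q))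
      (upTo (length w))) (upTo (length w))) (upTo (length w))

𝒬 : ℕ → List (List ℕ)
𝒬 n = filterᵇ (λ w → isMultisetPerm n w ∧ stirlingCond w) (words n (2 ℕ.* n))

ap : List ℕ → ℕ
ap (a ∷ b ∷ c ∷ w) = (if (a <ᵇ b) ∧ (b ≡ᵇ c) then 1 else 0) ℕ.+ ap (b ∷ c ∷ w)
ap _               = 0

fap : List ℕ → ℕ
fap (a ∷ b ∷ w) = if a ≡ᵇ b then suc (2 ℕ.* ap (a ∷ b ∷ w)) else 2 ℕ.* ap (a ∷ b ∷ w)
fap w           = 2 ℕ.* ap w

-- Signed permutations B_n, written π(1)⋯π(n) as lists of nonzero integers

signedLetters : ℕ → List ℤ
signedLetters n = map (λ i → + suc i) (upTo n) ++ map (λ i → -[1+ i ]) (upTo n)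

signedWords : ℕ → ℕ → List (List ℤ)
signedWords n zero    = [] ∷ []
signedWords n (suc L) = concatMap (λ a → map (a ∷_) (signedWords n L)) (signedLetters n)

isSignedPerm : ℕ → List ℤ → Bool
isSignedPerm n π = allᵇ (λ i → count (suc i) (map ∣_∣ π) ≡ᵇ 1) (upTo n)
                   ∧ (length π ≡ᵇ n)

B : ℕ → List (List ℤ)
B n = filterᵇ (isSignedPerm n) (signedWords n n)

_<ℤᵇ_ : ℤ → ℤ → Bool
a <ℤᵇ b = does (a ℤ.<? b)

desA : List ℤ → ℕ
desA (a ∷ b ∷ w) = (if b <ℤᵇ a then 1 else 0) ℕ.+ desA (b ∷ w)
desA _           = 0

fdes : List ℤ → ℕ
fdes (a ∷ w) = if a <ℤᵇ (+ 0) then suc (2 ℕ.* desA (a ∷ w)) else 2 ℕ.* desA (a ∷ w)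
fdes []      = 0

-- Polynomials in ℚ[x,y,z]: formal sums of terms  q · x^a y^b z^c,
-- compared by their coefficients.

Poly : Set
Poly = List (ℚ × ℕ × ℕ × ℕ)

coeff : Poly → ℕ → ℕ → ℕ → ℚ
coeff []                    a b c = 0ℚ
coeff ((q , a' , b' , c') ∷ p) a b c =
  (if (a ≡ᵇ a') ∧ (b ≡ᵇ b') ∧ (c ≡ᵇ c') then q else 0ℚ) ℚ.+ coeff p a b c

infix 4 _≈_
_≈_ : Poly → Poly → Set
p ≈ q = ∀ a b c → coeff p a b c ≡ coeff q a b c

infixl 6 _⊕_
infixl 7 _⊗_

_⊕_ : Poly → Poly → Poly
p ⊕ q = p ++ q

_⊗_ : Poly → Poly → Poly
p ⊗ q = concatMap (λ { (r , a , b , c) →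
          map (λ { (s , a' , b' , c') → (r ℚ.* s , a ℕ.+ a' , b ℕ.+ b' , c ℕ.+ c') }) q }) p

scale : ℚ → Poly → Poly
scale r p = map (λ { (s , a , b , c) → (r ℚ.* s , a , b , c) }) p

𝟙 X Y Z : Poly
𝟙 = (1ℚ , 0 , 0 , 0) ∷ []
X = (1ℚ , 1 , 0 , 0) ∷ []
Y = (1ℚ , 0 , 1 , 0) ∷ []
Z = (1ℚ , 0 , 0 , 1) ∷ []

_^^_ : Poly → ℕ → Poly
p ^^ zero  = 𝟙
p ^^ suc k = p ⊗ (p ^^ k)

ΣP : List Poly → Poly
ΣP = foldr _⊕_ []

fromℕ : ℕ → ℚ
fromℕ n = (+ n) ℚ./ 1

record IsTheDerivation (D : Poly → Poly) : Set where
  field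
    D-cong    : ∀ p q → p ≈ q → D p ≈ D q
    D-add     : ∀ p q → D (p ⊕ q) ≈ D p ⊕ D q
    D-scale   : ∀ r p → D (scale r p) ≈ scale r (D p)
    D-leibniz : ∀ p q → D (p ⊗ q) ≈ D p ⊗ q ⊕ p ⊗ D q
    D-x       : D X ≈ X ⊗ Y ⊗ Z
    D-y       : D Y ≈ Y ⊗ Z ⊗ Z
    D-z       : D Z ≈ Y ⊗ Y ⊗ Z

iterate : (Poly → Poly) → ℕ → Poly → Poly
iterate D zero    p = p
iterate D (suc n) p = D (iterate D n p)

module Submission where

open import Defs
open import Data.Nat using (ℕ; suc; _∸_; _*_)
open import Data.Nat.Combinatorics using (_C_)
open import Data.List using (map; upTo)
open import Data.Product using (_×_; _,_)

-- Both parts of the theorem are proved by induction on n, using that the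
-- combinatorial objects of size n+1 arise uniquely from those of size n by
-- inserting the new largest letter: the pair (n+1)(n+1) into one of the 2n+1
-- gaps of a Stirling permutation, or ±(n+1) into one of the n+1 gaps of a signed
-- permutation.  Tracking how fap, ap and fdes change under these insertions gives,
-- for every test function G : ℕ → ℕ, recurrences
--   Σ_{𝒬 (n+1)} G(fap) = Σ_{𝒬 n} (fapStep n G)(fap),  and likewise for ap and fdes.
-- Part one: D acts on y^f z^g by the product rule, and comparing coefficients of
-- D(x · S_n) with x · S_{n+1} is exactly the recurrence for fap.
-- Part two: fdesStep is a "Leibniz rule" of fapStep and apStep, so with Pascal's
-- rule the binomial convolution satisfies the fdes recurrence; comparing
-- coefficients of x^a then gives the polynomial identity.
-- Polynomials are compared through their coefficients, which are natural numbers
-- throughout; NatPoly records them and turns the algebra into counting.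

module NatFacts where

  open import Defs using (fromℕ)
  open import Data.Bool using (Bool; true; false; _∧_; if_then_else_; T)
  open import Data.Unit using (tt)
  open import Data.Nat using (ℕ; zero; suc; _+_; _*_; _∸_; _<_; s≤s; _≡ᵇ_; _<ᵇ_)
  import Data.Nat.Properties as ℕP
  import Data.Integer as ℤ
  import Data.Integer.Properties as ℤP
  open import Data.Rational as ℚ using (1ℚ; toℚᵘ)
  import Data.Rational.Properties as ℚP
  import Data.Rational.Unnormalised as ℚᵘ
  import Data.Rational.Unnormalised.Properties as ℚᵘP
  open import Data.Product using (_×_; _,_)
  open import Relation.Binary.PropositionalEquality

  ≡ᵇ-refl : ∀ m → (m ≡ᵇ m) ≡ true
  ≡ᵇ-refl zero    = refl
  ≡ᵇ-refl (suc m) = ≡ᵇ-refl m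

  ≡ᵇ⇒≡ : ∀ {m n} → (m ≡ᵇ n) ≡ true → m ≡ n
  ≡ᵇ⇒≡ {m} {n} e = ℕP.≡ᵇ⇒≡ m n (subst T (sym e) tt)

  <ᵇ-irrefl : ∀ m → (m <ᵇ m) ≡ false
  <ᵇ-irrefl zero    = refl
  <ᵇ-irrefl (suc m) = <ᵇ-irrefl m

  <ᵇ⇒< : ∀ {m n} → (m <ᵇ n) ≡ true → m < n
  <ᵇ⇒< {m} {n} e = ℕP.<ᵇ⇒< m n (subst T (sym e) tt)

  <⇒<ᵇ : ∀ {m n} → m < n → (m <ᵇ n) ≡ true
  <⇒<ᵇ {zero}  {suc n} _       = refl
  <⇒<ᵇ {suc m} {suc n} (s≤s p) = <⇒<ᵇ p

  <⇒≢ᵇ : ∀ {m n} → m < n → (m ≡ᵇ n) ≡ false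
  <⇒≢ᵇ {zero}  {suc n} _       = refl
  <⇒≢ᵇ {suc m} {suc n} (s≤s p) = <⇒≢ᵇ p

  <⇒≮ᵇ : ∀ {m n} → m < n → (n <ᵇ m) ≡ false
  <⇒≮ᵇ {zero}  {suc n} _       = refl
  <⇒≮ᵇ {suc m} {suc n} (s≤s p) = <⇒≮ᵇ p

  ∧-true⁻ : ∀ {x y} → (x ∧ y) ≡ true → x ≡ true × y ≡ true
  ∧-true⁻ {true} {true} _ = refl , refl

  ∧-true⁺ : ∀ {x y} → x ≡ true → y ≡ true → (x ∧ y) ≡ true
  ∧-true⁺ refl refl = refl

  ind : Bool → ℕ
  ind x = if x then 1 else 0

  ∸-from : ∀ x y z → x + y ≡ z → z ∸ y ≡ x
  ∸-from x y z e = trans (cong (_∸ y) (sym e)) (ℕP.m+n∸n≡m x y)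

  2*suc : ∀ n → 2 * suc n ≡ suc (suc (2 * n))
  2*suc n = ℕP.*-suc 2 n

  fromℕ-suc : ∀ n → fromℕ (suc n) ≡ 1ℚ ℚ.+ fromℕ n
  fromℕ-suc n = ℚP.toℚᵘ-injective (begin
    toℚᵘ (fromℕ (suc n))                   ≈⟨ ℚP.toℚᵘ-fromℚᵘ (ℚᵘ.mkℚᵘ (ℤ.+ suc n) 0) ⟩
    ℚᵘ.mkℚᵘ (ℤ.+ suc n) 0                  ≈⟨ ℚᵘ.*≡* one+n ⟩
    ℚᵘ.mkℚᵘ (ℤ.+ 1) 0 ℚᵘ.+ ℚᵘ.mkℚᵘ (ℤ.+ n) 0
        ≈⟨ ℚᵘP.+-congʳ (ℚᵘ.mkℚᵘ (ℤ.+ 1) 0) (ℚᵘP.≃-sym (ℚP.toℚᵘ-fromℚᵘ (ℚᵘ.mkℚᵘ (ℤ.+ n) 0))) ⟩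
    toℚᵘ 1ℚ ℚᵘ.+ toℚᵘ (fromℕ n)            ≈⟨ ℚᵘP.≃-sym (ℚP.toℚᵘ-homo-+ 1ℚ (fromℕ n)) ⟩
    toℚᵘ (1ℚ ℚ.+ fromℕ n)                  ∎)
    where
    open import Relation.Binary.Reasoning.Setoid ℚᵘP.≃-setoid
    one+n : ℤ.+ suc n ℤ.* ℤ.+ 1 ≡ (ℤ.+ 1 ℤ.* ℤ.+ 1 ℤ.+ ℤ.+ n ℤ.* ℤ.+ 1) ℤ.* ℤ.+ 1
    one+n = trans (ℤP.*-identityʳ (ℤ.+ suc n))
      (sym (trans (ℤP.*-identityʳ _) (cong (λ t → ℤ.+ 1 ℤ.+ t) (ℤP.*-identityʳ (ℤ.+ n)))))

  fromℕ-+ : ∀ m n → fromℕ (m + n) ≡ fromℕ m ℚ.+ fromℕ n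
  fromℕ-+ zero    n = sym (ℚP.+-identityˡ (fromℕ n))
  fromℕ-+ (suc m) n = begin
    fromℕ (suc (m + n))              ≡⟨ fromℕ-suc (m + n) ⟩
    1ℚ ℚ.+ fromℕ (m + n)             ≡⟨ cong (1ℚ ℚ.+_) (fromℕ-+ m n) ⟩
    1ℚ ℚ.+ (fromℕ m ℚ.+ fromℕ n)     ≡⟨ ℚP.+-assoc 1ℚ (fromℕ m) (fromℕ n) ⟨
    (1ℚ ℚ.+ fromℕ m) ℚ.+ fromℕ n     ≡⟨ cong (ℚ._+ fromℕ n) (fromℕ-suc m) ⟨
    fromℕ (suc m) ℚ.+ fromℕ n        ∎
    where open ≡-Reasoning

  fromℕ-* : ∀ m n → fromℕ (m * n) ≡ fromℕ m ℚ.* fromℕ n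
  fromℕ-* zero    n = sym (ℚP.*-zeroˡ (fromℕ n))
  fromℕ-* (suc m) n = begin
    fromℕ (n + m * n)                        ≡⟨ fromℕ-+ n (m * n) ⟩
    fromℕ n ℚ.+ fromℕ (m * n)                ≡⟨ cong (fromℕ n ℚ.+_) (fromℕ-* m n) ⟩
    fromℕ n ℚ.+ fromℕ m ℚ.* fromℕ n          ≡⟨ cong (ℚ._+ fromℕ m ℚ.* fromℕ n) (ℚP.*-identityˡ (fromℕ n)) ⟨
    1ℚ ℚ.* fromℕ n ℚ.+ fromℕ m ℚ.* fromℕ n   ≡⟨ ℚP.*-distribʳ-+ (fromℕ n) 1ℚ (fromℕ m) ⟨
    (1ℚ ℚ.+ fromℕ m) ℚ.* fromℕ n             ≡⟨ cong (ℚ._* fromℕ n) (fromℕ-suc m) ⟨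
    fromℕ (suc m) ℚ.* fromℕ n                ∎
    where open ≡-Reasoning

module FiniteSums where

  open import Defs using (fromℕ)
  open NatFacts using (fromℕ-+)
  open import Data.Nat using (ℕ; zero; suc; _+_; _*_; _<_; z≤n; s≤s)
  import Data.Nat.Properties as ℕP
  open import Data.Nat.ListAction using (sum)
  open import Data.Nat.ListAction.Properties using (sum-↭)
  open import Data.Nat.Tactic.RingSolver using (solve-∀)
  open import Data.Rational as ℚ using (ℚ; 0ℚ)
  import Data.Rational.Properties as ℚP
  open import Data.List using (List; []; _∷_; _++_; map; concatMap; foldr; applyUpTo)
  import Data.List.Properties as LP
  open import Data.List.Membership.Propositional using (_∈_; lose; find)
  open import Data.List.Membership.Propositional.Properties using (∈-++⁻; ∈-concatMap⁺; ∈-concatMap⁻)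
  open import Data.List.Relation.Unary.Any using (here; there)
  open import Data.List.Relation.Unary.All using (All; []; _∷_)
  open import Data.List.Relation.Unary.Unique.Propositional using (Unique)
  import Data.List.Relation.Unary.Unique.Propositional.Properties as UniqueP
  open import Data.List.Relation.Unary.AllPairs using ([]; _∷_)
  open import Data.List.Relation.Binary.Permutation.Propositional using (_↭_)
  import Data.List.Relation.Binary.Permutation.Propositional.Properties as PermP
  open import Data.List.Membership.Propositional.Properties.WithK using (unique∧set⇒bag)
  open import Data.List.Relation.Binary.BagAndSetEquality using (∼bag⇒↭)
  open import Function.Bundles using (mk⇔)
  open import Data.Product using (Σ; _×_; _,_)
  open import Data.Sum using (inj₁; inj₂)
  open import Data.Empty using (⊥)
  open import Relation.Binary.PropositionalEquality

  sumOf : {A : Set} → (A → ℕ) → List A → ℕ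
  sumOf g L = sum (map g L)

  sumOf-cong-∈ : ∀ {A : Set} (g h : A → ℕ) L → (∀ x → x ∈ L → g x ≡ h x) → sumOf g L ≡ sumOf h L
  sumOf-cong-∈ g h []      E = refl
  sumOf-cong-∈ g h (x ∷ L) E = cong₂ _+_ (E x (here refl)) (sumOf-cong-∈ g h L (λ y m → E y (there m)))

  sumOf-cong : ∀ {A : Set} {g h : A → ℕ} → (∀ x → g x ≡ h x) → ∀ L → sumOf g L ≡ sumOf h L
  sumOf-cong E L = cong sum (LP.map-cong E L)

  sumOf-map : ∀ {A B : Set} (g : B → ℕ) (f : A → B) L → sumOf g (map f L) ≡ sumOf (λ x → g (f x)) L
  sumOf-map g f L = cong sum (sym (LP.map-∘ L))

  sumOf-+ : ∀ {A : Set} (g h : A → ℕ) L → sumOf (λ x → g x + h x) L ≡ sumOf g L + sumOf h L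
  sumOf-+ g h []      = refl
  sumOf-+ g h (x ∷ L) = trans (cong (g x + h x +_) (sumOf-+ g h L)) (swap (g x) (h x) _ _)
    where
    swap : ∀ a b c d → a + b + (c + d) ≡ a + c + (b + d)
    swap = solve-∀

  sumOf-zero : ∀ {A : Set} (L : List A) → sumOf (λ _ → 0) L ≡ 0
  sumOf-zero []      = refl
  sumOf-zero (x ∷ L) = sumOf-zero L

  sumOf-swap : ∀ {A B : Set} (f : A → B → ℕ) xs ys →
    sumOf (λ x → sumOf (f x) ys) xs ≡ sumOf (λ y → sumOf (λ x → f x y) xs) ys
  sumOf-swap f []       ys = sym (sumOf-zero ys)
  sumOf-swap f (x ∷ xs) ys = trans (cong (sumOf (f x) ys +_) (sumOf-swap f xs ys))
    (sym (sumOf-+ (f x) (λ y → sumOf (λ x → f x y) xs) ys))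

  sumOf-++ : ∀ {A : Set} (g : A → ℕ) xs ys → sumOf g (xs ++ ys) ≡ sumOf g xs + sumOf g ys
  sumOf-++ g []       ys = refl
  sumOf-++ g (x ∷ xs) ys = trans (cong (g x +_) (sumOf-++ g xs ys)) (sym (ℕP.+-assoc (g x) _ _))

  sumOf-concatMap : ∀ {A B : Set} (g : B → ℕ) (f : A → List B) xs →
    sumOf g (concatMap f xs) ≡ sumOf (λ x → sumOf g (f x)) xs
  sumOf-concatMap g f []       = refl
  sumOf-concatMap g f (x ∷ xs) = trans (sumOf-++ g (f x) (concatMap f xs)) (cong (sumOf g (f x) +_) (sumOf-concatMap g f xs))

  -- A sum over a duplicate-free list only depends on the set of its entries.
  -- This is how bijective descriptions of 𝒬 (n+1) and B (n+1) become sum identities.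
  sumOf-sameSet : ∀ {A : Set} {xs ys : List A} → Unique xs → Unique ys →
    (∀ {x} → x ∈ xs → x ∈ ys) → (∀ {x} → x ∈ ys → x ∈ xs) → ∀ (g : A → ℕ) → sumOf g xs ≡ sumOf g ys
  sumOf-sameSet ux uy to from g =
    sum-↭ (PermP.map⁺ g (∼bag⇒↭ (unique∧set⇒bag ux uy (λ {x} → mk⇔ (to {x}) (from {x})))))

  unique-concatMap : ∀ {A B : Set} (f : A → List B) xs →
    (∀ {x x' y} → x ∈ xs → x' ∈ xs → y ∈ f x → y ∈ f x' → x ≡ x') →
    Unique xs → (∀ {x} → x ∈ xs → Unique (f x)) → Unique (concatMap f xs)
  unique-concatMap f []       D u        U = []
  unique-concatMap f (x ∷ xs) D (x∉ ∷ u) U =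
    UniqueP.++⁺ (U (here refl))
      (unique-concatMap f xs (λ m m' → D (there m) (there m')) u (λ m → U (there m)))
      (λ (m1 , m2) → disjoint xs x∉ (λ m → there m) m1 m2)
    where
    disjoint : ∀ {v} ys → All (x ≢_) ys → (∀ {y} → y ∈ ys → y ∈ x ∷ xs) →
      v ∈ f x → v ∈ concatMap f ys → ⊥
    disjoint (y ∷ ys) (x≢y ∷ a) sub mx m with ∈-++⁻ (f y) m
    ... | inj₁ my = x≢y (D (here refl) (sub (here refl)) mx my)
    ... | inj₂ m' = disjoint ys a (λ mm → sub (there mm)) mx m'

  sumOf-generated : ∀ {A B : Set} (old : List A) (new : List B) (grow : A → List B) →
    Unique old → Unique new → (∀ {τ} → τ ∈ old → Unique (grow τ)) →
    (∀ {τ τ' σ} → τ ∈ old → τ' ∈ old → σ ∈ grow τ → σ ∈ grow τ' → τ ≡ τ') →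
    (∀ {τ σ} → τ ∈ old → σ ∈ grow τ → σ ∈ new) →
    (∀ {σ} → σ ∈ new → Σ A λ τ → τ ∈ old × σ ∈ grow τ) →
    ∀ g → sumOf g new ≡ sumOf (λ τ → sumOf g (grow τ)) old
  sumOf-generated old new grow uo un ug D into onto g =
    trans (sumOf-sameSet un (unique-concatMap grow old D uo ug) to from g) (sumOf-concatMap g grow old)
    where
    to : ∀ {σ} → σ ∈ new → σ ∈ concatMap grow old
    to m with onto m
    ... | τ , mτ , mσ = ∈-concatMap⁺ grow (lose {P = λ τ → _ ∈ grow τ} mτ mσ)
    from : ∀ {σ} → σ ∈ concatMap grow old → σ ∈ new
    from m with find (∈-concatMap⁻ grow {xs = old} m)
    ... | τ , mτ , mσ = into mτ mσ

  sumBelow : ℕ → (ℕ → ℕ) → ℕ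
  sumBelow zero    h = 0
  sumBelow (suc N) h = h 0 + sumBelow N (λ k → h (suc k))

  sumBelow-cong : ∀ N {h h' : ℕ → ℕ} → (∀ k → k < N → h k ≡ h' k) → sumBelow N h ≡ sumBelow N h'
  sumBelow-cong zero    E = refl
  sumBelow-cong (suc N) E = cong₂ _+_ (E 0 (s≤s z≤n)) (sumBelow-cong N (λ k k< → E (suc k) (s≤s k<)))

  sumBelow-+ : ∀ N (h h' : ℕ → ℕ) → sumBelow N (λ k → h k + h' k) ≡ sumBelow N h + sumBelow N h'
  sumBelow-+ zero    h h' = refl
  sumBelow-+ (suc N) h h' = trans (cong (h 0 + h' 0 +_) (sumBelow-+ N (λ k → h (suc k)) (λ k → h' (suc k))))
    (swap (h 0) (h' 0) _ _)
    where
    swap : ∀ a b c d → a + b + (c + d) ≡ a + c + (b + d)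
    swap = solve-∀

  sumBelow-last : ∀ N (h : ℕ → ℕ) → sumBelow (suc N) h ≡ sumBelow N h + h N
  sumBelow-last zero    h = ℕP.+-identityʳ (h 0)
  sumBelow-last (suc N) h = trans (cong (h 0 +_) (sumBelow-last N (λ k → h (suc k)))) (sym (ℕP.+-assoc (h 0) _ _))

  sumOf-applyUpTo : ∀ (h : ℕ → ℕ) (f : ℕ → ℕ) N → sumOf h (applyUpTo f N) ≡ sumBelow N (λ k → h (f k))
  sumOf-applyUpTo h f zero    = refl
  sumOf-applyUpTo h f (suc N) = cong (h (f 0) +_) (sumOf-applyUpTo h (λ k → f (suc k)) N)

  sumℚ : List ℚ → ℚ
  sumℚ = foldr ℚ._+_ 0ℚ

  sumℚ-cong : ∀ {A : Set} {g h : A → ℚ} → (∀ x → g x ≡ h x) → ∀ xs → sumℚ (map g xs) ≡ sumℚ (map h xs)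
  sumℚ-cong E xs = cong sumℚ (LP.map-cong E xs)

  sumℚ-+ : ∀ {A : Set} (g h : A → ℚ) xs →
    sumℚ (map (λ x → g x ℚ.+ h x) xs) ≡ sumℚ (map g xs) ℚ.+ sumℚ (map h xs)
  sumℚ-+ g h []       = sym (ℚP.+-identityˡ 0ℚ)
  sumℚ-+ g h (x ∷ xs) = trans (cong (g x ℚ.+ h x ℚ.+_) (sumℚ-+ g h xs)) (swap (g x) (h x) _ _)
    where
    swap : ∀ a b c d → (a ℚ.+ b) ℚ.+ (c ℚ.+ d) ≡ (a ℚ.+ c) ℚ.+ (b ℚ.+ d)
    swap a b c d = begin
      (a ℚ.+ b) ℚ.+ (c ℚ.+ d) ≡⟨ ℚP.+-assoc a b (c ℚ.+ d) ⟩
      a ℚ.+ (b ℚ.+ (c ℚ.+ d)) ≡⟨ cong (a ℚ.+_) (sym (ℚP.+-assoc b c d)) ⟩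
      a ℚ.+ ((b ℚ.+ c) ℚ.+ d) ≡⟨ cong (λ t → a ℚ.+ (t ℚ.+ d)) (ℚP.+-comm b c) ⟩
      a ℚ.+ ((c ℚ.+ b) ℚ.+ d) ≡⟨ cong (a ℚ.+_) (ℚP.+-assoc c b d) ⟩
      a ℚ.+ (c ℚ.+ (b ℚ.+ d)) ≡⟨ sym (ℚP.+-assoc a c (b ℚ.+ d)) ⟩
      (a ℚ.+ c) ℚ.+ (b ℚ.+ d) ∎
      where open ≡-Reasoning

  sumℚ-zero : ∀ {A : Set} (xs : List A) → sumℚ (map (λ _ → 0ℚ) xs) ≡ 0ℚ
  sumℚ-zero []       = refl
  sumℚ-zero (x ∷ xs) = trans (ℚP.+-identityˡ _) (sumℚ-zero xs)

  sumℚ-swap : ∀ {A B : Set} (f : A → B → ℚ) xs ys →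
    sumℚ (map (λ x → sumℚ (map (f x) ys)) xs) ≡ sumℚ (map (λ y → sumℚ (map (λ x → f x y) xs)) ys)
  sumℚ-swap f []       ys = sym (sumℚ-zero ys)
  sumℚ-swap f (x ∷ xs) ys = trans (cong (sumℚ (map (f x) ys) ℚ.+_) (sumℚ-swap f xs ys))
    (sym (sumℚ-+ (f x) (λ y → sumℚ (map (λ x → f x y) xs)) ys))

  sumℚ-fromℕ : ∀ {A : Set} (h : A → ℕ) xs → sumℚ (map (λ x → fromℕ (h x)) xs) ≡ fromℕ (sumOf h xs)
  sumℚ-fromℕ h []       = refl
  sumℚ-fromℕ h (x ∷ xs) = trans (cong (fromℕ (h x) ℚ.+_) (sumℚ-fromℕ h xs)) (sym (fromℕ-+ (h x) (sumOf h xs)))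

module Polynomials where

  open import Defs
  open FiniteSums using (sumℚ; sumℚ-cong; sumℚ-swap)
  open import Data.Bool using (Bool; true; false; _∧_; if_then_else_)
  open import Data.Nat as ℕ using (ℕ; zero; suc; _≡ᵇ_)
  import Data.Nat.Properties as ℕP
  open import Data.Rational as ℚ using (ℚ; 0ℚ)
  import Data.Rational.Properties as ℚP
  open import Data.List using ([]; _∷_; _++_; map)
  import Data.List.Properties as LP
  open import Data.Maybe using (Maybe; just; nothing)
  open import Data.Product using (_×_; _,_)
  open import Relation.Binary.PropositionalEquality

  Term : Set
  Term = ℚ × ℕ × ℕ × ℕ

  ≈-trans : ∀ {p q r} → p ≈ q → q ≈ r → p ≈ r
  ≈-trans e f a b c = trans (e a b c) (f a b c)

  coeff-++ : ∀ p q a b c → coeff (p ++ q) a b c ≡ coeff p a b c ℚ.+ coeff q a b c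
  coeff-++ []                       q a b c = sym (ℚP.+-identityˡ _)
  coeff-++ ((r , a' , b' , c') ∷ p) q a b c =
    trans (cong (h ℚ.+_) (coeff-++ p q a b c)) (sym (ℚP.+-assoc h (coeff p a b c) (coeff q a b c)))
    where h = if (a ≡ᵇ a') ∧ (b ≡ᵇ b') ∧ (c ≡ᵇ c') then r else 0ℚ

  coeff-ΣP : ∀ ps a b c → coeff (ΣP ps) a b c ≡ sumℚ (map (λ p → coeff p a b c) ps)
  coeff-ΣP []       a b c = refl
  coeff-ΣP (p ∷ ps) a b c = trans (coeff-++ p (ΣP ps) a b c) (cong (coeff p a b c ℚ.+_) (coeff-ΣP ps a b c))

  coeff-scale : ∀ r p a b c → coeff (scale r p) a b c ≡ r ℚ.* coeff p a b c
  coeff-scale r []                       a b c = sym (ℚP.*-zeroʳ r)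
  coeff-scale r ((s , a' , b' , c') ∷ p) a b c =
    trans (cong₂ ℚ._+_ (if-* ((a ≡ᵇ a') ∧ (b ≡ᵇ b') ∧ (c ≡ᵇ c'))) (coeff-scale r p a b c))
          (sym (ℚP.*-distribˡ-+ r _ _))
    where
    if-* : ∀ x → (if x then r ℚ.* s else 0ℚ) ≡ r ℚ.* (if x then s else 0ℚ)
    if-* true  = refl
    if-* false = sym (ℚP.*-zeroʳ r)

  termProductCoeff : Term → Term → ℕ → ℕ → ℕ → ℚ
  termProductCoeff (r , a1 , b1 , c1) (s , a2 , b2 , c2) a b c =
    if (a ≡ᵇ a1 ℕ.+ a2) ∧ (b ≡ᵇ b1 ℕ.+ b2) ∧ (c ≡ᵇ c1 ℕ.+ c2) then r ℚ.* s else 0ℚ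

  termProductCoeff-comm : ∀ t s a b c → termProductCoeff t s a b c ≡ termProductCoeff s t a b c
  termProductCoeff-comm (r , a1 , b1 , c1) (s , a2 , b2 , c2) a b c
    rewrite ℕP.+-comm a1 a2 | ℕP.+-comm b1 b2 | ℕP.+-comm c1 c2 | ℚP.*-comm r s = refl

  coeff-⊗ : ∀ p q a b c →
    coeff (p ⊗ q) a b c ≡ sumℚ (map (λ t → sumℚ (map (λ s → termProductCoeff t s a b c) q)) p)
  coeff-⊗ []                        q a b c = refl
  coeff-⊗ ((r , a1 , b1 , c1) ∷ p) q a b c =
    trans (coeff-++ (map _ q) (p ⊗ q) a b c) (cong₂ ℚ._+_ (row q) (coeff-⊗ p q a b c))
    where
    row : ∀ q → coeff (map (λ { (s , a' , b' , c') → (r ℚ.* s , a1 ℕ.+ a' , b1 ℕ.+ b' , c1 ℕ.+ c') }) q) a b c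
                 ≡ sumℚ (map (λ s → termProductCoeff (r , a1 , b1 , c1) s a b c) q)
    row []                        = refl
    row ((s , a2 , b2 , c2) ∷ q) = cong (termProductCoeff (r , a1 , b1 , c1) (s , a2 , b2 , c2) a b c ℚ.+_) (row q)

  ⊗-comm : ∀ p q → p ⊗ q ≈ q ⊗ p
  ⊗-comm p q a b c = begin
    coeff (p ⊗ q) a b c
      ≡⟨ coeff-⊗ p q a b c ⟩
    sumℚ (map (λ t → sumℚ (map (λ s → termProductCoeff t s a b c) q)) p)
      ≡⟨ sumℚ-swap (λ t s → termProductCoeff t s a b c) p q ⟩
    sumℚ (map (λ s → sumℚ (map (λ t → termProductCoeff t s a b c) p)) q)
      ≡⟨ sumℚ-cong (λ s → sumℚ-cong (λ t → termProductCoeff-comm t s a b c) p) q ⟩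
    sumℚ (map (λ s → sumℚ (map (λ t → termProductCoeff s t a b c) p)) q)
      ≡⟨ coeff-⊗ q p a b c ⟨
    coeff (q ⊗ p) a b c ∎
    where open ≡-Reasoning

  -- Shifted evaluation: 'shifted z h a' b' c' a b c' is h (a-a') (b-b') (c-c')
  -- when all three differences are natural numbers, and the default z otherwise.
  -- Multiplying by the monomial x^a' y^b' z^c' shifts coefficients in exactly this way.

  _∸?_ : ℕ → ℕ → Maybe ℕ
  a     ∸? zero   = just a
  zero  ∸? suc a' = nothing
  suc a ∸? suc a' = a ∸? a'

  ∸?-just : ∀ a a' d x → a ∸? a' ≡ just d → (a ≡ᵇ a' ℕ.+ x) ≡ (d ≡ᵇ x)
  ∸?-just a       zero     d x refl = refl
  ∸?-just (suc a) (suc a') d x e    = ∸?-just a a' d x e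

  ∸?-nothing : ∀ a a' x → a ∸? a' ≡ nothing → (a ≡ᵇ a' ℕ.+ x) ≡ false
  ∸?-nothing zero    (suc a') x e = refl
  ∸?-nothing (suc a) (suc a') x e = ∸?-nothing a a' x e

  shiftedBy : {A : Set} → A → (ℕ → ℕ → ℕ → A) → Maybe ℕ → Maybe ℕ → Maybe ℕ → A
  shiftedBy z h (just d) (just e) (just f) = h d e f
  shiftedBy z h _        _        _        = z

  shifted : {A : Set} → A → (ℕ → ℕ → ℕ → A) → ℕ → ℕ → ℕ → ℕ → ℕ → ℕ → A
  shifted z h a' b' c' a b c = shiftedBy z h (a ∸? a') (b ∸? b') (c ∸? c')

  shifted-map : ∀ {A B : Set} (g : A → B) {z z'} → g z ≡ z' → ∀ h a' b' c' a b c →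
    g (shifted z h a' b' c' a b c) ≡ shifted z' (λ d e f → g (h d e f)) a' b' c' a b c
  shifted-map g gz h a' b' c' a b c with a ∸? a' | b ∸? b' | c ∸? c'
  ... | just d  | just e  | just f  = refl
  ... | nothing | _       | _       = gz
  ... | just _  | nothing | _       = gz
  ... | just _  | just _  | nothing = gz

  shifted-zip : ∀ {A B C : Set} (op : A → B → C) {z z' z''} → op z z' ≡ z'' → ∀ h k a' b' c' a b c →
    op (shifted z h a' b' c' a b c) (shifted z' k a' b' c' a b c)
      ≡ shifted z'' (λ d e f → op (h d e f) (k d e f)) a' b' c' a b c
  shifted-zip op oz h k a' b' c' a b c with a ∸? a' | b ∸? b' | c ∸? c'
  ... | just d  | just e  | just f  = refl
  ... | nothing | _       | _       = oz
  ... | just _  | nothing | _       = oz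
  ... | just _  | just _  | nothing = oz

  shifted-cong : ∀ {A : Set} {z : A} {h h' : ℕ → ℕ → ℕ → A} → (∀ d e f → h d e f ≡ h' d e f) →
    ∀ a' b' c' a b c → shifted z h a' b' c' a b c ≡ shifted z h' a' b' c' a b c
  shifted-cong E a' b' c' a b c with a ∸? a' | b ∸? b' | c ∸? c'
  ... | just d  | just e  | just f  = E d e f
  ... | nothing | _       | _       = refl
  ... | just _  | nothing | _       = refl
  ... | just _  | just _  | nothing = refl

  shifted-const : ∀ {A : Set} (z : A) a' b' c' a b c → shifted z (λ _ _ _ → z) a' b' c' a b c ≡ z
  shifted-const z a' b' c' a b c with a ∸? a' | b ∸? b' | c ∸? c'
  ... | just d  | just e  | just f  = refl
  ... | nothing | _       | _       = refl
  ... | just _  | nothing | _       = refl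
  ... | just _  | just _  | nothing = refl

  ∧-false₂ : ∀ x z → (x ∧ false ∧ z) ≡ false
  ∧-false₂ true  z = refl
  ∧-false₂ false z = refl

  ∧-false₃ : ∀ x y → (x ∧ y ∧ false) ≡ false
  ∧-false₃ true  true  = refl
  ∧-false₃ true  false = refl
  ∧-false₃ false y     = refl

  data ShiftView (a' b' c' a b c : ℕ) : Set where
    allDefined : ∀ d e f → a ∸? a' ≡ just d → b ∸? b' ≡ just e → c ∸? c' ≡ just f → ShiftView a' b' c' a b c
    aUndefined : a ∸? a' ≡ nothing → ShiftView a' b' c' a b c
    bUndefined : b ∸? b' ≡ nothing → ShiftView a' b' c' a b c
    cUndefined : c ∸? c' ≡ nothing → ShiftView a' b' c' a b c

  shiftView : ∀ a' b' c' a b c → ShiftView a' b' c' a b c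
  shiftView a' b' c' a b c with a ∸? a' in ea | b ∸? b' in eb | c ∸? c' in ec
  ... | just d  | just e  | just f  = allDefined d e f ea eb ec
  ... | nothing | _       | _       = aUndefined ea
  ... | just _  | nothing | _       = bUndefined eb
  ... | just _  | just _  | nothing = cUndefined ec

  exponentTest-shifted : ∀ a' b' c' x y z a b c →
    ((a ≡ᵇ a' ℕ.+ x) ∧ (b ≡ᵇ b' ℕ.+ y) ∧ (c ≡ᵇ c' ℕ.+ z))
      ≡ shifted false (λ d e f → (d ≡ᵇ x) ∧ (e ≡ᵇ y) ∧ (f ≡ᵇ z)) a' b' c' a b c
  exponentTest-shifted a' b' c' x y z a b c with shiftView a' b' c' a b c
  ... | allDefined d e f ea eb ec
    rewrite ea | eb | ec | ∸?-just a a' d x ea | ∸?-just b b' e y eb | ∸?-just c c' f z ec = refl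
  ... | aUndefined ea rewrite ea | ∸?-nothing a a' x ea = refl
  ... | bUndefined eb rewrite eb | ∸?-nothing b b' y eb =
    trans (∧-false₂ (a ≡ᵇ a' ℕ.+ x) (c ≡ᵇ c' ℕ.+ z)) (sym (undefined₂ (a ∸? a') (c ∸? c')))
    where
    undefined₂ : ∀ m k → shiftedBy false (λ d e f → (d ≡ᵇ x) ∧ (e ≡ᵇ y) ∧ (f ≡ᵇ z)) m nothing k ≡ false
    undefined₂ (just _) k = refl
    undefined₂ nothing  k = refl
  ... | cUndefined ec rewrite ec | ∸?-nothing c c' z ec =
    trans (∧-false₃ (a ≡ᵇ a' ℕ.+ x) (b ≡ᵇ b' ℕ.+ y)) (sym (undefined₃ (a ∸? a') (b ∸? b')))
    where
    undefined₃ : ∀ m k → shiftedBy false (λ d e f → (d ≡ᵇ x) ∧ (e ≡ᵇ y) ∧ (f ≡ᵇ z)) m k nothing ≡ false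
    undefined₃ (just _) (just _) = refl
    undefined₃ (just _) nothing  = refl
    undefined₃ nothing  k        = refl

  coeff-term⊗ : ∀ r a' b' c' q a b c →
    coeff (((r , a' , b' , c') ∷ []) ⊗ q) a b c ≡ r ℚ.* shifted 0ℚ (coeff q) a' b' c' a b c
  coeff-term⊗ r a' b' c' q a b c = trans (coeff-++ (map _ q) [] a b c) (trans (ℚP.+-identityʳ _) (row q))
    where
    open ≡-Reasoning
    row : ∀ q → coeff (map (λ { (s , a2 , b2 , c2) → (r ℚ.* s , a' ℕ.+ a2 , b' ℕ.+ b2 , c' ℕ.+ c2) }) q) a b c
                ≡ r ℚ.* shifted 0ℚ (coeff q) a' b' c' a b c
    row [] = sym (trans (cong (r ℚ.*_) (shifted-const 0ℚ a' b' c' a b c)) (ℚP.*-zeroʳ r))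
    row ((s , a2 , b2 , c2) ∷ q) = begin
      (if test then r ℚ.* s else 0ℚ) ℚ.+ _
        ≡⟨ cong₂ ℚ._+_ (trans (cong (λ t → if t then r ℚ.* s else 0ℚ) (exponentTest-shifted a' b' c' a2 b2 c2 a b c))
                              (shifted-map (λ t → if t then r ℚ.* s else 0ℚ) refl _ a' b' c' a b c))
                       (trans (row q) (shifted-map (r ℚ.*_) (ℚP.*-zeroʳ r) (coeff q) a' b' c' a b c)) ⟩
      shifted 0ℚ (λ d e f → if M d e f then r ℚ.* s else 0ℚ) a' b' c' a b c
        ℚ.+ shifted 0ℚ (λ d e f → r ℚ.* coeff q d e f) a' b' c' a b c
        ≡⟨ shifted-zip ℚ._+_ (ℚP.+-identityʳ 0ℚ) _ _ a' b' c' a b c ⟩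
      shifted 0ℚ (λ d e f → (if M d e f then r ℚ.* s else 0ℚ) ℚ.+ r ℚ.* coeff q d e f) a' b' c' a b c
        ≡⟨ shifted-cong (λ d e f → trans (cong (ℚ._+ r ℚ.* coeff q d e f) (if-* (M d e f)))
                                         (sym (ℚP.*-distribˡ-+ r _ _))) a' b' c' a b c ⟩
      shifted 0ℚ (λ d e f → r ℚ.* coeff ((s , a2 , b2 , c2) ∷ q) d e f) a' b' c' a b c
        ≡⟨ shifted-map (r ℚ.*_) (ℚP.*-zeroʳ r) (coeff ((s , a2 , b2 , c2) ∷ q)) a' b' c' a b c ⟨
      r ℚ.* shifted 0ℚ (coeff ((s , a2 , b2 , c2) ∷ q)) a' b' c' a b c ∎
      where
      test : Bool
      test = (a ≡ᵇ a' ℕ.+ a2) ∧ (b ≡ᵇ b' ℕ.+ b2) ∧ (c ≡ᵇ c' ℕ.+ c2)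
      M : ℕ → ℕ → ℕ → Bool
      M d e f = (d ≡ᵇ a2) ∧ (e ≡ᵇ b2) ∧ (f ≡ᵇ c2)
      if-* : ∀ t → (if t then r ℚ.* s else 0ℚ) ≡ r ℚ.* (if t then s else 0ℚ)
      if-* true  = refl
      if-* false = sym (ℚP.*-zeroʳ r)

  ⊗-cons : ∀ t p q → (t ∷ p) ⊗ q ≡ ((t ∷ []) ⊗ q) ++ (p ⊗ q)
  ⊗-cons t p q = cong (_++ (p ⊗ q)) (sym (LP.++-identityʳ _))

  ⊗-congʳ : ∀ p {q q'} → q ≈ q' → p ⊗ q ≈ p ⊗ q'
  ⊗-congʳ []                        e a b c = refl
  ⊗-congʳ ((r , a' , b' , c') ∷ p) {q} {q'} e a b c = begin
    coeff (((r , a' , b' , c') ∷ p) ⊗ q) a b c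
      ≡⟨ cong (λ t → coeff t a b c) (⊗-cons (r , a' , b' , c') p q) ⟩
    coeff (((r , a' , b' , c') ∷ []) ⊗ q ++ p ⊗ q) a b c
      ≡⟨ coeff-++ (((r , a' , b' , c') ∷ []) ⊗ q) (p ⊗ q) a b c ⟩
    coeff (((r , a' , b' , c') ∷ []) ⊗ q) a b c ℚ.+ coeff (p ⊗ q) a b c
      ≡⟨ cong₂ ℚ._+_ headTerm (⊗-congʳ p e a b c) ⟩
    coeff (((r , a' , b' , c') ∷ []) ⊗ q') a b c ℚ.+ coeff (p ⊗ q') a b c
      ≡⟨ coeff-++ (((r , a' , b' , c') ∷ []) ⊗ q') (p ⊗ q') a b c ⟨
    coeff (((r , a' , b' , c') ∷ []) ⊗ q' ++ p ⊗ q') a b c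
      ≡⟨ cong (λ t → coeff t a b c) (⊗-cons (r , a' , b' , c') p q') ⟨
    coeff (((r , a' , b' , c') ∷ p) ⊗ q') a b c ∎
    where
    open ≡-Reasoning
    headTerm : coeff (((r , a' , b' , c') ∷ []) ⊗ q) a b c ≡ coeff (((r , a' , b' , c') ∷ []) ⊗ q') a b c
    headTerm = trans (coeff-term⊗ r a' b' c' q a b c)
      (trans (cong (r ℚ.*_) (shifted-cong e a' b' c' a b c)) (sym (coeff-term⊗ r a' b' c' q' a b c)))

  ⊗-congˡ : ∀ {p p'} q → p ≈ p' → p ⊗ q ≈ p' ⊗ q
  ⊗-congˡ {p} {p'} q e = ≈-trans {p ⊗ q} {q ⊗ p} {p' ⊗ q} (⊗-comm p q)
    (≈-trans {q ⊗ p} {q ⊗ p'} {p' ⊗ q} (⊗-congʳ q e) (⊗-comm q p'))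

  ⊗-++ˡ : ∀ p p' q → (p ++ p') ⊗ q ≡ (p ⊗ q) ++ (p' ⊗ q)
  ⊗-++ˡ []      p' q = refl
  ⊗-++ˡ (t ∷ p) p' q = begin
    (t ∷ p ++ p') ⊗ q                     ≡⟨ ⊗-cons t (p ++ p') q ⟩
    (t ∷ []) ⊗ q ++ (p ++ p') ⊗ q         ≡⟨ cong ((t ∷ []) ⊗ q ++_) (⊗-++ˡ p p' q) ⟩
    (t ∷ []) ⊗ q ++ (p ⊗ q ++ p' ⊗ q)     ≡⟨ LP.++-assoc ((t ∷ []) ⊗ q) (p ⊗ q) (p' ⊗ q) ⟨
    ((t ∷ []) ⊗ q ++ p ⊗ q) ++ p' ⊗ q     ≡⟨ cong (_++ p' ⊗ q) (⊗-cons t p q) ⟨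
    (t ∷ p) ⊗ q ++ p' ⊗ q                 ∎
    where open ≡-Reasoning

  coeff-ΣP⊗ : ∀ {A : Set} (h : A → Poly) L q a b c →
    coeff (ΣP (map h L) ⊗ q) a b c ≡ sumℚ (map (λ x → coeff (h x ⊗ q) a b c) L)
  coeff-ΣP⊗ h []      q a b c = refl
  coeff-ΣP⊗ h (x ∷ L) q a b c = trans (cong (λ z → coeff z a b c) (⊗-++ˡ (h x) (ΣP (map h L)) q))
    (trans (coeff-++ (h x ⊗ q) (ΣP (map h L) ⊗ q) a b c) (cong (coeff (h x ⊗ q) a b c ℚ.+_) (coeff-ΣP⊗ h L q a b c)))

module NatPoly where

  open import Defs
  open NatFacts using (ind; fromℕ-+)
  open FiniteSums using (sumOf)
  open Polynomials
  open import Data.Bool using (true; false; _∧_; if_then_else_)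
  open import Data.Nat as ℕ using (ℕ; zero; suc; _≡ᵇ_; _+_; _*_)
  import Data.Nat.Properties as ℕP
  open import Data.Rational as ℚ using (0ℚ; 1ℚ)
  import Data.Rational.Properties as ℚP
  open import Data.List using (List; []; _∷_; _++_; map; concatMap)
  import Data.List.Properties as LP
  open import Data.Product using (_×_; _,_)
  open import Relation.Binary.PropositionalEquality

  NatPoly : Set
  NatPoly = List (ℕ × ℕ × ℕ × ℕ)

  termCoeffℕ : ℕ × ℕ × ℕ × ℕ → ℕ → ℕ → ℕ → ℕ
  termCoeffℕ (k , u , v , w) a b c = k * ind ((a ≡ᵇ u) ∧ (b ≡ᵇ v) ∧ (c ≡ᵇ w))

  coeffℕ : NatPoly → ℕ → ℕ → ℕ → ℕ
  coeffℕ []      a b c = 0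
  coeffℕ (t ∷ s) a b c = termCoeffℕ t a b c + coeffℕ s a b c

  infix 4 _≅_
  record _≅_ (p : Poly) (s : NatPoly) : Set where
    constructor mk≅
    field coeff≅ : ∀ a b c → coeff p a b c ≡ fromℕ (coeffℕ s a b c)
  open _≅_ public

  coeffℕ-++ : ∀ s t a b c → coeffℕ (s ++ t) a b c ≡ coeffℕ s a b c + coeffℕ t a b c
  coeffℕ-++ []      t a b c = refl
  coeffℕ-++ (x ∷ s) t a b c =
    trans (cong (termCoeffℕ x a b c +_) (coeffℕ-++ s t a b c)) (sym (ℕP.+-assoc (termCoeffℕ x a b c) _ _))

  coeffℕ-concatMap : ∀ {A : Set} (h : A → NatPoly) L a b c →
    coeffℕ (concatMap h L) a b c ≡ sumOf (λ x → coeffℕ (h x) a b c) L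
  coeffℕ-concatMap h []      a b c = refl
  coeffℕ-concatMap h (x ∷ L) a b c =
    trans (coeffℕ-++ (h x) (concatMap h L) a b c) (cong (coeffℕ (h x) a b c +_) (coeffℕ-concatMap h L a b c))

  []≅ : [] ≅ []
  []≅ = mk≅ λ a b c → refl

  ≅-++ : ∀ {p q s t} → p ≅ s → q ≅ t → p ++ q ≅ s ++ t
  ≅-++ {p} {q} {s} {t} e f = mk≅ λ a b c → begin
    coeff (p ++ q) a b c                          ≡⟨ coeff-++ p q a b c ⟩
    coeff p a b c ℚ.+ coeff q a b c               ≡⟨ cong₂ ℚ._+_ (coeff≅ e a b c) (coeff≅ f a b c) ⟩
    fromℕ (coeffℕ s a b c) ℚ.+ fromℕ (coeffℕ t a b c) ≡⟨ fromℕ-+ (coeffℕ s a b c) (coeffℕ t a b c) ⟨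
    fromℕ (coeffℕ s a b c + coeffℕ t a b c)       ≡⟨ cong fromℕ (coeffℕ-++ s t a b c) ⟨
    fromℕ (coeffℕ (s ++ t) a b c)                 ∎
    where open ≡-Reasoning

  ≅-ΣP : ∀ {A : Set} (h : A → Poly) (s : A → NatPoly) L → (∀ x → h x ≅ s x) → ΣP (map h L) ≅ concatMap s L
  ≅-ΣP h s []      E = []≅
  ≅-ΣP h s (x ∷ L) E = ≅-++ (E x) (≅-ΣP h s L E)

  ≈-≅ : ∀ {p q s} → p ≈ q → q ≅ s → p ≅ s
  ≈-≅ e f = mk≅ λ a b c → trans (e a b c) (coeff≅ f a b c)

  ≅-coeffℕ : ∀ {p s t} → p ≅ s → (∀ a b c → coeffℕ s a b c ≡ coeffℕ t a b c) → p ≅ t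
  ≅-coeffℕ e f = mk≅ λ a b c → trans (coeff≅ e a b c) (cong fromℕ (f a b c))

  ≅⇒≈ : ∀ {p q s} → p ≅ s → q ≅ s → p ≈ q
  ≅⇒≈ e f a b c = trans (coeff≅ e a b c) (sym (coeff≅ f a b c))

  shiftℕ : ℕ → ℕ → ℕ → NatPoly → NatPoly
  shiftℕ a' b' c' = map (λ { (k , u , v , w) → (k , a' + u , b' + v , c' + w) })

  coeffℕ-shift : ∀ s a' b' c' a b c → coeffℕ (shiftℕ a' b' c' s) a b c ≡ shifted 0 (coeffℕ s) a' b' c' a b c
  coeffℕ-shift [] a' b' c' a b c = sym (shifted-const 0 a' b' c' a b c)
  coeffℕ-shift ((k , u , v , w) ∷ s) a' b' c' a b c = begin
    k * ind ((a ≡ᵇ a' + u) ∧ (b ≡ᵇ b' + v) ∧ (c ≡ᵇ c' + w)) + coeffℕ (shiftℕ a' b' c' s) a b c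
      ≡⟨ cong₂ _+_ (trans (cong (λ t → k * ind t) (exponentTest-shifted a' b' c' u v w a b c))
                          (shifted-map (λ t → k * ind t) (ℕP.*-zeroʳ k) _ a' b' c' a b c))
                   (coeffℕ-shift s a' b' c' a b c) ⟩
    shifted 0 (termCoeffℕ (k , u , v , w)) a' b' c' a b c + shifted 0 (coeffℕ s) a' b' c' a b c
      ≡⟨ shifted-zip _+_ refl (termCoeffℕ (k , u , v , w)) (coeffℕ s) a' b' c' a b c ⟩
    shifted 0 (coeffℕ ((k , u , v , w) ∷ s)) a' b' c' a b c ∎
    where open ≡-Reasoning

  shiftℕ-concatMap : ∀ {A : Set} a' b' c' (h : A → NatPoly) L →
    shiftℕ a' b' c' (concatMap h L) ≡ concatMap (λ x → shiftℕ a' b' c' (h x)) L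
  shiftℕ-concatMap a' b' c' h []      = refl
  shiftℕ-concatMap a' b' c' h (x ∷ L) =
    trans (LP.map-++ _ (h x) (concatMap h L)) (cong (shiftℕ a' b' c' (h x) ++_) (shiftℕ-concatMap a' b' c' h L))

  ≅-monomial⊗ : ∀ a' b' c' {q s} → q ≅ s → ((1ℚ , a' , b' , c') ∷ []) ⊗ q ≅ shiftℕ a' b' c' s
  ≅-monomial⊗ a' b' c' {q} {s} e = mk≅ λ a b c → begin
    coeff (((1ℚ , a' , b' , c') ∷ []) ⊗ q) a b c         ≡⟨ coeff-term⊗ 1ℚ a' b' c' q a b c ⟩
    1ℚ ℚ.* shifted 0ℚ (coeff q) a' b' c' a b c            ≡⟨ ℚP.*-identityˡ _ ⟩
    shifted 0ℚ (coeff q) a' b' c' a b c                   ≡⟨ shifted-cong (coeff≅ e) a' b' c' a b c ⟩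
    shifted 0ℚ (λ d e f → fromℕ (coeffℕ s d e f)) a' b' c' a b c ≡⟨ shifted-map fromℕ refl (coeffℕ s) a' b' c' a b c ⟨
    fromℕ (shifted 0 (coeffℕ s) a' b' c' a b c)           ≡⟨ cong fromℕ (coeffℕ-shift s a' b' c' a b c) ⟨
    fromℕ (coeffℕ (shiftℕ a' b' c' s) a b c)              ∎
    where open ≡-Reasoning

  X^ : ∀ k → X ^^ k ≡ (1ℚ , k , 0 , 0) ∷ []
  X^ zero    = refl
  X^ (suc k) rewrite X^ k = refl

  Y^ : ∀ k → Y ^^ k ≡ (1ℚ , 0 , k , 0) ∷ []
  Y^ zero    = refl
  Y^ (suc k) rewrite Y^ k = refl

  Z^ : ∀ k → Z ^^ k ≡ (1ℚ , 0 , 0 , k) ∷ []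
  Z^ zero    = refl
  Z^ (suc k) rewrite Z^ k = refl

  monomial≅ : ∀ a' b' c' → ((1ℚ , a' , b' , c') ∷ []) ≅ ((1 , a' , b' , c') ∷ [])
  monomial≅ a' b' c' = mk≅ λ a b c → coeffOne ((a ≡ᵇ a') ∧ (b ≡ᵇ b') ∧ (c ≡ᵇ c'))
    where
    coeffOne : ∀ t → (if t then 1ℚ else 0ℚ) ℚ.+ 0ℚ ≡ fromℕ (1 * ind t + 0)
    coeffOne true  = refl
    coeffOne false = refl

module Enumeration where

  open import Defs
  open NatFacts using (≡ᵇ-refl; ≡ᵇ⇒≡; <ᵇ⇒<; <⇒<ᵇ; ∧-true⁻; ∧-true⁺)
  open FiniteSums using (unique-concatMap)
  open import Data.Bool using (Bool; true; false; _∧_; _∨_; not; if_then_else_; T; T?)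
  open import Data.Unit using (tt)
  open import Data.Nat as ℕ using (ℕ; zero; suc; _+_; _*_; _≤_; _<_; z≤n; s≤s; _≡ᵇ_; _<ᵇ_)
  import Data.Nat.Properties as ℕP
  open import Data.Integer as ℤ using (ℤ; +_; -[1+_]; ∣_∣)
  open import Data.List using (List; []; _∷_; _++_; map; concatMap; length; upTo; filterᵇ)
  open import Data.List.Membership.Propositional using (_∈_; lose)
  open import Data.List.Membership.Propositional.Properties
    using (∈-++⁻; ∈-++⁺ˡ; ∈-++⁺ʳ; ∈-map⁺; ∈-map⁻; ∈-upTo⁺; ∈-upTo⁻; ∈-concatMap⁺; ∈-concatMap⁻; ∈-filter⁺; ∈-filter⁻)
  open import Data.List.Relation.Unary.Any using (Any; here; there)
  open import Data.List.Relation.Unary.All using (All; []; _∷_)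
  import Data.List.Relation.Unary.All as All
  open import Data.List.Relation.Unary.Unique.Propositional using (Unique)
  import Data.List.Relation.Unary.Unique.Propositional.Properties as UniqueP
  open import Data.List.Relation.Unary.AllPairs using ([]; _∷_)
  open import Data.Product using (Σ; _×_; _,_; proj₁; proj₂)
  open import Data.Sum using (_⊎_; inj₁; inj₂)
  open import Data.Empty using (⊥-elim)
  open import Relation.Binary.PropositionalEquality
  open import Relation.Nullary using (¬_)

  module WordsOver {A : Set} (letters : List A) (W : ℕ → List (List A))
    (W-zero : W 0 ≡ [] ∷ []) (W-suc : ∀ L → W (suc L) ≡ concatMap (λ a → map (a ∷_) (W L)) letters) where

    ∈W⁻ : ∀ L w → w ∈ W L → length w ≡ L × All (_∈ letters) w
    ∈W⁻ zero    w m rewrite W-zero with m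
    ... | here refl = refl , []
    ∈W⁻ (suc L) w m rewrite W-suc L with ∈-concatMap⁻ (λ a → map (a ∷_) (W L)) {xs = letters} m
    ... | am = fromAny letters am (λ ma → ma)
      where
      fromAny : ∀ xs → Any (λ a → w ∈ map (a ∷_) (W L)) xs → (∀ {a} → a ∈ xs → a ∈ letters) →
        length w ≡ suc L × All (_∈ letters) w
      fromAny (a ∷ xs) (here m') f with ∈-map⁻ (a ∷_) m'
      ... | w' , mw' , refl = cong suc (proj₁ (∈W⁻ L w' mw')) , f (here refl) ∷ proj₂ (∈W⁻ L w' mw')
      fromAny (a ∷ xs) (there m') f = fromAny xs m' (λ mb → f (there mb))

    ∈W⁺ : ∀ L w → length w ≡ L → All (_∈ letters) w → w ∈ W L
    ∈W⁺ zero    []      refl []         rewrite W-zero = here refl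
    ∈W⁺ (suc L) (a ∷ w) refl (la ∷ al) rewrite W-suc L =
      ∈-concatMap⁺ (λ a → map (a ∷_) (W L)) {xs = letters}
        (lose {P = λ b → (a ∷ w) ∈ map (b ∷_) (W L)} la (∈-map⁺ (a ∷_) (∈W⁺ L w refl al)))

    unique-W : Unique letters → ∀ L → Unique (W L)
    unique-W u zero    rewrite W-zero = [] ∷ []
    unique-W u (suc L) rewrite W-suc L =
      unique-concatMap (λ a → map (a ∷_) (W L)) letters sameHead u
        (λ _ → UniqueP.map⁺ ∷-injectiveʳ (unique-W u L))
      where
      sameHead : ∀ {a a' y} → a ∈ letters → a' ∈ letters → y ∈ map (a ∷_) (W L) → y ∈ map (a' ∷_) (W L) → a ≡ a'
      sameHead _ _ my my' with ∈-map⁻ (_ ∷_) my | ∈-map⁻ (_ ∷_) my'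
      ... | _ , _ , refl | _ , _ , refl = refl
      ∷-injectiveʳ : ∀ {a : A} {xs ys} → _≡_ {A = List A} (a ∷ xs) (a ∷ ys) → xs ≡ ys
      ∷-injectiveʳ refl = refl

  ∈-filterᵇ⁻ : ∀ {A : Set} (p : A → Bool) {x} xs → x ∈ filterᵇ p xs → x ∈ xs × p x ≡ true
  ∈-filterᵇ⁻ p xs m with ∈-filter⁻ (λ y → T? (p y)) {xs = xs} m
  ... | m' , t = m' , T→≡ t
    where
    T→≡ : ∀ {b} → T b → b ≡ true
    T→≡ {true} _ = refl

  ∈-filterᵇ⁺ : ∀ {A : Set} (p : A → Bool) {x} xs → x ∈ xs → p x ≡ true → x ∈ filterᵇ p xs
  ∈-filterᵇ⁺ p xs m e = ∈-filter⁺ (λ y → T? (p y)) m (subst T (sym e) tt)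

  allᵇ-sound : ∀ {A : Set} (p : A → Bool) xs → allᵇ p xs ≡ true → ∀ x → x ∈ xs → p x ≡ true
  allᵇ-sound p (y ∷ xs) e x (here refl) = proj₁ (∧-true⁻ e)
  allᵇ-sound p (y ∷ xs) e x (there m)   = allᵇ-sound p xs (proj₂ (∧-true⁻ {p y} e)) x m

  allᵇ-complete : ∀ {A : Set} (p : A → Bool) xs → (∀ x → x ∈ xs → p x ≡ true) → allᵇ p xs ≡ true
  allᵇ-complete p []       f = refl
  allᵇ-complete p (y ∷ xs) f = ∧-true⁺ (f y (here refl)) (allᵇ-complete p xs (λ x m → f x (there m)))

  at-++ˡ : ∀ xs ys k → k < length xs → at (xs ++ ys) k ≡ at xs k
  at-++ˡ (x ∷ xs) ys zero    _       = refl
  at-++ˡ (x ∷ xs) ys (suc k) (s≤s k<) = at-++ˡ xs ys k k<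

  at-++ʳ : ∀ xs ys k → at (xs ++ ys) (length xs + k) ≡ at ys k
  at-++ʳ []       ys k = refl
  at-++ʳ (x ∷ xs) ys k = at-++ʳ xs ys k

  at-All : ∀ {P : ℕ → Set} w k → k < length w → All P w → P (at w k)
  at-All (a ∷ w) zero    _        (pa ∷ _)  = pa
  at-All (a ∷ w) (suc k) (s≤s k<) (_ ∷ al) = at-All w k k< al

  count-here : ∀ a w → count a (a ∷ w) ≡ suc (count a w)
  count-here a w = cong (λ t → if t then suc (count a w) else count a w) (≡ᵇ-refl a)

  count-there : ∀ a b w → (a ≡ᵇ b) ≡ false → count a (b ∷ w) ≡ count a w
  count-there a b w e = cong (λ t → if t then suc (count a w) else count a w) e

  count-++ : ∀ a xs ys → count a (xs ++ ys) ≡ count a xs + count a ys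
  count-++ a []       ys = refl
  count-++ a (b ∷ xs) ys with a ≡ᵇ b
  ... | true  = cong suc (count-++ a xs ys)
  ... | false = count-++ a xs ys

  count-absent : ∀ a w → All (a ≢_) w → count a w ≡ 0
  count-absent a []      []        = refl
  count-absent a (b ∷ w) (ne ∷ al) with a ≡ᵇ b in eq
  ... | true  = ⊥-elim (ne (≡ᵇ⇒≡ eq))
  ... | false = count-absent a w al

  count-zero : ∀ a w → count a w ≡ 0 → All (a ≢_) w
  count-zero a []      e = []
  count-zero a (b ∷ w) e with a ≡ᵇ b in eq
  ... | false = (λ { refl → true≢false (trans (sym (≡ᵇ-refl a)) eq) }) ∷ count-zero a w e
    where
    true≢false : true ≢ false
    true≢false ()

  count-position : ∀ a w → 0 < count a w → Σ ℕ λ d → d < length w × at w d ≡ a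
  count-position a (b ∷ w) p with a ≡ᵇ b in eq
  ... | true  = 0 , s≤s z≤n , sym (≡ᵇ⇒≡ eq)
  ... | false with count-position a w p
  ...   | d , d< , e = suc d , s≤s d< , e

  firstOccurrence : ∀ a w → 0 < count a w → Σ (List ℕ) λ τ₁ → Σ (List ℕ) λ ρ → w ≡ τ₁ ++ a ∷ ρ × count a τ₁ ≡ 0
  firstOccurrence a (b ∷ w) p with a ≡ᵇ b in eq
  ... | true  = [] , w , cong (_∷ w) (sym (≡ᵇ⇒≡ eq)) , refl
  ... | false with firstOccurrence a w p
  ...   | τ₁ , ρ , e , c = b ∷ τ₁ , ρ , cong (b ∷_) e , trans (count-there a b τ₁ eq) c

  Letter : ℕ → ℕ → Set
  Letter n a = 0 < a × a ≤ n

  Letter⇔∈ : ∀ {n a} → (a ∈ map suc (upTo n) → Letter n a) × (Letter n a → a ∈ map suc (upTo n))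
  Letter⇔∈ {n} = from , to
    where
    from : ∀ {a} → a ∈ map suc (upTo n) → Letter n a
    from m with ∈-map⁻ suc m
    ... | i , mi , refl = s≤s z≤n , ∈-upTo⁻ mi
    to : ∀ {a} → Letter n a → a ∈ map suc (upTo n)
    to {suc i} (_ , le) = ∈-map⁺ suc (∈-upTo⁺ le)

  Letter⇒< : ∀ {n a} → Letter n a → a < suc n
  Letter⇒< (_ , le) = s≤s le

  Letter-weaken : ∀ {n a} → Letter n a → Letter (suc n) a
  Letter-weaken (p , le) = p , ℕP.m≤n⇒m≤1+n le

  module Words (n : ℕ) = WordsOver (map suc (upTo n)) (words n) refl (λ L → refl)

  StirlingCondition : List ℕ → Set
  StirlingCondition w = ∀ p q r → p < q → q < r → r < length w → at w p ≡ at w r → at w p < at w q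

  stirlingCond-sound : ∀ w → stirlingCond w ≡ true → StirlingCondition w
  stirlingCond-sound w e p q r p<q q<r r< ep = <ᵇ⇒< (decide tested)
    where
    U : List ℕ
    U = upTo (length w)
    q< : q < length w
    q< = ℕP.<-trans q<r r<
    tested : (not ((p <ᵇ q) ∧ (q <ᵇ r) ∧ (at w p ≡ᵇ at w r)) ∨ (at w p <ᵇ at w q)) ≡ true
    tested = allᵇ-sound _ U (allᵇ-sound _ U (allᵇ-sound _ U e p (∈-upTo⁺ (ℕP.<-trans p<q q<))) q (∈-upTo⁺ q<)) r (∈-upTo⁺ r<)
    decide : (not ((p <ᵇ q) ∧ (q <ᵇ r) ∧ (at w p ≡ᵇ at w r)) ∨ (at w p <ᵇ at w q)) ≡ true → (at w p <ᵇ at w q) ≡ true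
    decide e rewrite <⇒<ᵇ p<q | <⇒<ᵇ q<r | ep | ≡ᵇ-refl (at w r) = e

  stirlingCond-complete : ∀ w → StirlingCondition w → stirlingCond w ≡ true
  stirlingCond-complete w st = allᵇ-complete _ U λ p _ → allᵇ-complete _ U λ q _ → allᵇ-complete _ U λ r mr →
      decide p q r (∈-upTo⁻ mr) ((p <ᵇ q) ∧ (q <ᵇ r) ∧ (at w p ≡ᵇ at w r)) refl
    where
    U : List ℕ
    U = upTo (length w)
    decide : ∀ p q r → r < length w → ∀ b → ((p <ᵇ q) ∧ (q <ᵇ r) ∧ (at w p ≡ᵇ at w r)) ≡ b →
      (not b ∨ (at w p <ᵇ at w q)) ≡ true
    decide p q r r< false e = refl
    decide p q r r< true  e with ∧-true⁻ {p <ᵇ q} e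
    ... | e1 , e23 with ∧-true⁻ {q <ᵇ r} e23
    ...   | e2 , tested = <⇒<ᵇ (st p q r (<ᵇ⇒< e1) (<ᵇ⇒< e2) r< (≡ᵇ⇒≡ tested))

  record IsStirling (n : ℕ) (σ : List ℕ) : Set where
    field
      len     : length σ ≡ 2 * n
      letters : All (Letter n) σ
      twice   : ∀ i → i < n → count (suc i) σ ≡ 2
      nested  : StirlingCondition σ

  ∈𝒬⇒IsStirling : ∀ n σ → σ ∈ 𝒬 n → IsStirling n σ
  ∈𝒬⇒IsStirling n σ m with ∈-filterᵇ⁻ (λ w → isMultisetPerm n w ∧ stirlingCond w) (words n (2 * n)) m
  ... | mw , e with ∧-true⁻ {isMultisetPerm n σ} e
  ...   | e1 , e2 with ∧-true⁻ {allᵇ (λ i → count (suc i) σ ≡ᵇ 2) (upTo n)} e1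
  ...     | e11 , _ = record
    { len     = proj₁ (Words.∈W⁻ n (2 * n) σ mw)
    ; letters = All.map (proj₁ Letter⇔∈) (proj₂ (Words.∈W⁻ n (2 * n) σ mw))
    ; twice   = λ i i< → ≡ᵇ⇒≡ (allᵇ-sound _ (upTo n) e11 i (∈-upTo⁺ i<))
    ; nested  = stirlingCond-sound σ e2 }

  IsStirling⇒∈𝒬 : ∀ n σ → IsStirling n σ → σ ∈ 𝒬 n
  IsStirling⇒∈𝒬 n σ q = ∈-filterᵇ⁺ (λ w → isMultisetPerm n w ∧ stirlingCond w) (words n (2 * n))
      (Words.∈W⁺ n (2 * n) σ (IsStirling.len q) (All.map (proj₂ Letter⇔∈) (IsStirling.letters q)))
      (∧-true⁺ (∧-true⁺ (allᵇ-complete _ (upTo n) (λ i mi → cong (_≡ᵇ 2) (IsStirling.twice q i (∈-upTo⁻ mi))))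
                        (trans (cong (_≡ᵇ 2 * n) (IsStirling.len q)) (≡ᵇ-refl (2 * n))))
               (stirlingCond-complete σ (IsStirling.nested q)))

  unique-𝒬 : ∀ n → Unique (𝒬 n)
  unique-𝒬 n = UniqueP.filter⁺ (λ y → T? (isMultisetPerm n y ∧ stirlingCond y))
    (Words.unique-W n (UniqueP.map⁺ ℕP.suc-injective (UniqueP.upTo⁺ n)) (2 * n))

  SignedLetter : ℕ → ℤ → Set
  SignedLetter n x = Σ ℕ λ i → i < n × (x ≡ + suc i ⊎ x ≡ -[1+ i ])

  SignedLetter⇔∈ : ∀ {n x} → (x ∈ signedLetters n → SignedLetter n x) × (SignedLetter n x → x ∈ signedLetters n)
  SignedLetter⇔∈ {n} = from , to
    where
    from : ∀ {x} → x ∈ signedLetters n → SignedLetter n x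
    from m with ∈-++⁻ (map (λ i → + suc i) (upTo n)) m
    ... | inj₁ m1 with ∈-map⁻ (λ i → + suc i) m1
    ...   | i , mi , refl = i , ∈-upTo⁻ mi , inj₁ refl
    from m | inj₂ m2 with ∈-map⁻ (λ i → -[1+ i ]) m2
    ...   | i , mi , refl = i , ∈-upTo⁻ mi , inj₂ refl
    to : ∀ {x} → SignedLetter n x → x ∈ signedLetters n
    to (i , i< , inj₁ refl) = ∈-++⁺ˡ (∈-map⁺ (λ i → + suc i) (∈-upTo⁺ i<))
    to (i , i< , inj₂ refl) = ∈-++⁺ʳ (map (λ i → + suc i) (upTo n)) (∈-map⁺ (λ i → -[1+ i ]) (∈-upTo⁺ i<))

  SignedLetter-abs : ∀ {n x} → SignedLetter n x → Σ ℕ λ i → i < n × ∣ x ∣ ≡ suc i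
  SignedLetter-abs (i , i< , inj₁ refl) = i , i< , refl
  SignedLetter-abs (i , i< , inj₂ refl) = i , i< , refl

  SignedLetter-weaken : ∀ {n x} → SignedLetter n x → SignedLetter (suc n) x
  SignedLetter-weaken (i , i< , e) = i , ℕP.m≤n⇒m≤1+n i< , e

  module SignedWords (n : ℕ) = WordsOver (signedLetters n) (signedWords n) refl (λ L → refl)

  record IsSignedPerm (n : ℕ) (π : List ℤ) : Set where
    field
      len     : length π ≡ n
      letters : All (SignedLetter n) π
      once    : ∀ i → i < n → count (suc i) (map ∣_∣ π) ≡ 1

  ∈B⇒IsSignedPerm : ∀ n π → π ∈ B n → IsSignedPerm n π
  ∈B⇒IsSignedPerm n π m with ∈-filterᵇ⁻ (isSignedPerm n) (signedWords n n) m
  ... | mw , e with ∧-true⁻ {allᵇ (λ i → count (suc i) (map ∣_∣ π) ≡ᵇ 1) (upTo n)} e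
  ...   | e1 , _ = record
    { len     = proj₁ (SignedWords.∈W⁻ n n π mw)
    ; letters = All.map (proj₁ SignedLetter⇔∈) (proj₂ (SignedWords.∈W⁻ n n π mw))
    ; once    = λ i i< → ≡ᵇ⇒≡ (allᵇ-sound _ (upTo n) e1 i (∈-upTo⁺ i<)) }

  IsSignedPerm⇒∈B : ∀ n π → IsSignedPerm n π → π ∈ B n
  IsSignedPerm⇒∈B n π q = ∈-filterᵇ⁺ (isSignedPerm n) (signedWords n n)
    (SignedWords.∈W⁺ n n π (IsSignedPerm.len q) (All.map (proj₂ SignedLetter⇔∈) (IsSignedPerm.letters q)))
    (∧-true⁺ (allᵇ-complete _ (upTo n) (λ i mi → cong (_≡ᵇ 1) (IsSignedPerm.once q i (∈-upTo⁻ mi))))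
             (trans (cong (_≡ᵇ n) (IsSignedPerm.len q)) (≡ᵇ-refl n)))

  unique-B : ∀ n → Unique (B n)
  unique-B n = UniqueP.filter⁺ (λ y → T? (isSignedPerm n y)) (SignedWords.unique-W n unique-letters n)
    where
    unique-letters : Unique (signedLetters n)
    unique-letters = UniqueP.++⁺ (UniqueP.map⁺ (λ { refl → refl }) (UniqueP.upTo⁺ n))
      (UniqueP.map⁺ (λ { refl → refl }) (UniqueP.upTo⁺ n)) disjoint
      where
      disjoint : ∀ {v} → ¬ (v ∈ map (λ i → + suc i) (upTo n) × v ∈ map (λ i → -[1+ i ]) (upTo n))
      disjoint (m1 , m2) with ∈-map⁻ (λ i → + suc i) m1 | ∈-map⁻ (λ i → -[1+ i ]) m2
      ... | _ , _ , refl | _ , _ , ()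

module StirlingInsertion where

  open import Defs
  open NatFacts using (≡ᵇ-refl; ≡ᵇ⇒≡; <⇒≢ᵇ; 2*suc)
  open FiniteSums using (sumOf; sumOf-generated)
  open Enumeration
  open import Data.Bool using (true; false; if_then_else_)
  open import Data.Nat as ℕ using (ℕ; suc; _+_; _*_; _∸_; _≤_; _<_; z≤n; s≤s; _≡ᵇ_)
  import Data.Nat.Properties as ℕP
  open import Data.List using (List; []; _∷_; _++_; map; length)
  import Data.List.Properties as LP
  open import Data.List.Membership.Propositional using (_∈_)
  open import Data.List.Membership.Propositional.Properties using (∈-map⁺; ∈-map⁻)
  open import Data.List.Relation.Unary.Any using (here; there)
  open import Data.List.Relation.Unary.All using (All; []; _∷_)
  import Data.List.Relation.Unary.All as All
  import Data.List.Relation.Unary.All.Properties as AllP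
  open import Data.List.Relation.Unary.Unique.Propositional using (Unique)
  import Data.List.Relation.Unary.Unique.Propositional.Properties as UniqueP
  open import Data.List.Relation.Unary.AllPairs using ([]; _∷_)
  open import Data.Product using (Σ; _×_; _,_; proj₁; proj₂)
  open import Data.Sum using (_⊎_; inj₁; inj₂)
  open import Data.Empty using (⊥-elim)
  open import Relation.Binary.PropositionalEquality hiding (J)
  open import Relation.Nullary using (yes; no)
  open import Relation.Binary.Definitions using (tri<; tri≈; tri>)

  -- Every Stirling permutation of order n+1 arises in exactly one way from one of
  -- order n by inserting the adjacent pair (n+1)(n+1) into one of its 2n+1 gaps.

  insertPair : ℕ → List ℕ → List (List ℕ)
  insertPair m []      = (m ∷ m ∷ []) ∷ []
  insertPair m (a ∷ v) = (m ∷ m ∷ a ∷ v) ∷ map (a ∷_) (insertPair m v)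

  insertPair-∈⁻ : ∀ m τ σ → σ ∈ insertPair m τ →
    Σ (List ℕ) λ τ₁ → Σ (List ℕ) λ τ₂ → τ ≡ τ₁ ++ τ₂ × σ ≡ τ₁ ++ m ∷ m ∷ τ₂
  insertPair-∈⁻ m []      σ (here refl) = [] , [] , refl , refl
  insertPair-∈⁻ m (a ∷ v) σ (here refl) = [] , a ∷ v , refl , refl
  insertPair-∈⁻ m (a ∷ v) σ (there mm) with ∈-map⁻ (a ∷_) mm
  ... | σ' , m' , refl with insertPair-∈⁻ m v σ' m'
  ...   | τ₁ , τ₂ , refl , refl = a ∷ τ₁ , τ₂ , refl , refl

  insertPair-∈⁺ : ∀ m τ₁ τ₂ → (τ₁ ++ m ∷ m ∷ τ₂) ∈ insertPair m (τ₁ ++ τ₂)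
  insertPair-∈⁺ m []       []       = here refl
  insertPair-∈⁺ m []       (a ∷ τ₂) = here refl
  insertPair-∈⁺ m (a ∷ τ₁) τ₂       = there (∈-map⁺ (a ∷_) (insertPair-∈⁺ m τ₁ τ₂))

  -- Positions in σ = τ₁ m m τ₂ versus positions in τ = τ₁ τ₂: the two inserted
  -- letters sit at positions J and J+1 (J = |τ₁|), everything else is shifted
  -- monotonically.  This transfers the Stirling condition between σ and τ.
  module Gap (τ₁ τ₂ : List ℕ) (m : ℕ) where
    J : ℕ
    J = length τ₁
    σ τ : List ℕ
    σ = τ₁ ++ m ∷ m ∷ τ₂
    τ = τ₁ ++ τ₂

    lenσ : length σ ≡ J + suc (suc (length τ₂))
    lenσ = LP.length-++ τ₁
    lenτ : length τ ≡ J + length τ₂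
    lenτ = LP.length-++ τ₁

    NewToOld : ℕ → ℕ → Set
    NewToOld k t = at σ k ≡ at τ t × ((k < J × t ≡ k) ⊎ Σ ℕ λ d → k ≡ J + (2 + d) × t ≡ J + d)

    Inserted : ℕ → Set
    Inserted k = at σ k ≡ m × J ≤ k × k ≤ suc J

    classifyNew : ∀ k → Inserted k ⊎ Σ ℕ (NewToOld k)
    classifyNew k with ℕP.<-cmp k J
    ... | tri< k< _ _ = inj₂ (k , trans (at-++ˡ τ₁ _ k k<) (sym (at-++ˡ τ₁ τ₂ k k<)) , inj₁ (k< , refl))
    ... | tri≈ _ refl _ =
          inj₁ (trans (cong (at σ) (sym (ℕP.+-identityʳ J))) (at-++ʳ τ₁ (m ∷ m ∷ τ₂) 0) , ℕP.≤-refl , ℕP.n≤1+n J)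
    ... | tri> _ _ J<k with ℕP.<-cmp k (suc J)
    ...   | tri< k< _ _ = ⊥-elim (ℕP.<⇒≱ J<k (ℕP.≤-pred k<))
    ...   | tri≈ _ refl _ =
            inj₁ (trans (cong (at σ) (sym (ℕP.+-comm J 1))) (at-++ʳ τ₁ (m ∷ m ∷ τ₂) 1) , ℕP.n≤1+n J , ℕP.≤-refl)
    ...   | tri> _ _ J<k' =
            inj₂ (J + d , trans (cong (at σ) e) (trans (at-++ʳ τ₁ (m ∷ m ∷ τ₂) (2 + d)) (sym (at-++ʳ τ₁ τ₂ d))) , inj₂ (d , e , refl))
      where
      d : ℕ
      d = k ∸ (2 + J)
      e : k ≡ J + (2 + d)
      e = trans (sym (ℕP.m+[n∸m]≡n J<k'))
          (trans (sym (ℕP.+-assoc 2 J d)) (trans (cong (_+ d) (ℕP.+-comm 2 J)) (ℕP.+-assoc J 2 d)))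

    NewToOld-mono : ∀ {k t k' t'} → NewToOld k t → NewToOld k' t' → k < k' → t < t'
    NewToOld-mono (_ , inj₁ (_ , refl)) (_ , inj₁ (_ , refl)) k<k' = k<k'
    NewToOld-mono (_ , inj₁ (k<J , refl)) (_ , inj₂ (d , _ , refl)) _ = ℕP.<-≤-trans k<J (ℕP.m≤m+n J d)
    NewToOld-mono (_ , inj₂ (d , refl , _)) (_ , inj₁ (k'<J , _)) k<k' =
      ⊥-elim (ℕP.<-asym (ℕP.<-trans k<k' k'<J) (ℕP.<-≤-trans (ℕP.m<m+n J (s≤s z≤n)) ℕP.≤-refl))
    NewToOld-mono (_ , inj₂ (d , refl , refl)) (_ , inj₂ (d' , refl , refl)) k<k' =
      ℕP.+-monoʳ-< J (ℕP.+-cancelˡ-< 2 d d' (ℕP.+-cancelˡ-< J (2 + d) (2 + d') k<k'))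

    NewToOld-bound : ∀ {k t} → NewToOld k t → k < length σ → t < length τ
    NewToOld-bound (_ , inj₁ (k<J , refl)) _ = ℕP.<-≤-trans k<J (subst (J ≤_) (sym lenτ) (ℕP.m≤m+n J (length τ₂)))
    NewToOld-bound (_ , inj₂ (d , refl , refl)) k< = subst (J + d <_) (sym lenτ)
      (ℕP.+-monoʳ-< J (ℕP.+-cancelˡ-< 2 d (length τ₂)
        (ℕP.+-cancelˡ-< J (2 + d) (2 + length τ₂) (subst (J + (2 + d) <_) lenσ k<))))

    OldToNew : ℕ → ℕ → Set
    OldToNew k s = at τ k ≡ at σ s × ((k < J × s ≡ k) ⊎ Σ ℕ λ d → k ≡ J + d × s ≡ J + (2 + d))

    classifyOld : ∀ k → Σ ℕ (OldToNew k)
    classifyOld k with k ℕ.<? J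
    ... | yes k< = k , trans (at-++ˡ τ₁ _ k k<) (sym (at-++ˡ τ₁ _ k k<)) , inj₁ (k< , refl)
    ... | no  k≮ = J + (2 + d) , trans (cong (at τ) e) (trans (at-++ʳ τ₁ τ₂ d) (sym (at-++ʳ τ₁ (m ∷ m ∷ τ₂) (2 + d))))
                               , inj₂ (d , e , refl)
      where
      d : ℕ
      d = k ∸ J
      e : k ≡ J + d
      e = sym (ℕP.m+[n∸m]≡n (ℕP.≮⇒≥ k≮))

    OldToNew-mono : ∀ {k s k' s'} → OldToNew k s → OldToNew k' s' → k < k' → s < s'
    OldToNew-mono (_ , inj₁ (_ , refl)) (_ , inj₁ (_ , refl)) k<k' = k<k'
    OldToNew-mono (_ , inj₁ (k<J , refl)) (_ , inj₂ (d , _ , refl)) _ = ℕP.<-≤-trans k<J (ℕP.m≤m+n J (2 + d))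
    OldToNew-mono (_ , inj₂ (d , refl , _)) (_ , inj₁ (k'<J , _)) k<k' =
      ⊥-elim (ℕP.<-irrefl refl (ℕP.<-≤-trans (ℕP.<-trans k<k' k'<J) (ℕP.m≤m+n J d)))
    OldToNew-mono (_ , inj₂ (d , refl , refl)) (_ , inj₂ (d' , refl , refl)) k<k' =
      ℕP.+-monoʳ-< J (s≤s (s≤s (ℕP.+-cancelˡ-< J d d' k<k')))

    OldToNew-bound : ∀ {k s} → OldToNew k s → k < length τ → s < length σ
    OldToNew-bound (_ , inj₁ (k<J , refl)) _ = ℕP.<-≤-trans k<J (subst (J ≤_) (sym lenσ) (ℕP.m≤m+n J _))
    OldToNew-bound (_ , inj₂ (d , refl , refl)) k< = subst (J + (2 + d) <_) (sym lenσ)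
      (ℕP.+-monoʳ-< J (s≤s (s≤s (ℕP.+-cancelˡ-< J d (length τ₂) (subst (J + d <_) lenτ k<)))))

    -- For p < q < r with σ_p = σ_r: two inserted positions are adjacent, so they
    -- cannot be p and r; one inserted and one old position would carry equal
    -- letters m and something < m; an inserted q carries the maximum m; and if no
    -- position is inserted the condition is inherited from τ.
    nested-insert : StirlingCondition τ → All (_< m) τ → StirlingCondition σ
    nested-insert st al p q r p<q q<r r< ep with classifyNew p | classifyNew q | classifyNew r
    ... | inj₁ (_ , Jp , _) | _ | inj₁ (_ , _ , r≤) =
          ⊥-elim (ℕP.1+n≰n (ℕP.≤-trans (ℕP.≤-trans (s≤s p<q) q<r) (ℕP.≤-trans r≤ (s≤s Jp))))
    ... | inj₁ (mp , _ , _) | _ | inj₂ (tr , r↦) =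
          ⊥-elim (ℕP.<-irrefl (sym (trans (sym mp) (trans ep (proj₁ r↦)))) (at-All τ tr (NewToOld-bound r↦ r<) al))
    ... | inj₂ (tp , p↦) | inj₁ (mq , _) | _ =
          subst₂ _<_ (sym (proj₁ p↦)) (sym mq) (at-All τ tp (NewToOld-bound p↦ (ℕP.<-trans (ℕP.<-trans p<q q<r) r<)) al)
    ... | inj₂ (tp , p↦) | inj₂ _ | inj₁ (mr , _) =
          ⊥-elim (ℕP.<-irrefl (trans (sym (proj₁ p↦)) (trans ep mr)) (at-All τ tp (NewToOld-bound p↦ (ℕP.<-trans (ℕP.<-trans p<q q<r) r<)) al))
    ... | inj₂ (tp , p↦) | inj₂ (tq , q↦) | inj₂ (tr , r↦) =
          subst₂ _<_ (sym (proj₁ p↦)) (sym (proj₁ q↦))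
            (st tp tq tr (NewToOld-mono p↦ q↦ p<q) (NewToOld-mono q↦ r↦ q<r) (NewToOld-bound r↦ r<)
                (trans (sym (proj₁ p↦)) (trans ep (proj₁ r↦))))

    -- Removing the pair keeps the relative order of the remaining positions.
    nested-remove : StirlingCondition σ → StirlingCondition τ
    nested-remove st p q r p<q q<r r< ep with classifyOld p | classifyOld q | classifyOld r
    ... | sp , p↦ | sq , q↦ | sr , r↦ = subst₂ _<_ (sym (proj₁ p↦)) (sym (proj₁ q↦))
          (st sp sq sr (OldToNew-mono p↦ q↦ p<q) (OldToNew-mono q↦ r↦ q<r) (OldToNew-bound r↦ r<)
              (trans (sym (proj₁ p↦)) (trans ep (proj₁ r↦))))

  length-++₂ : ∀ (τ₁ τ₂ : List ℕ) x y → length (τ₁ ++ x ∷ y ∷ τ₂) ≡ suc (suc (length (τ₁ ++ τ₂)))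
  length-++₂ []       τ₂ x y = refl
  length-++₂ (a ∷ τ₁) τ₂ x y = cong suc (length-++₂ τ₁ τ₂ x y)

  count-insertPair : ∀ a m τ₁ τ₂ → count a (τ₁ ++ m ∷ m ∷ τ₂) ≡ (if a ≡ᵇ m then 2 else 0) + count a (τ₁ ++ τ₂)
  count-insertPair a m []       τ₂ with a ≡ᵇ m
  ... | true  = refl
  ... | false = refl
  count-insertPair a m (b ∷ τ₁) τ₂ with a ≡ᵇ b
  ... | true  = trans (cong suc (count-insertPair a m τ₁ τ₂)) (sym (ℕP.+-suc (if a ≡ᵇ m then 2 else 0) _))
  ... | false = count-insertPair a m τ₁ τ₂

  IsStirling-insert : ∀ n τ₁ τ₂ → IsStirling n (τ₁ ++ τ₂) → IsStirling (suc n) (τ₁ ++ suc n ∷ suc n ∷ τ₂)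
  IsStirling-insert n τ₁ τ₂ q = record
    { len     = trans (length-++₂ τ₁ τ₂ _ _) (trans (cong (λ t → suc (suc t)) (IsStirling.len q)) (sym (2*suc n)))
    ; letters = AllP.++⁺ (All.map Letter-weaken (AllP.++⁻ˡ τ₁ (IsStirling.letters q)))
                  ((s≤s z≤n , ℕP.≤-refl) ∷ (s≤s z≤n , ℕP.≤-refl) ∷ All.map Letter-weaken (AllP.++⁻ʳ τ₁ (IsStirling.letters q)))
    ; twice   = twice
    ; nested  = Gap.nested-insert τ₁ τ₂ (suc n) (IsStirling.nested q) (All.map Letter⇒< (IsStirling.letters q)) }
    where
    twice : ∀ i → i < suc n → count (suc i) (τ₁ ++ suc n ∷ suc n ∷ τ₂) ≡ 2
    twice i i< with ℕP.<-cmp i n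
    ... | tri< i<n _ _ rewrite count-insertPair (suc i) (suc n) τ₁ τ₂ | <⇒≢ᵇ i<n = IsStirling.twice q i i<n
    ... | tri≈ _ refl _ rewrite count-insertPair (suc i) (suc i) τ₁ τ₂ | ≡ᵇ-refl i =
          cong (2 +_) (count-absent (suc i) (τ₁ ++ τ₂)
            (All.map (λ { {a} (_ , le) e → ℕP.1+n≰n (subst (_≤ i) (sym e) le) }) (IsStirling.letters q)))
    ... | tri> _ _ n<i = ⊥-elim (ℕP.<⇒≱ n<i (ℕP.≤-pred i<))

  IsStirling-remove : ∀ n τ₁ τ₂ → IsStirling (suc n) (τ₁ ++ suc n ∷ suc n ∷ τ₂) →
    count (suc n) τ₁ ≡ 0 → count (suc n) τ₂ ≡ 0 → IsStirling n (τ₁ ++ τ₂)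
  IsStirling-remove n τ₁ τ₂ q c1 c2 = record
    { len     = ℕP.suc-injective (ℕP.suc-injective
                  (trans (sym (length-++₂ τ₁ τ₂ _ _)) (trans (IsStirling.len q) (2*suc n))))
    ; letters = AllP.++⁺ (All.zipWith shrink (AllP.++⁻ˡ τ₁ (IsStirling.letters q) , count-zero (suc n) τ₁ c1))
                         (All.zipWith shrink (drop2 (AllP.++⁻ʳ τ₁ (IsStirling.letters q)) , count-zero (suc n) τ₂ c2))
    ; twice   = λ i i< → trans (sym (trans (count-insertPair (suc i) (suc n) τ₁ τ₂)
                                      (cong (λ b → (if b then 2 else 0) + count (suc i) (τ₁ ++ τ₂)) (<⇒≢ᵇ i<))))
                               (IsStirling.twice q i (ℕP.m≤n⇒m≤1+n i<))
    ; nested  = Gap.nested-remove τ₁ τ₂ (suc n) (IsStirling.nested q) }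
    where
    shrink : ∀ {a} → Letter (suc n) a × suc n ≢ a → Letter n a
    shrink ((p , le) , ne) = p , ℕP.≤-pred (ℕP.≤∧≢⇒< le (λ e → ne (sym e)))
    drop2 : ∀ {P : ℕ → Set} {x y ys} → All P (x ∷ y ∷ ys) → All P ys
    drop2 (_ ∷ _ ∷ a) = a

  -- In a Stirling permutation of order n+1 the letter after the first n+1 is the
  -- second n+1: any other letter x ≤ n+1 there would lie between the two copies
  -- of n+1 and so would have to exceed n+1.
  maximal-pair-adjacent : ∀ n τ₁ ρ → IsStirling (suc n) (τ₁ ++ suc n ∷ ρ) → count (suc n) ρ ≡ 1 →
    Σ (List ℕ) λ τ₂ → ρ ≡ suc n ∷ τ₂ × count (suc n) τ₂ ≡ 0
  maximal-pair-adjacent n τ₁ [] q ()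
  maximal-pair-adjacent n τ₁ (x ∷ τ₂) q cρ with x ℕ.≟ suc n
  ... | yes refl = τ₂ , refl , ℕP.suc-injective (trans (sym (count-here (suc n) τ₂)) cρ)
  ... | no x≢m = ⊥-elim (ℕP.<⇒≱ m<x x≤m)
    where
    m J : ℕ
    m = suc n
    J = length τ₁
    m≢ᵇx : (m ≡ᵇ x) ≡ false
    m≢ᵇx with m ≡ᵇ x in e
    ... | true  = ⊥-elim (x≢m (sym (≡ᵇ⇒≡ e)))
    ... | false = refl
    second : Σ ℕ λ d → d < length τ₂ × at τ₂ d ≡ m
    second = count-position m τ₂ (subst (0 <_) (trans (sym cρ) (count-there m x τ₂ m≢ᵇx)) (s≤s z≤n))
    d : ℕ
    d = proj₁ second
    x≤m : x ≤ m
    x≤m with AllP.++⁻ʳ τ₁ (IsStirling.letters q)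
    ... | _ ∷ (_ , le) ∷ _ = le
    m<x : m < x
    m<x = subst₂ _<_ (at-++ʳ τ₁ (m ∷ x ∷ τ₂) 0) (at-++ʳ τ₁ (m ∷ x ∷ τ₂) 1)
      (IsStirling.nested q (J + 0) (J + 1) (J + (2 + d)) (ℕP.+-monoʳ-< J (s≤s z≤n)) (ℕP.+-monoʳ-< J (s≤s (s≤s z≤n)))
         (subst (J + (2 + d) <_) (sym (LP.length-++ τ₁)) (ℕP.+-monoʳ-< J (s≤s (s≤s (proj₁ (proj₂ second))))))
         (trans (at-++ʳ τ₁ (m ∷ x ∷ τ₂) 0) (sym (trans (at-++ʳ τ₁ (m ∷ x ∷ τ₂) (2 + d)) (proj₂ (proj₂ second))))))

  remove-maximal-pair : ∀ n σ → IsStirling (suc n) σ →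
    Σ (List ℕ) λ τ₁ → Σ (List ℕ) λ τ₂ → σ ≡ τ₁ ++ suc n ∷ suc n ∷ τ₂ × IsStirling n (τ₁ ++ τ₂)
  remove-maximal-pair n σ q with firstOccurrence (suc n) σ (subst (0 <_) (sym (IsStirling.twice q n (ℕP.n<1+n n))) (s≤s z≤n))
  ... | τ₁ , ρ , refl , c1 with maximal-pair-adjacent n τ₁ ρ q cρ
    where
    m : ℕ
    m = suc n
    cρ : count m ρ ≡ 1
    cρ = ℕP.suc-injective (begin
      suc (count m ρ)                   ≡⟨ count-here m ρ ⟨
      count m (m ∷ ρ)                   ≡⟨ cong (_+ count m (m ∷ ρ)) c1 ⟨
      count m τ₁ + count m (m ∷ ρ)      ≡⟨ count-++ m τ₁ (m ∷ ρ) ⟨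
      count m (τ₁ ++ m ∷ ρ)             ≡⟨ IsStirling.twice q n (ℕP.n<1+n n) ⟩
      2                                 ∎)
      where open ≡-Reasoning
  ...   | τ₂ , refl , c2 = τ₁ , τ₂ , refl , IsStirling-remove n τ₁ τ₂ q c1 c2

  unique-insertPair : ∀ m τ → All (_< m) τ → Unique (insertPair m τ)
  unique-insertPair m []      _          = [] ∷ []
  unique-insertPair m (a ∷ v) (a< ∷ al) = All.tabulate differ ∷ UniqueP.map⁺ ∷-injectiveʳ (unique-insertPair m v al)
    where
    ∷-injectiveʳ : ∀ {xs ys : List ℕ} → _≡_ {A = List ℕ} (a ∷ xs) (a ∷ ys) → xs ≡ ys
    ∷-injectiveʳ refl = refl
    differ : ∀ {y} → y ∈ map (a ∷_) (insertPair m v) → (m ∷ m ∷ a ∷ v) ≢ y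
    differ my with ∈-map⁻ (a ∷_) my
    ... | _ , _ , refl = λ { refl → ℕP.<-irrefl refl a< }

  deleteLetter : ℕ → List ℕ → List ℕ
  deleteLetter m []      = []
  deleteLetter m (a ∷ w) = if a ≡ᵇ m then deleteLetter m w else a ∷ deleteLetter m w

  deleteLetter-++ : ∀ m xs ys → deleteLetter m (xs ++ ys) ≡ deleteLetter m xs ++ deleteLetter m ys
  deleteLetter-++ m []       ys = refl
  deleteLetter-++ m (a ∷ xs) ys with a ≡ᵇ m
  ... | true  = deleteLetter-++ m xs ys
  ... | false = cong (a ∷_) (deleteLetter-++ m xs ys)

  deleteLetter-absent : ∀ m w → All (_< m) w → deleteLetter m w ≡ w
  deleteLetter-absent m []      _          = refl
  deleteLetter-absent m (a ∷ w) (a< ∷ al) rewrite <⇒≢ᵇ a< = cong (a ∷_) (deleteLetter-absent m w al)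

  deleteLetter-insertPair : ∀ m τ σ → All (_< m) τ → σ ∈ insertPair m τ → deleteLetter m σ ≡ τ
  deleteLetter-insertPair m τ σ al mσ with insertPair-∈⁻ m τ σ mσ
  ... | τ₁ , τ₂ , refl , refl =
    trans (deleteLetter-++ m τ₁ (m ∷ m ∷ τ₂)) (cong₂ _++_ (deleteLetter-absent m τ₁ (AllP.++⁻ˡ τ₁ al)) dropPair)
    where
    dropPair : deleteLetter m (m ∷ m ∷ τ₂) ≡ τ₂
    dropPair rewrite ≡ᵇ-refl m = deleteLetter-absent m τ₂ (AllP.++⁻ʳ τ₁ al)

  𝒬-bounds : ∀ n τ → τ ∈ 𝒬 n → length τ ≡ 2 * n × All (_< suc n) τ
  𝒬-bounds n τ m = IsStirling.len (∈𝒬⇒IsStirling n τ m) , All.map Letter⇒< (IsStirling.letters (∈𝒬⇒IsStirling n τ m))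

  𝒬-step : ∀ n (g : List ℕ → ℕ) → sumOf g (𝒬 (suc n)) ≡ sumOf (λ τ → sumOf g (insertPair (suc n) τ)) (𝒬 n)
  𝒬-step n = sumOf-generated (𝒬 n) (𝒬 (suc n)) (insertPair (suc n)) (unique-𝒬 n) (unique-𝒬 (suc n))
    (λ mτ → unique-insertPair (suc n) _ (proj₂ (𝒬-bounds n _ mτ)))
    (λ mτ mτ' mσ mσ' → trans (sym (deleteLetter-insertPair (suc n) _ _ (proj₂ (𝒬-bounds n _ mτ)) mσ))
                             (deleteLetter-insertPair (suc n) _ _ (proj₂ (𝒬-bounds n _ mτ')) mσ'))
    into onto
    where
    into : ∀ {τ σ} → τ ∈ 𝒬 n → σ ∈ insertPair (suc n) τ → σ ∈ 𝒬 (suc n)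
    into {τ} {σ} mτ mσ with insertPair-∈⁻ (suc n) τ σ mσ
    ... | τ₁ , τ₂ , refl , refl = IsStirling⇒∈𝒬 (suc n) _ (IsStirling-insert n τ₁ τ₂ (∈𝒬⇒IsStirling n (τ₁ ++ τ₂) mτ))
    onto : ∀ {σ} → σ ∈ 𝒬 (suc n) → Σ (List ℕ) λ τ → τ ∈ 𝒬 n × σ ∈ insertPair (suc n) τ
    onto {σ} mσ with remove-maximal-pair n σ (∈𝒬⇒IsStirling (suc n) σ mσ)
    ... | τ₁ , τ₂ , refl , q = τ₁ ++ τ₂ , IsStirling⇒∈𝒬 n (τ₁ ++ τ₂) q , insertPair-∈⁺ (suc n) τ₁ τ₂

module SignedInsertion where

  open import Defs
  open NatFacts using (≡ᵇ-refl; ≡ᵇ⇒≡; <⇒≢ᵇ)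
  open FiniteSums using (sumOf; sumOf-generated)
  open Enumeration
  open import Data.Bool using (true; false; if_then_else_)
  open import Data.Nat as ℕ using (ℕ; suc; _+_; _<_; z≤n; s≤s; _≡ᵇ_)
  import Data.Nat.Properties as ℕP
  open import Data.Integer as ℤ using (ℤ; +_; -[1+_]; ∣_∣; -<+; +<+; -<-)
  open import Data.List using (List; []; _∷_; _++_; map; length)
  open import Data.List.Membership.Propositional using (_∈_)
  open import Data.List.Membership.Propositional.Properties using (∈-map⁺; ∈-map⁻)
  open import Data.List.Relation.Unary.Any using (here; there)
  open import Data.List.Relation.Unary.All using (All; []; _∷_)
  import Data.List.Relation.Unary.All as All
  import Data.List.Relation.Unary.All.Properties as AllP
  open import Data.List.Relation.Unary.Unique.Propositional using (Unique)
  import Data.List.Relation.Unary.Unique.Propositional.Properties as UniqueP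
  open import Data.List.Relation.Unary.AllPairs using ([]; _∷_)
  open import Data.Product using (Σ; _×_; _,_)
  open import Data.Sum using (_⊎_; inj₁; inj₂)
  open import Data.Empty using (⊥-elim)
  open import Relation.Binary.PropositionalEquality
  open import Relation.Nullary using (¬_)
  open import Relation.Binary.Definitions using (tri<; tri≈; tri>)

  -- Every signed permutation of [n+1] arises in exactly one way from one of [n]
  -- by inserting +(n+1) or -(n+1) into one of its n+1 gaps.

  IsTop : ℕ → ℤ → Set
  IsTop n x = x ≡ + suc n ⊎ x ≡ -[1+ n ]

  IsTop-abs : ∀ {n x} → IsTop n x → ∣ x ∣ ≡ suc n
  IsTop-abs (inj₁ refl) = refl
  IsTop-abs (inj₂ refl) = refl

  insertTop : ℕ → List ℤ → List (List ℤ)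
  insertTop n []      = (+ suc n ∷ []) ∷ (-[1+ n ] ∷ []) ∷ []
  insertTop n (a ∷ v) = (+ suc n ∷ a ∷ v) ∷ (-[1+ n ] ∷ a ∷ v) ∷ map (a ∷_) (insertTop n v)

  insertTop-∈⁻ : ∀ n π σ → σ ∈ insertTop n π →
    Σ (List ℤ) λ π₁ → Σ (List ℤ) λ π₂ → Σ ℤ λ x → IsTop n x × π ≡ π₁ ++ π₂ × σ ≡ π₁ ++ x ∷ π₂
  insertTop-∈⁻ n []      σ (here refl)         = [] , [] , _ , inj₁ refl , refl , refl
  insertTop-∈⁻ n []      σ (there (here refl)) = [] , [] , _ , inj₂ refl , refl , refl
  insertTop-∈⁻ n (a ∷ v) σ (here refl)         = [] , a ∷ v , _ , inj₁ refl , refl , refl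
  insertTop-∈⁻ n (a ∷ v) σ (there (here refl)) = [] , a ∷ v , _ , inj₂ refl , refl , refl
  insertTop-∈⁻ n (a ∷ v) σ (there (there mm)) with ∈-map⁻ (a ∷_) mm
  ... | σ' , m' , refl with insertTop-∈⁻ n v σ' m'
  ...   | π₁ , π₂ , x , ix , refl , refl = a ∷ π₁ , π₂ , x , ix , refl , refl

  insertTop-∈⁺ : ∀ n π₁ π₂ x → IsTop n x → (π₁ ++ x ∷ π₂) ∈ insertTop n (π₁ ++ π₂)
  insertTop-∈⁺ n []       []       x (inj₁ refl) = here refl
  insertTop-∈⁺ n []       []       x (inj₂ refl) = there (here refl)
  insertTop-∈⁺ n []       (a ∷ π₂) x (inj₁ refl) = here refl
  insertTop-∈⁺ n []       (a ∷ π₂) x (inj₂ refl) = there (here refl)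
  insertTop-∈⁺ n (a ∷ π₁) π₂       x ix          = there (there (∈-map⁺ (a ∷_) (insertTop-∈⁺ n π₁ π₂ x ix)))

  count-insertOne : ∀ a π₁ π₂ x →
    count a (map ∣_∣ (π₁ ++ x ∷ π₂)) ≡ (if a ≡ᵇ ∣ x ∣ then 1 else 0) + count a (map ∣_∣ (π₁ ++ π₂))
  count-insertOne a []       π₂ x with a ≡ᵇ ∣ x ∣
  ... | true  = refl
  ... | false = refl
  count-insertOne a (b ∷ π₁) π₂ x with a ≡ᵇ ∣ b ∣
  ... | true  = trans (cong suc (count-insertOne a π₁ π₂ x)) (sym (ℕP.+-suc (if a ≡ᵇ ∣ x ∣ then 1 else 0) _))
  ... | false = count-insertOne a π₁ π₂ x

  length-++₁ : ∀ (π₁ π₂ : List ℤ) x → length (π₁ ++ x ∷ π₂) ≡ suc (length (π₁ ++ π₂))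
  length-++₁ []       π₂ x = refl
  length-++₁ (a ∷ π₁) π₂ x = cong suc (length-++₁ π₁ π₂ x)

  IsSignedPerm-insert : ∀ n π₁ π₂ x → IsTop n x → IsSignedPerm n (π₁ ++ π₂) → IsSignedPerm (suc n) (π₁ ++ x ∷ π₂)
  IsSignedPerm-insert n π₁ π₂ x ix q = record
    { len     = trans (length-++₁ π₁ π₂ x) (cong suc (IsSignedPerm.len q))
    ; letters = AllP.++⁺ (All.map SignedLetter-weaken (AllP.++⁻ˡ π₁ (IsSignedPerm.letters q)))
                         (topLetter ix ∷ All.map SignedLetter-weaken (AllP.++⁻ʳ π₁ (IsSignedPerm.letters q)))
    ; once    = once }
    where
    topLetter : ∀ {x} → IsTop n x → SignedLetter (suc n) x
    topLetter (inj₁ refl) = n , ℕP.n<1+n n , inj₁ refl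
    topLetter (inj₂ refl) = n , ℕP.n<1+n n , inj₂ refl
    once : ∀ i → i < suc n → count (suc i) (map ∣_∣ (π₁ ++ x ∷ π₂)) ≡ 1
    once i i< with ℕP.<-cmp i n
    ... | tri< i<n _ _ rewrite count-insertOne (suc i) π₁ π₂ x | IsTop-abs ix | <⇒≢ᵇ i<n = IsSignedPerm.once q i i<n
    ... | tri≈ _ refl _ rewrite count-insertOne (suc i) π₁ π₂ x | IsTop-abs ix | ≡ᵇ-refl i =
          cong suc (count-absent (suc i) (map ∣_∣ (π₁ ++ π₂)) (AllP.map⁺ (All.map differ (IsSignedPerm.letters q))))
      where
      differ : ∀ {y} → SignedLetter i y → suc i ≢ ∣ y ∣
      differ sy e with SignedLetter-abs sy
      ... | j , j< , ey = ℕP.<-irrefl (sym (ℕP.suc-injective (trans e ey))) j<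
    ... | tri> _ _ n<i = ⊥-elim (ℕP.<⇒≱ n<i (ℕP.≤-pred i<))

  firstSignedOccurrence : ∀ a w → 0 < count a (map ∣_∣ w) →
    Σ (List ℤ) λ π₁ → Σ ℤ λ x → Σ (List ℤ) λ ρ → w ≡ π₁ ++ x ∷ ρ × ∣ x ∣ ≡ a × count a (map ∣_∣ π₁) ≡ 0
  firstSignedOccurrence a (b ∷ w) p with a ≡ᵇ ∣ b ∣ in eq
  ... | true  = [] , b , w , refl , sym (≡ᵇ⇒≡ eq) , refl
  ... | false with firstSignedOccurrence a w p
  ...   | π₁ , x , ρ , e , ex , c = b ∷ π₁ , x , ρ , cong (b ∷_) e , ex , trans (count-there a ∣ b ∣ (map ∣_∣ π₁) eq) c

  remove-top : ∀ n σ → IsSignedPerm (suc n) σ →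
    Σ (List ℤ) λ π₁ → Σ (List ℤ) λ π₂ → Σ ℤ λ x → IsTop n x × σ ≡ π₁ ++ x ∷ π₂ × IsSignedPerm n (π₁ ++ π₂)
  remove-top n σ q with firstSignedOccurrence (suc n) σ (subst (0 <_) (sym (IsSignedPerm.once q n (ℕP.n<1+n n))) (s≤s z≤n))
  ... | π₁ , x , ρ , refl , ex , _ = π₁ , ρ , x , isTop , refl , record { len = len ; letters = letters ; once = once }
    where
    lettersσ : All (SignedLetter (suc n)) (π₁ ++ x ∷ ρ)
    lettersσ = IsSignedPerm.letters q
    isTop : IsTop n x
    isTop with AllP.++⁻ʳ π₁ lettersσ
    ... | (i , _ , inj₁ refl) ∷ _ = inj₁ (cong +_ ex)
    ... | (i , _ , inj₂ refl) ∷ _ rewrite ℕP.suc-injective ex = inj₂ refl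
    insertedOnce : ∀ i → (suc i ≡ᵇ ∣ x ∣) ≡ (suc i ≡ᵇ suc n)
    insertedOnce i = cong (suc i ≡ᵇ_) ex
    topAbsent : count (suc n) (map ∣_∣ (π₁ ++ ρ)) ≡ 0
    topAbsent = ℕP.suc-injective (trans (sym (trans (count-insertOne (suc n) π₁ ρ x)
      (cong (λ b → (if b then 1 else 0) + count (suc n) (map ∣_∣ (π₁ ++ ρ))) (trans (insertedOnce n) (≡ᵇ-refl n)))))
      (IsSignedPerm.once q n (ℕP.n<1+n n)))
    len : length (π₁ ++ ρ) ≡ n
    len = ℕP.suc-injective (trans (sym (length-++₁ π₁ ρ x)) (IsSignedPerm.len q))
    shrink : ∀ {y} → SignedLetter (suc n) y × suc n ≢ ∣ y ∣ → SignedLetter n y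
    shrink ((i , i< , e) , ne) = i , ℕP.≤∧≢⇒< (ℕP.≤-pred i<) (λ { refl → ne (sym (abs e)) }) , e
      where
      abs : ∀ {y i} → (y ≡ + suc i ⊎ y ≡ -[1+ i ]) → ∣ y ∣ ≡ suc i
      abs (inj₁ refl) = refl
      abs (inj₂ refl) = refl
    dropHead : ∀ {P : ℤ → Set} {y ys} → All P (y ∷ ys) → All P ys
    dropHead (_ ∷ a) = a
    letters : All (SignedLetter n) (π₁ ++ ρ)
    letters = All.zipWith shrink (AllP.++⁺ (AllP.++⁻ˡ π₁ lettersσ) (dropHead (AllP.++⁻ʳ π₁ lettersσ)) ,
                                  AllP.map⁻ (count-zero (suc n) (map ∣_∣ (π₁ ++ ρ)) topAbsent))
    once : ∀ i → i < n → count (suc i) (map ∣_∣ (π₁ ++ ρ)) ≡ 1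
    once i i< = trans (sym (trans (count-insertOne (suc i) π₁ ρ x)
      (cong (λ b → (if b then 1 else 0) + count (suc i) (map ∣_∣ (π₁ ++ ρ))) (trans (insertedOnce i) (<⇒≢ᵇ i<)))))
      (IsSignedPerm.once q i (ℕP.m≤n⇒m≤1+n i<))

  unique-insertTop : ∀ n π → All (SignedLetter n) π → Unique (insertTop n π)
  unique-insertTop n []      _          = ((λ ()) ∷ []) ∷ [] ∷ []
  unique-insertTop n (a ∷ v) (sa ∷ al) =
    ((λ ()) ∷ All.tabulate (differ (+ suc n) (notTop sa ∘ inj₁ ∘ sym))) ∷ All.tabulate (differ -[1+ n ] (notTop sa ∘ inj₂ ∘ sym))
      ∷ UniqueP.map⁺ ∷-injectiveʳ (unique-insertTop n v al)
    where
    open import Function using (_∘_)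
    notTop : ∀ {a} → SignedLetter n a → ¬ IsTop n a
    notTop sa t with SignedLetter-abs sa
    ... | i , i< , e = ℕP.<-irrefl (ℕP.suc-injective (trans (sym e) (IsTop-abs t))) i<
    ∷-injectiveʳ : ∀ {xs ys : List ℤ} → _≡_ {A = List ℤ} (a ∷ xs) (a ∷ ys) → xs ≡ ys
    ∷-injectiveʳ refl = refl
    differ : ∀ x → x ≢ a → ∀ {y} → y ∈ map (a ∷_) (insertTop n v) → (x ∷ a ∷ v) ≢ y
    differ x x≢a my with ∈-map⁻ (a ∷_) my
    ... | _ , _ , refl = λ { refl → x≢a refl }

  deleteTop : ℕ → List ℤ → List ℤ
  deleteTop n []      = []
  deleteTop n (a ∷ w) = if ∣ a ∣ ≡ᵇ suc n then deleteTop n w else a ∷ deleteTop n w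

  deleteTop-++ : ∀ n xs ys → deleteTop n (xs ++ ys) ≡ deleteTop n xs ++ deleteTop n ys
  deleteTop-++ n []       ys = refl
  deleteTop-++ n (a ∷ xs) ys with ∣ a ∣ ≡ᵇ suc n
  ... | true  = deleteTop-++ n xs ys
  ... | false = cong (a ∷_) (deleteTop-++ n xs ys)

  deleteTop-absent : ∀ n w → All (SignedLetter n) w → deleteTop n w ≡ w
  deleteTop-absent n []      _          = refl
  deleteTop-absent n (a ∷ w) (sa ∷ al) with SignedLetter-abs sa
  ... | i , i< , e rewrite e | <⇒≢ᵇ i< = cong (a ∷_) (deleteTop-absent n w al)

  deleteTop-insertTop : ∀ n π σ → All (SignedLetter n) π → σ ∈ insertTop n π → deleteTop n σ ≡ π
  deleteTop-insertTop n π σ al mσ with insertTop-∈⁻ n π σ mσ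
  ... | π₁ , π₂ , x , ix , refl , refl =
    trans (deleteTop-++ n π₁ (x ∷ π₂)) (cong₂ _++_ (deleteTop-absent n π₁ (AllP.++⁻ˡ π₁ al)) dropTop)
    where
    dropTop : deleteTop n (x ∷ π₂) ≡ π₂
    dropTop rewrite IsTop-abs ix | ≡ᵇ-refl n = deleteTop-absent n π₂ (AllP.++⁻ʳ π₁ al)

  Bounded : ℕ → ℤ → Set
  Bounded n x = -[1+ n ] ℤ.< x × x ℤ.< + suc n

  B-bounds : ∀ n π → π ∈ B n → length π ≡ n × All (Bounded n) π
  B-bounds n π m = IsSignedPerm.len (∈B⇒IsSignedPerm n π m) , All.map bounded (IsSignedPerm.letters (∈B⇒IsSignedPerm n π m))
    where
    bounded : ∀ {x} → SignedLetter n x → Bounded n x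
    bounded (i , i< , inj₁ refl) = -<+ , +<+ (s≤s i<)
    bounded (i , i< , inj₂ refl) = -<- i< , -<+

  B-step : ∀ n (g : List ℤ → ℕ) → sumOf g (B (suc n)) ≡ sumOf (λ π → sumOf g (insertTop n π)) (B n)
  B-step n = sumOf-generated (B n) (B (suc n)) (insertTop n) (unique-B n) (unique-B (suc n))
    (λ mπ → unique-insertTop n _ (letters mπ))
    (λ mπ mπ' mσ mσ' → trans (sym (deleteTop-insertTop n _ _ (letters mπ) mσ)) (deleteTop-insertTop n _ _ (letters mπ') mσ'))
    into onto
    where
    letters : ∀ {π} → π ∈ B n → All (SignedLetter n) π
    letters mπ = IsSignedPerm.letters (∈B⇒IsSignedPerm n _ mπ)
    into : ∀ {π σ} → π ∈ B n → σ ∈ insertTop n π → σ ∈ B (suc n)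
    into {π} {σ} mπ mσ with insertTop-∈⁻ n π σ mσ
    ... | π₁ , π₂ , x , ix , refl , refl =
      IsSignedPerm⇒∈B (suc n) _ (IsSignedPerm-insert n π₁ π₂ x ix (∈B⇒IsSignedPerm n (π₁ ++ π₂) mπ))
    onto : ∀ {σ} → σ ∈ B (suc n) → Σ (List ℤ) λ π → π ∈ B n × σ ∈ insertTop n π
    onto {σ} mσ with remove-top n σ (∈B⇒IsSignedPerm (suc n) σ mσ)
    ... | π₁ , π₂ , x , ix , refl , q = π₁ ++ π₂ , IsSignedPerm⇒∈B n (π₁ ++ π₂) q , insertTop-∈⁺ n π₁ π₂ x ix

module StirlingStatistics where

  open import Defs
  open NatFacts using (≡ᵇ-refl; ≡ᵇ⇒≡; <ᵇ-irrefl; <⇒<ᵇ; <⇒≢ᵇ; <⇒≮ᵇ; ∧-true⁻; ind; ∸-from; 2*suc)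
  open FiniteSums using (sumOf; sumOf-map; sumOf-cong)
  open StirlingInsertion using (insertPair)
  open import Data.Bool using (Bool; true; false; _∧_)
  import Data.Bool.Properties as BP
  open import Data.Nat as ℕ using (ℕ; suc; _+_; _*_; _∸_; _≤_; _<_; z≤n; s≤s; _≡ᵇ_; _<ᵇ_)
  import Data.Nat.Properties as ℕP
  open import Data.List using (List; []; _∷_; map; length)
  open import Data.List.Relation.Unary.All using (All; []; _∷_)
  open import Data.Product using (proj₂)
  open import Relation.Binary.PropositionalEquality
  open import Data.Nat.Tactic.RingSolver using (solve-∀)

  -- Inserting into the middle of an
  -- ascent-plateau or just before it destroys it; every other insertion after
  -- the first letter creates the new ascent-plateau m m.

  startsPlateau : ℕ → List ℕ → Bool
  startsPlateau p (b ∷ c ∷ w) = (p <ᵇ b) ∧ (b ≡ᵇ c)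
  startsPlateau p _           = false

  plateauAt : ℕ → List ℕ → ℕ
  plateauAt p v = ind (startsPlateau p v)

  ap-cons : ∀ p v → ap (p ∷ v) ≡ plateauAt p v + ap v
  ap-cons p []          = refl
  ap-cons p (b ∷ [])    = refl
  ap-cons p (b ∷ c ∷ w) = refl

  plateaus-not-adjacent : ∀ p b c v → ((p <ᵇ b) ∧ (b ≡ᵇ c)) ∧ startsPlateau b (c ∷ v) ≡ false
  plateaus-not-adjacent p b c []      = BP.∧-zeroʳ _
  plateaus-not-adjacent p b c (d ∷ v) with b ≡ᵇ c in eq
  ... | false rewrite BP.∧-zeroʳ (p <ᵇ b) = refl
  ... | true  rewrite ≡ᵇ⇒≡ {b} {c} eq | <ᵇ-irrefl c = BP.∧-zeroʳ _

  insertPairAfterHead : ℕ → List ℕ → List (List ℕ)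
  insertPairAfterHead m []      = []
  insertPairAfterHead m (b ∷ v) = map (b ∷_) (insertPair m v)

  record TailCount (m : ℕ) (p : ℕ) (v : List ℕ) : Set where
    field
      kept raised : ℕ
      kept-eq     : kept + plateauAt p v ≡ 2 * ap (p ∷ v)
      raised-eq   : raised + 2 * ap (p ∷ v) ≡ length v + plateauAt p v
      sum-eq      : ∀ (G : ℕ → ℕ) → sumOf (λ u → G (ap (p ∷ u))) (insertPairAfterHead m v)
                      ≡ kept * G (ap (p ∷ v)) + raised * G (suc (ap (p ∷ v)))

  -- The induction step for TailCount, abstracted over the Boolean x (a plateau at
  -- the new second letter) and y (a plateau at the old second letter).
  record TailStep (x : Bool) (r A k₀ k₀' L : ℕ) : Set where
    field
      kept raised : ℕ
      kept-eq     : kept + ind x ≡ 2 * (ind x + A)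
      raised-eq   : raised + 2 * (ind x + A) ≡ suc L + ind x
      sum-eq      : ∀ (G : ℕ → ℕ) → G (suc r) + (k₀ * G (ind x + A) + k₀' * G (ind x + suc A))
                      ≡ kept * G (ind x + A) + raised * G (suc (ind x + A))

  tailStep : ∀ (x y : Bool) → (x ∧ y) ≡ false → ∀ r A k₀ k₀' L →
    A ≡ ind y + r → k₀ + ind y ≡ 2 * A → k₀' + 2 * A ≡ L + ind y → TailStep x r A k₀ k₀' L
  tailStep true true () r A k₀ k₀' L eA e1 e2
  tailStep true false _ r .r k₀ k₀' L refl e1 e2 = record
    { kept = suc k₀ ; raised = k₀'
    ; kept-eq = trans (cong suc (ℕP.+-comm k₀ 1)) (trans (cong (2 +_) (trans (sym (ℕP.+-identityʳ k₀)) e1)) (sym (2*suc r)))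
    ; raised-eq = trans (cong (k₀' +_) (2*suc r))
        (trans (ℕP.+-comm k₀' (2 + 2 * r))
        (trans (cong (2 +_) (trans (ℕP.+-comm (2 * r) k₀') (trans e2 (ℕP.+-identityʳ L)))) (sym (ℕP.+-comm (suc L) 1))))
    ; sum-eq = λ G → sym (ℕP.+-assoc (G (suc r)) _ _) }
  tailStep false true _ r .(suc r) k₀ k₀' L refl e1 e2 = record
    { kept = suc k₀ ; raised = k₀'
    ; kept-eq = trans (ℕP.+-identityʳ (suc k₀)) (trans (ℕP.+-comm 1 k₀) e1)
    ; raised-eq = trans e2 (trans (ℕP.+-comm L 1) (sym (ℕP.+-identityʳ (suc L))))
    ; sum-eq = λ G → sym (ℕP.+-assoc (G (suc r)) _ _) }
  tailStep false false _ r .r k₀ k₀' L refl e1 e2 = record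
    { kept = k₀ ; raised = suc k₀' ; kept-eq = e1 ; raised-eq = cong suc e2
    ; sum-eq = λ G → swap (G (suc r)) (G r) k₀ k₀' }
    where
    swap : ∀ a b k₀ k₀' → a + (k₀ * b + k₀' * a) ≡ k₀ * b + (a + k₀' * a)
    swap = solve-∀

  module _ (m : ℕ) where
    ap-pairFront : ∀ v → All (_< m) v → ap (m ∷ m ∷ v) ≡ ap v
    ap-pairFront []      _          = refl
    ap-pairFront (c ∷ v) (c< ∷ _) rewrite <ᵇ-irrefl m | ap-cons m (c ∷ v) with v
    ... | []     = refl
    ... | d ∷ v' rewrite <⇒≮ᵇ c< = refl

    ap-pairAfter : ∀ p v → p < m → All (_< m) v → ap (p ∷ m ∷ m ∷ v) ≡ suc (ap v)
    ap-pairAfter p v p< al rewrite <⇒<ᵇ p< | ≡ᵇ-refl m = cong suc (ap-pairFront v al)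

    ap-pairThird : ∀ p b v → b < m → All (_< m) v → ap (p ∷ b ∷ m ∷ m ∷ v) ≡ suc (ap v)
    ap-pairThird p b v b< al rewrite <⇒≢ᵇ b< | BP.∧-zeroʳ (p <ᵇ b) = ap-pairAfter b v b< al

    tailCount : ∀ p v → p < m → All (_< m) v → TailCount m p v
    tailCount p []          p< al         = record { kept = 0 ; raised = 0 ; kept-eq = refl ; raised-eq = refl ; sum-eq = λ G → refl }
    tailCount p (b ∷ [])    p< (b< ∷ []) = record { kept = 0 ; raised = 1 ; kept-eq = refl ; raised-eq = refl
                                                    ; sum-eq = λ G → cong (_+ 0) (cong G (ap-pairThird p b [] b< [])) }
    tailCount p (b ∷ c ∷ v) p< (b< ∷ al) = record
      { kept = S.kept ; raised = S.raised ; kept-eq = S.kept-eq ; raised-eq = S.raised-eq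
      ; sum-eq = λ G → trans (unfold G) (S.sum-eq G) }
      where
      I : TailCount m b (c ∷ v)
      I = tailCount b (c ∷ v) b< al
      module I = TailCount I
      x : Bool
      x = (p <ᵇ b) ∧ (b ≡ᵇ c)
      S : TailStep x (ap (c ∷ v)) (ap (b ∷ c ∷ v)) I.kept I.raised (suc (length v))
      S = tailStep x (startsPlateau b (c ∷ v)) (plateaus-not-adjacent p b c v) (ap (c ∷ v)) (ap (b ∷ c ∷ v))
            I.kept I.raised (suc (length v)) (ap-cons b (c ∷ v)) I.kept-eq I.raised-eq
      module S = TailStep S
      -- the first insertion after b creates a plateau; the others are those of b ∷ c ∷ v
      unfold : ∀ (G : ℕ → ℕ) → sumOf (λ u → G (ap (p ∷ u))) (insertPairAfterHead m (b ∷ c ∷ v))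
        ≡ G (suc (ap (c ∷ v))) + (I.kept * G (ind x + ap (b ∷ c ∷ v)) + I.raised * G (ind x + suc (ap (b ∷ c ∷ v))))
      unfold G = trans (sumOf-map (λ u → G (ap (p ∷ u))) (b ∷_) (insertPair m (c ∷ v)))
        (cong₂ _+_ (cong G (ap-pairThird p b (c ∷ v) b< al))
          (trans (sumOf-map (λ u → G (ap (p ∷ b ∷ u))) (c ∷_) (insertPair m v))
          (trans (sym (sumOf-map (λ u → G (ind x + ap (b ∷ u))) (c ∷_) (insertPair m v)))
                 (I.sum-eq (λ z → G (ind x + z))))))

  insertPair-unfold₂ : ∀ m a b v (h : List ℕ → ℕ) → sumOf h (insertPair m (a ∷ b ∷ v)) ≡
    h (m ∷ m ∷ a ∷ b ∷ v) + h (a ∷ m ∷ m ∷ b ∷ v) + sumOf (λ u → h (a ∷ b ∷ u)) (insertPair m v)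
  insertPair-unfold₂ m a b v h = trans (cong (h (m ∷ m ∷ a ∷ b ∷ v) +_)
    (trans (sumOf-map h (a ∷_) (insertPair m (b ∷ v)))
           (cong (h (a ∷ m ∷ m ∷ b ∷ v) +_) (sumOf-map (λ u → h (a ∷ u)) (b ∷_) (insertPair m v)))))
    (sym (ℕP.+-assoc (h (m ∷ m ∷ a ∷ b ∷ v)) _ _))

  startsEqual : List ℕ → Bool
  startsEqual (a ∷ b ∷ _) = a ≡ᵇ b
  startsEqual _           = false

  fap≡flag+2ap : ∀ σ → fap σ ≡ ind (startsEqual σ) + 2 * ap σ
  fap≡flag+2ap []          = refl
  fap≡flag+2ap (a ∷ [])    = refl
  fap≡flag+2ap (a ∷ b ∷ w) with a ≡ᵇ b
  ... | true  = refl
  ... | false = refl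

  -- The joint distribution of (flag, ap) over the insertions into a ∷ b ∷ v:
  -- inserting in front gives (1, ap w), inserting after a gives (0, 1 + ap (b ∷ v)),
  -- and the remaining insertions keep the flag of w and are counted by tailCount.
  insertPair-profile : ∀ m a b v (a< : a < m) (al : All (_< m) (b ∷ v)) (G : ℕ → ℕ → ℕ) →
    let T = tailCount m a (b ∷ v) a< al ; A = ap (a ∷ b ∷ v) ; e = ind (a ≡ᵇ b) in
    sumOf (λ σ → G (ind (startsEqual σ)) (ap σ)) (insertPair m (a ∷ b ∷ v))
      ≡ G 1 A + G 0 (suc (ap (b ∷ v))) + (TailCount.kept T * G e A + TailCount.raised T * G e (suc A))
  insertPair-profile m a b v a< al G = trans (insertPair-unfold₂ m a b v (λ σ → G (ind (startsEqual σ)) (ap σ)))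
    (cong₃ (λ x y z → x + y + z) front afterA
      (trans (sym (sumOf-map (λ u → G e (ap (a ∷ u))) (b ∷_) (insertPair m v))) (T.sum-eq (G e))))
    where
    T : TailCount m a (b ∷ v)
    T = tailCount m a (b ∷ v) a< al
    module T = TailCount T
    e : ℕ
    e = ind (a ≡ᵇ b)
    front : G (ind (startsEqual (m ∷ m ∷ a ∷ b ∷ v))) (ap (m ∷ m ∷ a ∷ b ∷ v)) ≡ G 1 (ap (a ∷ b ∷ v))
    front rewrite ≡ᵇ-refl m = cong (G 1) (ap-pairFront m (a ∷ b ∷ v) (a< ∷ al))
    afterA : G (ind (startsEqual (a ∷ m ∷ m ∷ b ∷ v))) (ap (a ∷ m ∷ m ∷ b ∷ v)) ≡ G 0 (suc (ap (b ∷ v)))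
    afterA rewrite <⇒≢ᵇ a< = cong (G 0) (ap-pairAfter m a (b ∷ v) a< al)
    cong₃ : ∀ (f : ℕ → ℕ → ℕ → ℕ) {x x' y y' z z'} → x ≡ x' → y ≡ y' → z ≡ z' → f x y z ≡ f x' y' z'
    cong₃ f refl refl refl = refl

  equalStart-noPlateau : ∀ a b v → (a ≡ᵇ b) ≡ true → plateauAt a (b ∷ v) ≡ 0
  equalStart-noPlateau a b []      e = refl
  equalStart-noPlateau a b (c ∷ v) e rewrite ≡ᵇ⇒≡ {a} {b} e | <ᵇ-irrefl b = refl

  -- Arithmetic closing the computations below: the counts k, k' of a tail are
  -- determined by their defining equations, leaving a ring identity.

  close-plateau : ∀ t k k' (g0 g1 g2 : ℕ) → k + 1 ≡ t → g1 + g0 + (k * g0 + k' * g2) ≡ t * g0 + g1 + k' * g2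
  close-plateau .(k + 1) k k' g0 g1 g2 refl = solve k k' g0 g1 g2
    where
    solve : ∀ k k' g0 g1 g2 → g1 + g0 + (k * g0 + k' * g2) ≡ (k + 1) * g0 + g1 + k' * g2
    solve = solve-∀

  close-plain : ∀ t k k' (g0 g1 g2 : ℕ) → k + 0 ≡ t → g1 + g2 + (k * g0 + k' * g2) ≡ t * g0 + g1 + suc k' * g2
  close-plain .(k + 0) k k' g0 g1 g2 refl = solve k k' g0 g1 g2
    where
    solve : ∀ k k' g0 g1 g2 → g1 + g2 + (k * g0 + k' * g2) ≡ (k + 0) * g0 + g1 + suc k' * g2
    solve = solve-∀

  close-flagged : ∀ t k k' (g0 g1 g2 : ℕ) → k ≡ t → g0 + g1 + (k * g0 + k' * g2) ≡ suc t * g0 + g1 + k' * g2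
  close-flagged .k k k' g0 g1 g2 refl = solve k k' g0 g1 g2
    where
    solve : ∀ k k' g0 g1 g2 → g0 + g1 + (k * g0 + k' * g2) ≡ suc k * g0 + g1 + k' * g2
    solve = solve-∀

  close-ap-plateau : ∀ t k k' (g0 g2 : ℕ) → k + 1 ≡ t → g0 + g0 + (k * g0 + k' * g2) ≡ suc t * g0 + k' * g2
  close-ap-plateau .(k + 1) k k' g0 g2 refl = solve k k' g0 g2
    where
    solve : ∀ k k' g0 g2 → g0 + g0 + (k * g0 + k' * g2) ≡ suc (k + 1) * g0 + k' * g2
    solve = solve-∀

  close-ap-plain : ∀ t k k' (g0 g2 : ℕ) → k + 0 ≡ t → g0 + g2 + (k * g0 + k' * g2) ≡ suc t * g0 + suc k' * g2
  close-ap-plain .(k + 0) k k' g0 g2 refl = solve k k' g0 g2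
    where
    solve : ∀ k k' g0 g2 → g0 + g2 + (k * g0 + k' * g2) ≡ suc (k + 0) * g0 + suc k' * g2
    solve = solve-∀

  ap-insertPair : ∀ m w → All (_< m) w → ∀ (G : ℕ → ℕ) →
    sumOf (λ σ → G (2 * ap σ)) (insertPair m w) ≡ suc (2 * ap w) * G (2 * ap w) + (length w ∸ 2 * ap w) * G (2 + 2 * ap w)
  ap-insertPair m [] al G = sym (ℕP.+-identityʳ _)
  ap-insertPair m (a ∷ []) (a< ∷ []) G rewrite <ᵇ-irrefl m | <⇒<ᵇ a< | ≡ᵇ-refl m = solve (G 0) (G 2)
    where
    solve : ∀ x y → x + (y + 0) ≡ x + 0 + (y + 0)
    solve = solve-∀
  ap-insertPair m (a ∷ b ∷ v) (a< ∷ al) G =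
    trans (insertPair-profile m a b v a< al (λ _ x → G (2 * x))) (close (startsPlateau a (b ∷ v)) refl)
    where
    open ≡-Reasoning
    T : TailCount m a (b ∷ v)
    T = tailCount m a (b ∷ v) a< al
    module T = TailCount T
    A r L : ℕ
    A = ap (a ∷ b ∷ v)
    r = ap (b ∷ v)
    L = length (b ∷ v)
    close : ∀ x → startsPlateau a (b ∷ v) ≡ x →
      G (2 * A) + G (2 * suc r) + (T.kept * G (2 * A) + T.raised * G (2 * suc A))
        ≡ suc (2 * A) * G (2 * A) + (suc L ∸ 2 * A) * G (2 + 2 * A)
    close true ex = begin
      G (2 * A) + G (2 * suc r) + (T.kept * G (2 * A) + T.raised * G (2 * suc A))
        ≡⟨ cong₂ (λ y z → G (2 * A) + G y + (T.kept * G (2 * A) + T.raised * G z)) (cong (2 *_) (sym A≡)) (2*suc A) ⟩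
      G (2 * A) + G (2 * A) + (T.kept * G (2 * A) + T.raised * G (2 + 2 * A))
        ≡⟨ close-ap-plateau (2 * A) T.kept T.raised (G (2 * A)) (G (2 + 2 * A)) (trans (cong (λ z → T.kept + ind z) (sym ex)) T.kept-eq) ⟩
      suc (2 * A) * G (2 * A) + T.raised * G (2 + 2 * A)
        ≡⟨ cong (λ z → suc (2 * A) * G (2 * A) + z * G (2 + 2 * A))
                (sym (∸-from T.raised (2 * A) (suc L) (trans T.raised-eq (trans (cong (λ z → L + ind z) ex) (ℕP.+-comm L 1))))) ⟩
      suc (2 * A) * G (2 * A) + (suc L ∸ 2 * A) * G (2 + 2 * A) ∎
      where
      A≡ : A ≡ suc r
      A≡ = trans (ap-cons a (b ∷ v)) (cong (λ z → ind z + r) ex)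
    close false ex = begin
      G (2 * A) + G (2 * suc r) + (T.kept * G (2 * A) + T.raised * G (2 * suc A))
        ≡⟨ cong₂ (λ y z → G (2 * A) + G y + (T.kept * G (2 * A) + T.raised * G z))
                 (trans (2*suc r) (cong (λ z → 2 + 2 * z) (sym A≡))) (2*suc A) ⟩
      G (2 * A) + G (2 + 2 * A) + (T.kept * G (2 * A) + T.raised * G (2 + 2 * A))
        ≡⟨ close-ap-plain (2 * A) T.kept T.raised (G (2 * A)) (G (2 + 2 * A)) (trans (cong (λ z → T.kept + ind z) (sym ex)) T.kept-eq) ⟩
      suc (2 * A) * G (2 * A) + suc T.raised * G (2 + 2 * A)
        ≡⟨ cong (λ z → suc (2 * A) * G (2 * A) + z * G (2 + 2 * A))
                (sym (∸-from (suc T.raised) (2 * A) (suc L) (cong suc (trans T.raised-eq (trans (cong (λ z → L + ind z) ex) (ℕP.+-identityʳ L)))))) ⟩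
      suc (2 * A) * G (2 * A) + (suc L ∸ 2 * A) * G (2 + 2 * A) ∎
      where
      A≡ : A ≡ r
      A≡ = trans (ap-cons a (b ∷ v)) (cong (λ z → ind z + r) ex)

  fap-insertPair : ∀ m w → All (_< m) w → ∀ (G : ℕ → ℕ) →
    sumOf (λ σ → G (fap σ)) (insertPair m w) ≡ fap w * G (fap w) + G (suc (fap w)) + (length w ∸ fap w) * G (2 + fap w)
  fap-insertPair m [] al G rewrite ≡ᵇ-refl m = refl
  fap-insertPair m (a ∷ []) (a< ∷ []) G rewrite ≡ᵇ-refl m | <⇒≢ᵇ a< | <⇒<ᵇ a< | <ᵇ-irrefl m = refl
  fap-insertPair m (a ∷ b ∷ v) (a< ∷ al) G = begin
    sumOf (λ σ → G (fap σ)) (insertPair m (a ∷ b ∷ v))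
      ≡⟨ sumOf-cong (λ σ → cong G (fap≡flag+2ap σ)) (insertPair m (a ∷ b ∷ v)) ⟩
    sumOf (λ σ → G (ind (startsEqual σ) + 2 * ap σ)) (insertPair m (a ∷ b ∷ v))
      ≡⟨ insertPair-profile m a b v a< al (λ e x → G (e + 2 * x)) ⟩
    G (1 + 2 * A) + G (2 * suc r) + (T.kept * G (ind (a ≡ᵇ b) + 2 * A) + T.raised * G (ind (a ≡ᵇ b) + 2 * suc A))
      ≡⟨ close (a ≡ᵇ b) refl (startsPlateau a (b ∷ v)) refl ⟩
    (ind (a ≡ᵇ b) + 2 * A) * G (ind (a ≡ᵇ b) + 2 * A) + G (suc (ind (a ≡ᵇ b) + 2 * A))
      + (suc L ∸ (ind (a ≡ᵇ b) + 2 * A)) * G (2 + (ind (a ≡ᵇ b) + 2 * A))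
      ≡⟨ cong (λ f → f * G f + G (suc f) + (suc L ∸ f) * G (2 + f)) (sym (fap≡flag+2ap (a ∷ b ∷ v))) ⟩
    fap (a ∷ b ∷ v) * G (fap (a ∷ b ∷ v)) + G (suc (fap (a ∷ b ∷ v))) + (suc L ∸ fap (a ∷ b ∷ v)) * G (2 + fap (a ∷ b ∷ v)) ∎
    where
    open ≡-Reasoning
    T : TailCount m a (b ∷ v)
    T = tailCount m a (b ∷ v) a< al
    module T = TailCount T
    A r L : ℕ
    A = ap (a ∷ b ∷ v)
    r = ap (b ∷ v)
    L = length (b ∷ v)
    close : ∀ y → (a ≡ᵇ b) ≡ y → ∀ x → startsPlateau a (b ∷ v) ≡ x →
      G (1 + 2 * A) + G (2 * suc r) + (T.kept * G (ind y + 2 * A) + T.raised * G (ind y + 2 * suc A))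
        ≡ (ind y + 2 * A) * G (ind y + 2 * A) + G (suc (ind y + 2 * A)) + (suc L ∸ (ind y + 2 * A)) * G (2 + (ind y + 2 * A))
    close true ey x ex = begin
      G (1 + 2 * A) + G (2 * suc r) + (T.kept * G (1 + 2 * A) + T.raised * G (1 + 2 * suc A))
        ≡⟨ cong₂ (λ y z → G (1 + 2 * A) + G y + (T.kept * G (1 + 2 * A) + T.raised * G z))
                 (trans (2*suc r) (cong (λ z → 2 + 2 * z) (sym A≡))) (cong suc (2*suc A)) ⟩
      G (1 + 2 * A) + G (2 + 2 * A) + (T.kept * G (1 + 2 * A) + T.raised * G (3 + 2 * A))
        ≡⟨ close-flagged (2 * A) T.kept T.raised (G (1 + 2 * A)) (G (2 + 2 * A)) (G (3 + 2 * A))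
                         (trans (sym (ℕP.+-identityʳ T.kept)) (trans (cong (T.kept +_) (sym noPlateau)) T.kept-eq)) ⟩
      (1 + 2 * A) * G (1 + 2 * A) + G (2 + 2 * A) + T.raised * G (3 + 2 * A)
        ≡⟨ cong (λ z → (1 + 2 * A) * G (1 + 2 * A) + G (2 + 2 * A) + z * G (3 + 2 * A))
                (sym (∸-from T.raised (2 * A) L (trans T.raised-eq (trans (cong (L +_) noPlateau) (ℕP.+-identityʳ L))))) ⟩
      (1 + 2 * A) * G (1 + 2 * A) + G (2 + 2 * A) + (suc L ∸ (1 + 2 * A)) * G (3 + 2 * A) ∎
      where
      noPlateau : plateauAt a (b ∷ v) ≡ 0
      noPlateau = equalStart-noPlateau a b v ey
      A≡ : A ≡ r
      A≡ = trans (ap-cons a (b ∷ v)) (cong (_+ r) noPlateau)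
    close false ey true ex = begin
      G (1 + 2 * A) + G (2 * suc r) + (T.kept * G (2 * A) + T.raised * G (2 * suc A))
        ≡⟨ cong₂ (λ y z → G (1 + 2 * A) + G y + (T.kept * G (2 * A) + T.raised * G z)) (cong (2 *_) (sym A≡)) (2*suc A) ⟩
      G (1 + 2 * A) + G (2 * A) + (T.kept * G (2 * A) + T.raised * G (2 + 2 * A))
        ≡⟨ close-plateau (2 * A) T.kept T.raised (G (2 * A)) (G (1 + 2 * A)) (G (2 + 2 * A))
                         (trans (cong (λ z → T.kept + ind z) (sym ex)) T.kept-eq) ⟩
      2 * A * G (2 * A) + G (1 + 2 * A) + T.raised * G (2 + 2 * A)
        ≡⟨ cong (λ z → 2 * A * G (2 * A) + G (1 + 2 * A) + z * G (2 + 2 * A))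
                (sym (∸-from T.raised (2 * A) (suc L) (trans T.raised-eq (trans (cong (λ z → L + ind z) ex) (ℕP.+-comm L 1))))) ⟩
      2 * A * G (2 * A) + G (1 + 2 * A) + (suc L ∸ 2 * A) * G (2 + 2 * A) ∎
      where
      A≡ : A ≡ suc r
      A≡ = trans (ap-cons a (b ∷ v)) (cong (λ z → ind z + r) ex)
    close false ey false ex = begin
      G (1 + 2 * A) + G (2 * suc r) + (T.kept * G (2 * A) + T.raised * G (2 * suc A))
        ≡⟨ cong₂ (λ y z → G (1 + 2 * A) + G y + (T.kept * G (2 * A) + T.raised * G z))
                 (trans (2*suc r) (cong (λ z → 2 + 2 * z) (sym A≡))) (2*suc A) ⟩
      G (1 + 2 * A) + G (2 + 2 * A) + (T.kept * G (2 * A) + T.raised * G (2 + 2 * A))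
        ≡⟨ close-plain (2 * A) T.kept T.raised (G (2 * A)) (G (1 + 2 * A)) (G (2 + 2 * A))
                       (trans (cong (λ z → T.kept + ind z) (sym ex)) T.kept-eq) ⟩
      2 * A * G (2 * A) + G (1 + 2 * A) + suc T.raised * G (2 + 2 * A)
        ≡⟨ cong (λ z → 2 * A * G (2 * A) + G (1 + 2 * A) + z * G (2 + 2 * A))
                (sym (∸-from (suc T.raised) (2 * A) (suc L) (cong suc (trans T.raised-eq (trans (cong (λ z → L + ind z) ex) (ℕP.+-identityʳ L)))))) ⟩
      2 * A * G (2 * A) + G (1 + 2 * A) + (suc L ∸ 2 * A) * G (2 + 2 * A) ∎
      where
      A≡ : A ≡ r
      A≡ = trans (ap-cons a (b ∷ v)) (cong (λ z → ind z + r) ex)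

  -- Ascent-plateaus occupy disjoint pairs of positions after the first letter,
  -- so 2·ap and fap never exceed the length.

  2ap-tail≤ : ∀ a w → 2 * ap (a ∷ w) ≤ length w
  2ap-tail≤ a []          = z≤n
  2ap-tail≤ a (b ∷ [])    = z≤n
  2ap-tail≤ a (b ∷ c ∷ w) = step ((a <ᵇ b) ∧ (b ≡ᵇ c)) refl (2ap-tail≤ b (c ∷ w)) (2ap-tail≤ c w)
    where
    step : ∀ x → (a <ᵇ b) ∧ (b ≡ᵇ c) ≡ x → 2 * ap (b ∷ c ∷ w) ≤ length (c ∷ w) → 2 * ap (c ∷ w) ≤ length w →
      2 * (ind x + ap (b ∷ c ∷ w)) ≤ length (b ∷ c ∷ w)
    step false _  ih₁ _   = ℕP.≤-trans ih₁ (ℕP.n≤1+n _)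
    step true  eq _   ih₂ = subst (_≤ length (b ∷ c ∷ w)) (sym twoMore) (s≤s (s≤s ih₂))
      where
      twoMore : 2 * (1 + ap (b ∷ c ∷ w)) ≡ suc (suc (2 * ap (c ∷ w)))
      twoMore = trans (cong (λ z → 2 * (1 + z))
                        (trans (ap-cons b (c ∷ w)) (cong (_+ ap (c ∷ w)) (equalStart-noPlateau b c w (proj₂ (∧-true⁻ eq))))))
                      (2*suc (ap (c ∷ w)))

  2ap≤length : ∀ w → 2 * ap w ≤ length w
  2ap≤length []      = z≤n
  2ap≤length (a ∷ w) = ℕP.≤-trans (2ap-tail≤ a w) (ℕP.n≤1+n _)

  fap≤length : ∀ w → fap w ≤ length w
  fap≤length []          = z≤n
  fap≤length (a ∷ [])    = z≤n
  fap≤length (a ∷ b ∷ w) with a ≡ᵇ b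
  ... | true  = s≤s (2ap-tail≤ a (b ∷ w))
  ... | false = ℕP.≤-trans (2ap-tail≤ a (b ∷ w)) (ℕP.n≤1+n _)

module SignedStatistics where

  open import Defs
  open NatFacts using (ind; ∸-from; 2*suc)
  open FiniteSums using (sumOf; sumOf-map; sumOf-cong)
  open SignedInsertion using (insertTop; Bounded)
  open import Data.Bool using (true; false)
  open import Data.Nat as ℕ using (ℕ; suc; _+_; _*_; _∸_)
  import Data.Nat.Properties as ℕP
  open import Data.Nat.Tactic.RingSolver using (solve-∀)
  open import Data.Integer as ℤ using (ℤ; +_; -[1+_]; -<+)
  import Data.Integer.Properties as ℤP
  open import Data.List using (List; []; _∷_; map; length)
  open import Data.List.Relation.Unary.All using (All; []; _∷_)
  open import Data.Product using (_,_)
  open import Relation.Binary.PropositionalEquality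
  open import Relation.Nullary.Decidable using (dec-true; dec-false)

  module _ (n : ℕ) where

    top⁺ top⁻ : ℤ
    top⁺ = + suc n
    top⁻ = -[1+ n ]

    top⁺≮ : ∀ {x} → Bounded n x → (top⁺ <ℤᵇ x) ≡ false
    top⁺≮ (_ , x<) = dec-false (top⁺ ℤ.<? _) (ℤP.<-asym x<)

    <top⁺ : ∀ {x} → Bounded n x → (x <ℤᵇ top⁺) ≡ true
    <top⁺ (_ , x<) = dec-true (_ ℤ.<? top⁺) x<

    top⁻< : ∀ {x} → Bounded n x → (top⁻ <ℤᵇ x) ≡ true
    top⁻< (<x , _) = dec-true (top⁻ ℤ.<? _) <x

    ≮top⁻ : ∀ {x} → Bounded n x → (x <ℤᵇ top⁻) ≡ false
    ≮top⁻ (<x , _) = dec-false (_ ℤ.<? top⁻) (ℤP.<-asym <x)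

    top⁺-nonneg : (top⁺ <ℤᵇ (+ 0)) ≡ false
    top⁺-nonneg = dec-false (top⁺ ℤ.<? (+ 0)) (λ { (ℤ.+<+ ()) })

    top⁻-neg : (top⁻ <ℤᵇ (+ 0)) ≡ true
    top⁻-neg = dec-true (top⁻ ℤ.<? (+ 0)) -<+

    record TailDescents (p : ℤ) (v : List ℤ) : Set where
      field
        raised    : ℕ
        raised-eq : raised + 2 * desA (p ∷ v) ≡ suc (2 * length v)
        sum-eq    : ∀ (G : ℕ → ℕ) → sumOf (λ u → G (desA (p ∷ u))) (insertTop n v)
                      ≡ suc (2 * desA (p ∷ v)) * G (desA (p ∷ v)) + raised * G (suc (desA (p ∷ v)))

    tailDescents : ∀ p v → Bounded n p → All (Bounded n) v → TailDescents p v
    tailDescents p [] bp [] = record { raised = 1 ; raised-eq = refl ; sum-eq = sum-eq }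
      where
      sum-eq : ∀ (G : ℕ → ℕ) → sumOf (λ u → G (desA (p ∷ u))) (insertTop n []) ≡ 1 * G 0 + 1 * G 1
      sum-eq G rewrite top⁺≮ bp | top⁻< bp = solve (G 0) (G 1)
        where
        solve : ∀ x y → x + (y + 0) ≡ 1 * x + 1 * y
        solve = solve-∀
    tailDescents p (b ∷ v) bp (bb ∷ al) = step (b <ℤᵇ p) refl
      where
      I : TailDescents b v
      I = tailDescents b v bb al
      module I = TailDescents I
      D' : ℕ
      D' = desA (b ∷ v)
      -- both new letters create a descent next to p or b; the later insertions see p b
      unfold : ∀ (G : ℕ → ℕ) → sumOf (λ u → G (desA (p ∷ u))) (insertTop n (b ∷ v))
        ≡ G (suc D') + (G (suc D') + sumOf (λ u → G (ind (b <ℤᵇ p) + desA (b ∷ u))) (insertTop n v))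
      unfold G = trans (cong₂ (λ x y → G x + (G y + sumOf (λ u → G (desA (p ∷ u))) (map (b ∷_) (insertTop n v))))
                              (plus bp bb) (minus bp bb))
                       (cong (λ t → G (suc D') + (G (suc D') + t)) (sumOf-map (λ u → G (desA (p ∷ u))) (b ∷_) (insertTop n v)))
        where
        plus : Bounded n p → Bounded n b → desA (p ∷ top⁺ ∷ b ∷ v) ≡ suc D'
        plus bp bb rewrite top⁺≮ bp | <top⁺ bb = refl
        minus : Bounded n p → Bounded n b → desA (p ∷ top⁻ ∷ b ∷ v) ≡ suc D'
        minus bp bb rewrite top⁻< bp | ≮top⁻ bb = refl
      step : ∀ δ → (b <ℤᵇ p) ≡ δ → TailDescents p (b ∷ v)
      step true eq = record
        { raised = I.raised
        ; raised-eq = trans (cong (λ t → I.raised + 2 * (ind t + D')) eq) (shift I.raised D' (length v) I.raised-eq)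
        ; sum-eq = λ G → begin
            sumOf (λ u → G (desA (p ∷ u))) (insertTop n (b ∷ v))
              ≡⟨ unfold G ⟩
            G (suc D') + (G (suc D') + sumOf (λ u → G (ind (b <ℤᵇ p) + desA (b ∷ u))) (insertTop n v))
              ≡⟨ cong (λ t → G (suc D') + (G (suc D') + sumOf (λ u → G (ind t + desA (b ∷ u))) (insertTop n v))) eq ⟩
            G (suc D') + (G (suc D') + sumOf (λ u → G (suc (desA (b ∷ u)))) (insertTop n v))
              ≡⟨ cong (λ t → G (suc D') + (G (suc D') + t)) (I.sum-eq (λ x → G (suc x))) ⟩
            G (suc D') + (G (suc D') + (suc (2 * D') * G (suc D') + I.raised * G (suc (suc D'))))
              ≡⟨ solve (G (suc D')) (G (suc (suc D'))) D' I.raised ⟩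
            suc (2 * suc D') * G (suc D') + I.raised * G (suc (suc D'))
              ≡⟨ cong (λ d → suc (2 * d) * G d + I.raised * G (suc d)) (sym (cong (λ t → ind t + D') eq)) ⟩
            suc (2 * desA (p ∷ b ∷ v)) * G (desA (p ∷ b ∷ v)) + I.raised * G (suc (desA (p ∷ b ∷ v))) ∎ }
        where
        open ≡-Reasoning
        shift : ∀ k d l → k + 2 * d ≡ suc (2 * l) → k + 2 * suc d ≡ suc (2 * suc l)
        shift k d l e rewrite 2*suc d | 2*suc l | ℕP.+-suc k (suc (2 * d)) | ℕP.+-suc k (2 * d) = cong (λ t → suc (suc t)) e
        solve : ∀ x y d k → x + (x + (suc (2 * d) * x + k * y)) ≡ suc (2 * suc d) * x + k * y
        solve = solve-∀
      step false eq = record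
        { raised = 2 + I.raised
        ; raised-eq = trans (cong (λ t → 2 + I.raised + 2 * (ind t + D')) eq)
                            (trans (cong (λ t → 2 + t) I.raised-eq) (sym (cong suc (2*suc (length v)))))
        ; sum-eq = λ G → begin
            sumOf (λ u → G (desA (p ∷ u))) (insertTop n (b ∷ v))
              ≡⟨ unfold G ⟩
            G (suc D') + (G (suc D') + sumOf (λ u → G (ind (b <ℤᵇ p) + desA (b ∷ u))) (insertTop n v))
              ≡⟨ cong (λ t → G (suc D') + (G (suc D') + sumOf (λ u → G (ind t + desA (b ∷ u))) (insertTop n v))) eq ⟩
            G (suc D') + (G (suc D') + sumOf (λ u → G (desA (b ∷ u))) (insertTop n v))
              ≡⟨ cong (λ t → G (suc D') + (G (suc D') + t)) (I.sum-eq G) ⟩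
            G (suc D') + (G (suc D') + (suc (2 * D') * G D' + I.raised * G (suc D')))
              ≡⟨ solve (G D') (G (suc D')) (2 * D') I.raised ⟩
            suc (2 * D') * G D' + (2 + I.raised) * G (suc D')
              ≡⟨ cong (λ d → suc (2 * d) * G d + (2 + I.raised) * G (suc d)) (sym (cong (λ t → ind t + D') eq)) ⟩
            suc (2 * desA (p ∷ b ∷ v)) * G (desA (p ∷ b ∷ v)) + (2 + I.raised) * G (suc (desA (p ∷ b ∷ v))) ∎ }
        where
        open ≡-Reasoning
        solve : ∀ x y t k → y + (y + (suc t * x + k * y)) ≡ suc t * x + (2 + k) * y
        solve = solve-∀

    fdes-cons : ∀ a w → fdes (a ∷ w) ≡ ind (a <ℤᵇ (+ 0)) + 2 * desA (a ∷ w)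
    fdes-cons a w with a <ℤᵇ (+ 0)
    ... | true  = refl
    ... | false = refl

    fdes-insertTop : ∀ π → All (Bounded n) π → ∀ (G : ℕ → ℕ) →
      sumOf (λ σ → G (fdes σ)) (insertTop n π)
        ≡ suc (fdes π) * G (fdes π) + G (suc (fdes π)) + (2 * length π ∸ fdes π) * G (2 + fdes π)
    fdes-insertTop [] [] G rewrite top⁺-nonneg | top⁻-neg = solve (G 0) (G 1)
      where
      solve : ∀ x y → x + (y + 0) ≡ 1 * x + y + 0
      solve = solve-∀
    fdes-insertTop (a ∷ v) (ba ∷ al) G = begin
      sumOf (λ σ → G (fdes σ)) (insertTop n (a ∷ v))
        ≡⟨ cong₂ (λ x y → G x + (G y + sumOf (λ σ → G (fdes σ)) (map (a ∷_) (insertTop n v)))) plus minus ⟩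
      G (2 + 2 * D) + (G (suc (2 * D)) + sumOf (λ σ → G (fdes σ)) (map (a ∷_) (insertTop n v)))
        ≡⟨ cong (λ t → G (2 + 2 * D) + (G (suc (2 * D)) + t))
                (trans (sumOf-map (λ σ → G (fdes σ)) (a ∷_) (insertTop n v))
                       (trans (sumOf-cong (λ u → cong G (fdes-cons a u)) (insertTop n v))
                              (T.sum-eq (λ x → G (s + 2 * x))))) ⟩
      G (2 + 2 * D) + (G (suc (2 * D)) + (suc (2 * D) * G (s + 2 * D) + T.raised * G (s + 2 * suc D)))
        ≡⟨ close (a <ℤᵇ (+ 0)) refl ⟩
      suc (s + 2 * D) * G (s + 2 * D) + G (suc (s + 2 * D)) + (2 * length (a ∷ v) ∸ (s + 2 * D)) * G (2 + (s + 2 * D))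
        ≡⟨ cong (λ f → suc f * G f + G (suc f) + (2 * length (a ∷ v) ∸ f) * G (2 + f)) (sym (fdes-cons a v)) ⟩
      suc (fdes (a ∷ v)) * G (fdes (a ∷ v)) + G (suc (fdes (a ∷ v))) + (2 * length (a ∷ v) ∸ fdes (a ∷ v)) * G (2 + fdes (a ∷ v)) ∎
      where
      open ≡-Reasoning
      T : TailDescents a v
      T = tailDescents a v ba al
      module T = TailDescents T
      D s : ℕ
      D = desA (a ∷ v)
      s = ind (a <ℤᵇ (+ 0))
      plus : fdes (top⁺ ∷ a ∷ v) ≡ 2 + 2 * D
      plus rewrite top⁺-nonneg | <top⁺ ba = 2*suc D
      minus : fdes (top⁻ ∷ a ∷ v) ≡ suc (2 * D)
      minus rewrite top⁻-neg | ≮top⁻ ba = refl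
      close : ∀ x → (a <ℤᵇ (+ 0)) ≡ x →
        G (2 + 2 * D) + (G (suc (2 * D)) + (suc (2 * D) * G (ind x + 2 * D) + T.raised * G (ind x + 2 * suc D)))
          ≡ suc (ind x + 2 * D) * G (ind x + 2 * D) + G (suc (ind x + 2 * D)) + (2 * length (a ∷ v) ∸ (ind x + 2 * D)) * G (2 + (ind x + 2 * D))
      close false _ rewrite 2*suc D | ∸-from (suc T.raised) (2 * D) (2 * length (a ∷ v))
                                        (trans (cong suc T.raised-eq) (sym (2*suc (length v)))) =
        solve (2 * D) T.raised (G (2 * D)) (G (suc (2 * D))) (G (2 + 2 * D))
        where
        solve : ∀ t k g0 g1 g2 → g2 + (g1 + (suc t * g0 + k * g2)) ≡ suc t * g0 + g1 + suc k * g2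
        solve = solve-∀
      close true _ rewrite 2*suc D | ∸-from T.raised (suc (2 * D)) (2 * length (a ∷ v))
                                       (trans (ℕP.+-suc T.raised (2 * D)) (trans (cong suc T.raised-eq) (sym (2*suc (length v))))) =
        solve (2 * D) T.raised (G (suc (2 * D))) (G (2 + 2 * D)) (G (3 + 2 * D))
        where
        solve : ∀ t k g0 g1 g2 → g1 + (g0 + (suc t * g0 + k * g2)) ≡ suc (suc t) * g0 + g1 + k * g2
        solve = solve-∀

module Recurrences where

  open import Defs
  open FiniteSums using (sumOf; sumOf-cong-∈)
  open StirlingInsertion using (𝒬-step; 𝒬-bounds)
  open StirlingStatistics using (fap-insertPair; ap-insertPair; fap≤length; 2ap≤length)
  open SignedInsertion using (B-step; B-bounds)
  open SignedStatistics using (fdes-insertTop)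
  open import Data.Nat using (ℕ; suc; _+_; _*_; _∸_; _≤_)
  open import Data.List.Membership.Propositional using (_∈_)
  open import Data.Product using (proj₁; proj₂)
  open import Relation.Binary.PropositionalEquality

  -- Summing a test function G of a statistic over the objects of size n+1 equals
  -- summing a transformed test function over those of size n.  The transforms
  -- record how the statistic changes under the insertion of the new letter.

  fapStep apStep fdesStep : ℕ → (ℕ → ℕ) → ℕ → ℕ
  fapStep  n G f = f * G f + G (suc f) + (2 * n ∸ f) * G (2 + f)
  apStep   n G e = suc e * G e + (2 * n ∸ e) * G (2 + e)
  fdesStep n G f = suc f * G f + G (suc f) + (2 * n ∸ f) * G (2 + f)

  fap-recurrence : ∀ n G → sumOf (λ σ → G (fap σ)) (𝒬 (suc n)) ≡ sumOf (λ σ → fapStep n G (fap σ)) (𝒬 n)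
  fap-recurrence n G = trans (𝒬-step n _) (sumOf-cong-∈ _ _ (𝒬 n) λ τ m →
    trans (fap-insertPair (suc n) τ (proj₂ (𝒬-bounds n τ m)) G)
          (cong (λ L → fap τ * G (fap τ) + G (suc (fap τ)) + (L ∸ fap τ) * G (2 + fap τ)) (proj₁ (𝒬-bounds n τ m))))

  ap-recurrence : ∀ n G → sumOf (λ σ → G (2 * ap σ)) (𝒬 (suc n)) ≡ sumOf (λ σ → apStep n G (2 * ap σ)) (𝒬 n)
  ap-recurrence n G = trans (𝒬-step n _) (sumOf-cong-∈ _ _ (𝒬 n) λ τ m →
    trans (ap-insertPair (suc n) τ (proj₂ (𝒬-bounds n τ m)) G)
          (cong (λ L → suc (2 * ap τ) * G (2 * ap τ) + (L ∸ 2 * ap τ) * G (2 + 2 * ap τ)) (proj₁ (𝒬-bounds n τ m))))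

  fdes-recurrence : ∀ n G → sumOf (λ π → G (fdes π)) (B (suc n)) ≡ sumOf (λ π → fdesStep n G (fdes π)) (B n)
  fdes-recurrence n G = trans (B-step n _) (sumOf-cong-∈ _ _ (B n) λ π m →
    trans (fdes-insertTop n π (proj₂ (B-bounds n π m)) G)
          (cong (λ L → suc (fdes π) * G (fdes π) + G (suc (fdes π)) + (2 * L ∸ fdes π) * G (2 + fdes π)) (proj₁ (B-bounds n π m))))

  fap≤2n : ∀ n σ → σ ∈ 𝒬 n → fap σ ≤ 2 * n
  fap≤2n n σ m = subst (fap σ ≤_) (proj₁ (𝒬-bounds n σ m)) (fap≤length σ)

  2ap≤2n : ∀ n σ → σ ∈ 𝒬 n → 2 * ap σ ≤ 2 * n
  2ap≤2n n σ m = subst (2 * ap σ ≤_) (proj₁ (𝒬-bounds n σ m)) (2ap≤length σ)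

module DerivationFormula where

  open import Defs
  open NatFacts using (ind; 2*suc)
  open FiniteSums using (sumOf; sumOf-+; sumOf-cong-∈)
  open Polynomials
  open NatPoly
  open Recurrences using (fapStep; fap-recurrence; fap≤2n)
  open import Data.Bool using (_∧_)
  open import Data.Nat as ℕ using (ℕ; zero; suc; _≡ᵇ_; _+_; _*_; _∸_; _≤_)
  import Data.Nat.Properties as ℕP
  open import Data.Nat.Tactic.RingSolver using (solve-∀)
  open import Data.Rational as ℚ using (1ℚ)
  import Data.Rational.Properties as ℚP
  open import Algebra.Properties.Group ℚP.+-0-group using (identityˡ-unique)
  open import Data.List using (List; []; _∷_; _++_; map; concatMap)
  open import Data.Product using (_,_)
  open import Relation.Binary.PropositionalEquality

  -- Both sides have natural coefficients; D acts on each y^f z^g by the product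
  -- rule, and the resulting coefficients agree with the insertion recurrence for fap.

  2suc∸ : ∀ n f → f ≤ 2 * n → 2 * suc n ∸ f ≡ (2 * n ∸ f) + 2
  2suc∸ n f f≤ = trans (cong (_∸ f) (trans (2*suc n) (ℕP.+-comm 2 (2 * n)))) (ℕP.+-∸-comm {2 * n} 2 {f} f≤)

  2suc∸suc : ∀ n f → f ≤ 2 * n → 2 * suc n ∸ suc f ≡ suc (2 * n ∸ f)
  2suc∸suc n f f≤ = trans (cong (_∸ suc f) (2*suc n)) (ℕP.+-∸-assoc 1 f≤)

  2suc∸2+ : ∀ n f → 2 * suc n ∸ (2 + f) ≡ 2 * n ∸ f
  2suc∸2+ n f = cong (_∸ (2 + f)) (2*suc n)

  stirlingTerm : ℕ → List ℕ → Poly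
  stirlingTerm n σ = (Y ^^ fap σ) ⊗ (Z ^^ (2 * n ∸ fap σ))

  stirlingPoly : ℕ → Poly
  stirlingPoly n = ΣP (map (stirlingTerm n) (𝒬 n))

  stirlingCoeffs : ℕ → NatPoly
  stirlingCoeffs n = concatMap (λ σ → (1 , 0 , fap σ , 2 * n ∸ fap σ) ∷ []) (𝒬 n)

  -- D (y^f z^g) = f y^f z^(g+2) + g y^(f+2) z^g
  derivedCoeffs : ℕ → List ℕ → NatPoly
  derivedCoeffs n σ = (fap σ , 0 , fap σ , (2 * n ∸ fap σ) + 2) ∷ ((2 * n ∸ fap σ) , 0 , fap σ + 2 , 2 * n ∸ fap σ) ∷ []

  Y^Z^≅ : ∀ f g → Y ^^ f ⊗ Z ^^ g ≅ (1 , 0 , f , g) ∷ []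
  Y^Z^≅ f g rewrite Y^ f | Z^ g =
    ≅-coeffℕ (≅-monomial⊗ 0 f 0 (monomial≅ 0 0 g)) (λ a b c → cong (λ t → coeffℕ ((1 , 0 , t , g) ∷ []) a b c) (ℕP.+-identityʳ f))

  stirlingPoly≅ : ∀ n → stirlingPoly n ≅ stirlingCoeffs n
  stirlingPoly≅ n = ≅-ΣP (stirlingTerm n) _ (𝒬 n) (λ σ → Y^Z^≅ (fap σ) (2 * n ∸ fap σ))

  -- The coefficient identity behind the induction step: the coefficients of
  -- xyz · S_n + x · D(S_n) are those of x · S_{n+1}.  Each σ ∈ 𝒬 n contributes
  -- through fapStep, and fap-recurrence sums these contributions to 𝒬 (n+1).
  coefficient-step : ∀ n a b c →
    coeffℕ (shiftℕ 1 1 1 (stirlingCoeffs n) ++ shiftℕ 1 0 0 (concatMap (derivedCoeffs n) (𝒬 n))) a b c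
      ≡ coeffℕ (shiftℕ 1 0 0 (stirlingCoeffs (suc n))) a b c
  coefficient-step n a b c = begin
    coeffℕ (shiftℕ 1 1 1 (stirlingCoeffs n) ++ shiftℕ 1 0 0 (concatMap (derivedCoeffs n) (𝒬 n))) a b c
      ≡⟨ coeffℕ-++ (shiftℕ 1 1 1 (stirlingCoeffs n)) _ a b c ⟩
    coeffℕ (shiftℕ 1 1 1 (stirlingCoeffs n)) a b c + coeffℕ (shiftℕ 1 0 0 (concatMap (derivedCoeffs n) (𝒬 n))) a b c
      ≡⟨ cong₂ _+_ (sumOverStirling 1 1 1 _ n) (sumOverStirling 1 0 0 (derivedCoeffs n) n) ⟩
    sumOf (λ σ → coeffℕ ((1 , 1 , suc (fap σ) , suc (2 * n ∸ fap σ)) ∷ []) a b c) (𝒬 n)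
      + sumOf (λ σ → coeffℕ (shiftℕ 1 0 0 (derivedCoeffs n σ)) a b c) (𝒬 n)
      ≡⟨ sumOf-+ _ _ (𝒬 n) ⟨
    sumOf (λ σ → coeffℕ ((1 , 1 , suc (fap σ) , suc (2 * n ∸ fap σ)) ∷ []) a b c
                 + coeffℕ (shiftℕ 1 0 0 (derivedCoeffs n σ)) a b c) (𝒬 n)
      ≡⟨ sumOf-cong-∈ _ _ (𝒬 n) (λ σ m → contribution (fap σ) (fap≤2n n σ m)) ⟩
    sumOf (λ σ → fapStep n G (fap σ)) (𝒬 n)
      ≡⟨ fap-recurrence n G ⟨
    sumOf (λ σ → G (fap σ)) (𝒬 (suc n))
      ≡⟨ sumOverStirling 1 0 0 _ (suc n) ⟨
    coeffℕ (shiftℕ 1 0 0 (stirlingCoeffs (suc n))) a b c ∎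
    where
    open ≡-Reasoning
    G : ℕ → ℕ
    G k = coeffℕ ((1 , 1 , k , 2 * suc n ∸ k) ∷ []) a b c
    sumOverStirling : ∀ a' b' c' (h : List ℕ → NatPoly) k →
      coeffℕ (shiftℕ a' b' c' (concatMap h (𝒬 k))) a b c ≡ sumOf (λ σ → coeffℕ (shiftℕ a' b' c' (h σ)) a b c) (𝒬 k)
    sumOverStirling a' b' c' h k =
      trans (cong (λ t → coeffℕ t a b c) (shiftℕ-concatMap a' b' c' h (𝒬 k))) (coeffℕ-concatMap _ (𝒬 k) a b c)
    -- one σ with fap σ = f: the coefficient of x y^k z^(2n+2-k) gains
    -- f from k = f, one from k = f+1 and 2n-f from k = f+2
    contribution : ∀ f → f ≤ 2 * n →
      coeffℕ ((1 , 1 , suc f , suc (2 * n ∸ f)) ∷ []) a b c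
        + coeffℕ ((f , 1 , f , (2 * n ∸ f) + 2) ∷ ((2 * n ∸ f) , 1 , f + 2 , 2 * n ∸ f) ∷ []) a b c
        ≡ fapStep n G f
    contribution f f≤ rewrite 2suc∸ n f f≤ | 2suc∸suc n f f≤ | 2suc∸2+ n f | ℕP.+-comm f 2 =
      solve (ind ((a ≡ᵇ 1) ∧ (b ≡ᵇ suc f) ∧ (c ≡ᵇ suc (2 * n ∸ f))))
            (ind ((a ≡ᵇ 1) ∧ (b ≡ᵇ f) ∧ (c ≡ᵇ (2 * n ∸ f) + 2)))
            (ind ((a ≡ᵇ 1) ∧ (b ≡ᵇ suc (suc f)) ∧ (c ≡ᵇ 2 * n ∸ f))) f (2 * n ∸ f)
      where
      solve : ∀ x y z f g → 1 * x + 0 + (f * y + (g * z + 0)) ≡ f * (1 * y + 0) + (1 * x + 0) + g * (1 * z + 0)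
      solve = solve-∀

  𝟙⊗ : ∀ q → 𝟙 ⊗ q ≈ q
  𝟙⊗ q a b c = trans (coeff-term⊗ 1ℚ 0 0 0 q a b c) (ℚP.*-identityˡ _)

  module _ (D : Poly → Poly) (isD : IsTheDerivation D) where
    open IsTheDerivation isD

    D-zero : D [] ≅ []
    D-zero = mk≅ λ a b c → identityˡ-unique _ _ (sym (trans (D-add [] [] a b c) (coeff-++ (D []) (D []) a b c)))

    D-one : D 𝟙 ≅ []
    D-one = mk≅ λ a b c → identityˡ-unique _ _ (sym (begin
      coeff (D 𝟙) a b c                                 ≡⟨ D-leibniz 𝟙 𝟙 a b c ⟩
      coeff (D 𝟙 ⊗ 𝟙 ⊕ 𝟙 ⊗ D 𝟙) a b c                   ≡⟨ coeff-++ (D 𝟙 ⊗ 𝟙) (𝟙 ⊗ D 𝟙) a b c ⟩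
      coeff (D 𝟙 ⊗ 𝟙) a b c ℚ.+ coeff (𝟙 ⊗ D 𝟙) a b c
        ≡⟨ cong₂ ℚ._+_ (trans (⊗-comm (D 𝟙) 𝟙 a b c) (𝟙⊗ (D 𝟙) a b c)) (𝟙⊗ (D 𝟙) a b c) ⟩
      coeff (D 𝟙) a b c ℚ.+ coeff (D 𝟙) a b c           ∎))
      where open ≡-Reasoning

    D-Y^ : ∀ f → D (Y ^^ f) ≅ (f , 0 , f , 2) ∷ []
    D-Y^ zero    = ≅-coeffℕ D-one (λ a b c → refl)
    D-Y^ (suc f) = ≈-≅ {D (Y ^^ suc f)} (D-leibniz Y (Y ^^ f))
      (≅-coeffℕ {D Y ⊗ Y ^^ f ⊕ Y ⊗ D (Y ^^ f)}
         (≅-++ {D Y ⊗ Y ^^ f} {Y ⊗ D (Y ^^ f)} DY⊗Y^ (≅-monomial⊗ 0 1 0 (D-Y^ f))) collect)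
      where
      DY⊗Y^ : D Y ⊗ Y ^^ f ≅ (1 , 0 , f + 1 , 2) ∷ []
      DY⊗Y^ = ≈-≅ {D Y ⊗ Y ^^ f} (⊗-comm (D Y) (Y ^^ f)) (≈-≅ {Y ^^ f ⊗ D Y} (⊗-congʳ (Y ^^ f) D-y)
                (subst (λ P → P ⊗ (Y ⊗ Z ⊗ Z) ≅ (1 , 0 , f + 1 , 2) ∷ []) (sym (Y^ f)) (≅-monomial⊗ 0 f 0 (monomial≅ 0 1 2))))
      collect : ∀ a b c → coeffℕ ((1 , 0 , f + 1 , 2) ∷ (f , 0 , suc f , 2) ∷ []) a b c ≡ coeffℕ ((suc f , 0 , suc f , 2) ∷ []) a b c
      collect a b c rewrite ℕP.+-comm f 1 = solve (ind ((a ≡ᵇ 0) ∧ (b ≡ᵇ suc f) ∧ (c ≡ᵇ 2))) f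
        where
        solve : ∀ x f → 1 * x + (f * x + 0) ≡ (suc f) * x + 0
        solve = solve-∀

    D-Z^ : ∀ g → D (Z ^^ g) ≅ (g , 0 , 2 , g) ∷ []
    D-Z^ zero    = ≅-coeffℕ D-one (λ a b c → refl)
    D-Z^ (suc g) = ≈-≅ {D (Z ^^ suc g)} (D-leibniz Z (Z ^^ g))
      (≅-coeffℕ {D Z ⊗ Z ^^ g ⊕ Z ⊗ D (Z ^^ g)}
         (≅-++ {D Z ⊗ Z ^^ g} {Z ⊗ D (Z ^^ g)} DZ⊗Z^ (≅-monomial⊗ 0 0 1 (D-Z^ g))) collect)
      where
      DZ⊗Z^ : D Z ⊗ Z ^^ g ≅ (1 , 0 , 2 , g + 1) ∷ []
      DZ⊗Z^ = ≈-≅ {D Z ⊗ Z ^^ g} (⊗-comm (D Z) (Z ^^ g)) (≈-≅ {Z ^^ g ⊗ D Z} (⊗-congʳ (Z ^^ g) D-z)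
                (subst (λ P → P ⊗ (Y ⊗ Y ⊗ Z) ≅ (1 , 0 , 2 , g + 1) ∷ []) (sym (Z^ g)) (≅-monomial⊗ 0 0 g (monomial≅ 0 2 1))))
      collect : ∀ a b c → coeffℕ ((1 , 0 , 2 , g + 1) ∷ (g , 0 , 2 , suc g) ∷ []) a b c ≡ coeffℕ ((suc g , 0 , 2 , suc g) ∷ []) a b c
      collect a b c rewrite ℕP.+-comm g 1 = solve (ind ((a ≡ᵇ 0) ∧ (b ≡ᵇ 2) ∧ (c ≡ᵇ suc g))) g
        where
        solve : ∀ x f → 1 * x + (f * x + 0) ≡ (suc f) * x + 0
        solve = solve-∀

    D-Y^Z^ : ∀ f g → D (Y ^^ f ⊗ Z ^^ g) ≅ (f , 0 , f , g + 2) ∷ (g , 0 , f + 2 , g) ∷ []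
    D-Y^Z^ f g = ≈-≅ {D (Y ^^ f ⊗ Z ^^ g)} (D-leibniz (Y ^^ f) (Z ^^ g))
      (≅-++ {D (Y ^^ f) ⊗ Z ^^ g} {Y ^^ f ⊗ D (Z ^^ g)} first second)
      where
      first : D (Y ^^ f) ⊗ Z ^^ g ≅ (f , 0 , f , g + 2) ∷ []
      first = ≈-≅ {D (Y ^^ f) ⊗ Z ^^ g} (⊗-comm (D (Y ^^ f)) (Z ^^ g))
                (subst (λ P → P ⊗ D (Y ^^ f) ≅ (f , 0 , f , g + 2) ∷ []) (sym (Z^ g)) (≅-monomial⊗ 0 0 g (D-Y^ f)))
      second : Y ^^ f ⊗ D (Z ^^ g) ≅ (g , 0 , f + 2 , g) ∷ []
      second = subst (λ P → P ⊗ D (Z ^^ g) ≅ (g , 0 , f + 2 , g) ∷ []) (sym (Y^ f)) (≅-monomial⊗ 0 f 0 (D-Z^ g))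

    D-ΣP : ∀ {A : Set} (h : A → Poly) (s : A → NatPoly) L → (∀ x → D (h x) ≅ s x) → D (ΣP (map h L)) ≅ concatMap s L
    D-ΣP h s []      E = D-zero
    D-ΣP h s (x ∷ L) E = ≈-≅ {D (ΣP (map h (x ∷ L)))} (D-add (h x) (ΣP (map h L)))
      (≅-++ {D (h x)} {D (ΣP (map h L))} (E x) (D-ΣP h s L E))

    D-stirlingPoly≅ : ∀ n → D (stirlingPoly n) ≅ concatMap (derivedCoeffs n) (𝒬 n)
    D-stirlingPoly≅ n = D-ΣP (stirlingTerm n) (derivedCoeffs n) (𝒬 n) (λ σ → D-Y^Z^ (fap σ) (2 * n ∸ fap σ))

    -- D^n(x) has the coefficients of x · S_n; the step is
    -- D(x · S_n) = xyz · S_n + x · D(S_n) together with coefficient-step.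
    iterate-D-X≅ : ∀ n → iterate D n X ≅ shiftℕ 1 0 0 (stirlingCoeffs n)
    iterate-D-X≅ zero    = ≅-coeffℕ (monomial≅ 1 0 0) (λ a b c → refl)
    iterate-D-X≅ (suc n) =
      ≈-≅ {D (iterate D n X)}
          (D-cong (iterate D n X) (X ⊗ stirlingPoly n) (≅⇒≈ (iterate-D-X≅ n) (≅-monomial⊗ 1 0 0 (stirlingPoly≅ n))))
      (≈-≅ {D (X ⊗ stirlingPoly n)} (D-leibniz X (stirlingPoly n))
        (≅-coeffℕ (≅-++ (≈-≅ {D X ⊗ stirlingPoly n} (⊗-congˡ {D X} {X ⊗ Y ⊗ Z} (stirlingPoly n) D-x)
                                                   (≅-monomial⊗ 1 1 1 (stirlingPoly≅ n)))
                        (≅-monomial⊗ 1 0 0 (D-stirlingPoly≅ n)))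
                  (coefficient-step n)))

    derivative-formula : ∀ n → iterate D n X ≈ X ⊗ ΣP (map (λ σ → (Y ^^ fap σ) ⊗ (Z ^^ (2 * n ∸ fap σ))) (𝒬 n))
    derivative-formula n = ≅⇒≈ (iterate-D-X≅ n) (≅-monomial⊗ 1 0 0 (stirlingPoly≅ n))

module Convolution where

  open import Defs
  open FiniteSums
  open Recurrences
  open import Data.Nat as ℕ using (ℕ; zero; suc; _+_; _*_; _∸_; _≤_; _<_)
  import Data.Nat.Properties as ℕP
  open import Data.Nat.Combinatorics using (_C_; nCk+nC[k+1]≡[n+1]C[k+1]; k>n⇒nCk≡0)
  open import Data.Nat.Tactic.RingSolver using (solve-∀)
  open import Relation.Binary.PropositionalEquality

  -- Part two of the theorem at the level of counting: for every test function G,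
  --   Σ_{π ∈ B n} G(fdes π) = Σ_k C(n,k) Σ_{σ ∈ 𝒬 k} Σ_{τ ∈ 𝒬 (n-k)} G(fap σ + 2 ap τ).
  -- Both sides satisfy F_{n+1}(G) = F_n(fdesStep n G): the left side by the
  -- insertion recurrence for fdes, the right side because fdesStep splits as a
  -- Leibniz rule into fapStep and apStep, combined with Pascal's rule.

  ∸-split : ∀ A B i j → i ≤ A → j ≤ B → (A + B) ∸ (i + j) ≡ (A ∸ i) + (B ∸ j)
  ∸-split A B i j i≤ j≤ = begin
    (A + B) ∸ (i + j) ≡⟨ ℕP.∸-+-assoc (A + B) i j ⟨
    ((A + B) ∸ i) ∸ j ≡⟨ cong (_∸ j) (ℕP.+-∸-comm B i≤) ⟩
    ((A ∸ i) + B) ∸ j ≡⟨ ℕP.+-∸-assoc (A ∸ i) j≤ ⟩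
    (A ∸ i) + (B ∸ j) ∎
    where open ≡-Reasoning

  -- fdesStep on a sum of statistics is the sum of fapStep and apStep acting on
  -- the two summands (the "product rule" for the transfer operators).
  fdesStep-split : ∀ k l i j G → i ≤ 2 * k → j ≤ 2 * l →
    fdesStep (k + l) G (i + j) ≡ fapStep k (λ i' → G (i' + j)) i + apStep l (λ j' → G (i + j')) j
  fdesStep-split k l i j G i≤ j≤
    rewrite ℕP.*-distribˡ-+ 2 k l | ∸-split (2 * k) (2 * l) i j i≤ j≤ | ℕP.+-suc i (suc j) | ℕP.+-suc i j =
    solve i j (G (i + j)) (G (suc (i + j))) (G (suc (suc (i + j)))) (2 * k ∸ i) (2 * l ∸ j)
    where
    solve : ∀ i j x y z p q → suc (i + j) * x + y + (p + q) * z ≡ i * x + y + p * z + (suc j * x + q * z)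
    solve = solve-∀

  doubleSum : ℕ → ℕ → (ℕ → ℕ) → ℕ
  doubleSum k l G = sumOf (λ σ → sumOf (λ τ → G (fap σ + 2 * ap τ)) (𝒬 l)) (𝒬 k)

  doubleSum-step : ∀ k l G → doubleSum k l (fdesStep (k + l) G) ≡ doubleSum (suc k) l G + doubleSum k (suc l) G
  doubleSum-step k l G = begin
    doubleSum k l (fdesStep (k + l) G)
      ≡⟨ sumOf-cong-∈ _ _ (𝒬 k) (λ σ mσ → sumOf-cong-∈ _ _ (𝒬 l) (λ τ mτ →
           fdesStep-split k l (fap σ) (2 * ap τ) G (fap≤2n k σ mσ) (2ap≤2n l τ mτ))) ⟩
    sumOf (λ σ → sumOf (λ τ → fapStep k (λ i' → G (i' + 2 * ap τ)) (fap σ) + apStep l (λ j' → G (fap σ + j')) (2 * ap τ)) (𝒬 l)) (𝒬 k)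
      ≡⟨ trans (sumOf-cong-∈ _ _ (𝒬 k) (λ σ _ → sumOf-+ _ _ (𝒬 l))) (sumOf-+ _ _ (𝒬 k)) ⟩
    sumOf (λ σ → sumOf (λ τ → fapStep k (λ i' → G (i' + 2 * ap τ)) (fap σ)) (𝒬 l)) (𝒬 k)
      + sumOf (λ σ → sumOf (λ τ → apStep l (λ j' → G (fap σ + j')) (2 * ap τ)) (𝒬 l)) (𝒬 k)
      ≡⟨ cong₂ _+_ fapSide apSide ⟩
    doubleSum (suc k) l G + doubleSum k (suc l) G ∎
    where
    open ≡-Reasoning
    fapSide : sumOf (λ σ → sumOf (λ τ → fapStep k (λ i' → G (i' + 2 * ap τ)) (fap σ)) (𝒬 l)) (𝒬 k) ≡ doubleSum (suc k) l G
    fapSide = trans (sumOf-swap _ (𝒬 k) (𝒬 l))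
      (trans (sumOf-cong-∈ _ _ (𝒬 l) (λ τ _ → sym (fap-recurrence k (λ i' → G (i' + 2 * ap τ)))))
             (sym (sumOf-swap (λ σ τ → G (fap σ + 2 * ap τ)) (𝒬 (suc k)) (𝒬 l))))
    apSide : sumOf (λ σ → sumOf (λ τ → apStep l (λ j' → G (fap σ + j')) (2 * ap τ)) (𝒬 l)) (𝒬 k) ≡ doubleSum k (suc l) G
    apSide = sumOf-cong-∈ _ _ (𝒬 k) (λ σ _ → sym (ap-recurrence l (λ j' → G (fap σ + j'))))

  pascal : ∀ n (Y : ℕ → ℕ) →
    sumBelow (suc n) (λ k → (n C k) * (Y (suc k) + Y k)) ≡ sumBelow (suc (suc n)) (λ k → (suc n C k) * Y k)
  pascal n Y = begin
    sumBelow (suc n) (λ k → (n C k) * (Y (suc k) + Y k))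
      ≡⟨ trans (sumBelow-cong (suc n) (λ k _ → ℕP.*-distribˡ-+ (n C k) (Y (suc k)) (Y k)))
               (sumBelow-+ (suc n) (λ k → (n C k) * Y (suc k)) (λ k → (n C k) * Y k)) ⟩
    sumBelow (suc n) (λ k → (n C k) * Y (suc k)) + sumBelow (suc n) (λ k → (n C k) * Y k)
      ≡⟨ cong (sumBelow (suc n) (λ k → (n C k) * Y (suc k)) +_) shiftIndex ⟩
    sumBelow (suc n) (λ k → (n C k) * Y (suc k)) + (Y 0 + sumBelow (suc n) (λ k → (n C suc k) * Y (suc k)))
      ≡⟨ swap (sumBelow (suc n) (λ k → (n C k) * Y (suc k))) (Y 0) _ ⟩
    Y 0 + (sumBelow (suc n) (λ k → (n C k) * Y (suc k)) + sumBelow (suc n) (λ k → (n C suc k) * Y (suc k)))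
      ≡⟨ cong (Y 0 +_) (trans (sym (sumBelow-+ (suc n) (λ k → (n C k) * Y (suc k)) (λ k → (n C suc k) * Y (suc k))))
           (sumBelow-cong (suc n) (λ k _ → trans (sym (ℕP.*-distribʳ-+ (Y (suc k)) (n C k) (n C suc k)))
                                                 (cong (_* Y (suc k)) (nCk+nC[k+1]≡[n+1]C[k+1] n k))))) ⟩
    Y 0 + sumBelow (suc n) (λ k → (suc n C suc k) * Y (suc k))
      ≡⟨ cong (_+ sumBelow (suc n) (λ k → (suc n C suc k) * Y (suc k))) (ℕP.*-identityˡ (Y 0)) ⟨
    sumBelow (suc (suc n)) (λ k → (suc n C k) * Y k) ∎
    where
    open ≡-Reasoning
    swap : ∀ a b c → a + (b + c) ≡ b + (a + c)
    swap = solve-∀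
    -- the k = 0 term is split off; the new last term C(n, n+1) vanishes
    shiftIndex : sumBelow (suc n) (λ k → (n C k) * Y k) ≡ Y 0 + sumBelow (suc n) (λ k → (n C suc k) * Y (suc k))
    shiftIndex = begin
      sumBelow (suc n) (λ k → (n C k) * Y k)
        ≡⟨ cong (_+ sumBelow n (λ k → (n C suc k) * Y (suc k))) (ℕP.*-identityˡ (Y 0)) ⟩
      Y 0 + sumBelow n (λ k → (n C suc k) * Y (suc k))
        ≡⟨ cong (Y 0 +_) (sym (trans (sumBelow-last n (λ k → (n C suc k) * Y (suc k)))
             (trans (cong (λ t → sumBelow n (λ k → (n C suc k) * Y (suc k)) + t * Y (suc n)) (k>n⇒nCk≡0 (ℕP.n<1+n n)))
                    (ℕP.+-identityʳ _)))) ⟩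
      Y 0 + sumBelow (suc n) (λ k → (n C suc k) * Y (suc k)) ∎

  convolution : ℕ → (ℕ → ℕ) → ℕ
  convolution n G = sumBelow (suc n) (λ k → (n C k) * doubleSum k (n ∸ k) G)

  convolution-step : ∀ n G → convolution n (fdesStep n G) ≡ convolution (suc n) G
  convolution-step n G = trans
    (sumBelow-cong (suc n) (λ k k< → cong ((n C k) *_) (begin
      doubleSum k (n ∸ k) (fdesStep n G)
        ≡⟨ cong (λ t → doubleSum k (n ∸ k) (fdesStep t G)) (sym (ℕP.m+[n∸m]≡n (ℕP.<⇒≤pred k<))) ⟩
      doubleSum k (n ∸ k) (fdesStep (k + (n ∸ k)) G)
        ≡⟨ doubleSum-step k (n ∸ k) G ⟩
      doubleSum (suc k) (n ∸ k) G + doubleSum k (suc (n ∸ k)) G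
        ≡⟨ cong (λ t → doubleSum (suc k) (n ∸ k) G + doubleSum k t G) (sym (ℕP.+-∸-assoc 1 (ℕP.<⇒≤pred k<))) ⟩
      doubleSum (suc k) (suc n ∸ suc k) G + doubleSum k (suc n ∸ k) G ∎)))
    (pascal n (λ k → doubleSum k (suc n ∸ k) G))
    where open ≡-Reasoning

  fdes-convolution : ∀ n G → sumOf (λ π → G (fdes π)) (B n) ≡ convolution n G
  fdes-convolution zero    G = solve (G 0)
    where
    solve : ∀ x → x + 0 ≡ 1 * (x + 0 + 0) + 0
    solve = solve-∀
  fdes-convolution (suc n) G =
    trans (fdes-recurrence n G) (trans (fdes-convolution n (fdesStep n G)) (convolution-step n G))

module EulerianIdentity where

  open import Defs
  open NatFacts using (ind; fromℕ-*)
  open FiniteSums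
  open Polynomials
  open NatPoly
  open Convolution using (doubleSum; fdes-convolution)
  open import Data.Bool using (_∧_)
  open import Data.Nat as ℕ using (ℕ; suc; _+_; _*_; _∸_; _≡ᵇ_)
  import Data.Nat.Properties as ℕP
  open import Data.Nat.Combinatorics using (_C_)
  open import Data.Rational as ℚ using ()
  open import Data.List using (List; []; _∷_; map; concatMap; upTo)
  import Data.List.Properties as LP
  open import Data.Product using (_,_)
  open import Relation.Binary.PropositionalEquality

  -- Part two of the theorem as an identity of polynomials in x: compare the
  -- coefficients of x^a y^b z^c on both sides, which reduces it to
  -- fdes-convolution for the test function "exponent equals a".

  module _ (a b c : ℕ) where

    xCoeff : ℕ → ℕ
    xCoeff j = ind ((a ≡ᵇ j) ∧ (b ≡ᵇ 0) ∧ (c ≡ᵇ 0))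

    xCoeff-term : ∀ j → 1 * xCoeff j + 0 ≡ xCoeff j
    xCoeff-term j = trans (ℕP.+-identityʳ _) (ℕP.*-identityˡ _)

    coeff-X^ : ∀ j → coeff (X ^^ j) a b c ≡ fromℕ (xCoeff j)
    coeff-X^ j rewrite X^ j = trans (coeff≅ (monomial≅ j 0 0) a b c) (cong fromℕ (xCoeff-term j))

    coeff-ΣX^ : ∀ {A : Set} (s : A → ℕ) L → coeff (ΣP (map (λ x → X ^^ s x) L)) a b c ≡ fromℕ (sumOf (λ x → xCoeff (s x)) L)
    coeff-ΣX^ s L = begin
      coeff (ΣP (map (λ x → X ^^ s x) L)) a b c
        ≡⟨ coeff-ΣP (map (λ x → X ^^ s x) L) a b c ⟩
      sumℚ (map (λ p → coeff p a b c) (map (λ x → X ^^ s x) L))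
        ≡⟨ cong sumℚ (sym (LP.map-∘ {g = λ p → coeff p a b c} {f = λ x → X ^^ s x} L)) ⟩
      sumℚ (map (λ x → coeff (X ^^ s x) a b c) L)
        ≡⟨ sumℚ-cong (λ x → coeff-X^ (s x)) L ⟩
      sumℚ (map (λ x → fromℕ (xCoeff (s x))) L)
        ≡⟨ sumℚ-fromℕ (λ x → xCoeff (s x)) L ⟩
      fromℕ (sumOf (λ x → xCoeff (s x)) L) ∎
      where open ≡-Reasoning

    coeff-product : ∀ k l →
      coeff (ΣP (map (λ σ → X ^^ fap σ) (𝒬 k)) ⊗ ΣP (map (λ τ → X ^^ (2 * ap τ)) (𝒬 l))) a b c ≡ fromℕ (doubleSum k l xCoeff)
    coeff-product k l = trans (coeff-ΣP⊗ (λ σ → X ^^ fap σ) (𝒬 k) apPoly a b c)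
      (trans (sumℚ-cong perσ (𝒬 k)) (sumℚ-fromℕ (λ σ → sumOf (λ τ → xCoeff (fap σ + 2 * ap τ)) (𝒬 l)) (𝒬 k)))
      where
      apPoly : Poly
      apPoly = ΣP (map (λ τ → X ^^ (2 * ap τ)) (𝒬 l))
      apTerms : List ℕ → NatPoly
      apTerms τ = (1 , 2 * ap τ , 0 , 0) ∷ []
      apPoly≅ : apPoly ≅ concatMap apTerms (𝒬 l)
      apPoly≅ = ≅-ΣP (λ τ → X ^^ (2 * ap τ)) apTerms (𝒬 l)
        (λ τ → subst (_≅ apTerms τ) (sym (X^ (2 * ap τ))) (monomial≅ (2 * ap τ) 0 0))
      perσ : ∀ σ → coeff (X ^^ fap σ ⊗ apPoly) a b c ≡ fromℕ (sumOf (λ τ → xCoeff (fap σ + 2 * ap τ)) (𝒬 l))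
      perσ σ rewrite X^ (fap σ) = trans (coeff≅ (≅-monomial⊗ (fap σ) 0 0 apPoly≅) a b c)
        (cong fromℕ (trans (cong (λ s → coeffℕ s a b c) (shiftℕ-concatMap (fap σ) 0 0 apTerms (𝒬 l)))
          (trans (coeffℕ-concatMap (λ τ → shiftℕ (fap σ) 0 0 (apTerms τ)) (𝒬 l) a b c)
                 (sumOf-cong (λ τ → xCoeff-term (fap σ + 2 * ap τ)) (𝒬 l)))))

  eulerian-identity : ∀ n → ΣP (map (λ π → X ^^ fdes π) (B n))
         ≈ ΣP (map (λ k → scale (fromℕ (n C k))
                    (ΣP (map (λ σ → X ^^ fap σ) (𝒬 k))
                     ⊗ ΣP (map (λ σ → X ^^ (2 * ap σ)) (𝒬 (n ∸ k)))))
                   (upTo (suc n)))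
  eulerian-identity n a b c = begin
    coeff (ΣP (map (λ π → X ^^ fdes π) (B n))) a b c
      ≡⟨ coeff-ΣX^ a b c fdes (B n) ⟩
    fromℕ (sumOf (λ π → xCoeff a b c (fdes π)) (B n))
      ≡⟨ cong fromℕ (trans (fdes-convolution n (xCoeff a b c)) (sym (sumOf-applyUpTo summand (λ k → k) (suc n)))) ⟩
    fromℕ (sumOf summand (upTo (suc n)))
      ≡⟨ sumℚ-fromℕ summand (upTo (suc n)) ⟨
    sumℚ (map (λ k → fromℕ (summand k)) (upTo (suc n)))
      ≡⟨ sumℚ-cong (λ k → sym (termCoeff k)) (upTo (suc n)) ⟩
    sumℚ (map (λ k → coeff (term k) a b c) (upTo (suc n)))
      ≡⟨ cong sumℚ (LP.map-∘ {g = λ p → coeff p a b c} {f = term} (upTo (suc n))) ⟩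
    sumℚ (map (λ p → coeff p a b c) (map term (upTo (suc n))))
      ≡⟨ coeff-ΣP (map term (upTo (suc n))) a b c ⟨
    coeff (ΣP (map term (upTo (suc n)))) a b c ∎
    where
    open ≡-Reasoning
    term : ℕ → Poly
    term k = scale (fromℕ (n C k)) (ΣP (map (λ σ → X ^^ fap σ) (𝒬 k)) ⊗ ΣP (map (λ σ → X ^^ (2 * ap σ)) (𝒬 (n ∸ k))))
    summand : ℕ → ℕ
    summand k = (n C k) * doubleSum k (n ∸ k) (xCoeff a b c)
    termCoeff : ∀ k → coeff (term k) a b c ≡ fromℕ (summand k)
    termCoeff k = trans (coeff-scale (fromℕ (n C k)) (ΣP (map (λ σ → X ^^ fap σ) (𝒬 k)) ⊗ ΣP (map (λ σ → X ^^ (2 * ap σ)) (𝒬 (n ∸ k)))) a b c)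
      (trans (cong (fromℕ (n C k) ℚ.*_) (coeff-product a b c k (n ∸ k))) (sym (fromℕ-* (n C k) (doubleSum k (n ∸ k) (xCoeff a b c)))))

-- Both identities hold for every n.
mainTheorem1 : (D : Poly → Poly) → IsTheDerivation D → (n : ℕ) → 1 Data.Nat.≤ n →
    (iterate D n X ≈ X ⊗ ΣP (map (λ σ → (Y ^^ fap σ) ⊗ (Z ^^ (2 * n ∸ fap σ))) (𝒬 n)))
    × (ΣP (map (λ π → X ^^ fdes π) (B n))
       ≈ ΣP (map (λ k → scale (fromℕ (n C k))
                  (ΣP (map (λ σ → X ^^ fap σ) (𝒬 k))
                   ⊗ ΣP (map (λ σ → X ^^ (2 * ap σ)) (𝒬 (n ∸ k)))))
                 (upTo (suc n))))
mainTheorem1 D isD n _ = DerivationFormula.derivative-formula D isD n , EulerianIdentity.eulerian-identity n
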